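{- For all integers $j\ge 0$ and $q\ge 1$, with $c_0=2$ and $c_n=1$ for $n>0$, \[ F^{(q)}_{j+1}=\frac{(-1)^{q+1}\sqrt{\pi}}{\Gamma\!\left(q+\frac12\right)}\sum_{m=0}^{\left\lfloor j/2\right\rfloor}\frac{1}{c_{j-2m}}\binom{j-m}{j-2m}2^{ -j+2m-q+1}(j-2m)^2\,(j-2m+1)_{q-1}\,(-j+2m+1)_{q-1}\;{}_{2}F_{1}\!\left(\begin{matrix}-m,\ j-m+1\\ j-2m+1\end{matrix}\,\Big|\,-\tfrac14\right), \] and \[ F^{(q)}_{j+1}=\frac{(-1)^{q+1}\sqrt{\pi}}{2^{j+q+1}\,\Gamma\!\left(q+\frac32\right)}\sum_{m=0}^{\left\lfloor j/2\right\rfloor}\binom{j}{m}\frac{(j-2m)(j-2m+1)^2(j-2m+2)}{j-m+1}\,(-j+2m+1)_{q-1}\,(j-2m+3)_{q-1}\;{}_{2}F_{1}\!\left(\begin{matrix}-m,\ -j+m-1\\ -j\end{matrix}\,\Big|\,-4\right). \]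
   Context: The Fibonacci polynomials are defined by $F_0(x)=0$, $F_1(x)=1$, $F_{n+2}(x)=xF_{n+1}(x)+F_n(x)$; $F^{(q)}_n=\frac{d^q}{dx^q}F_n(x)\big|_{x=1}$. $(a)_k=a(a+1)\cdots(a+k-1)$ with $(a)_0=1$. For a nonnegative integer $m$, ${}_2F_1\!\left(\begin{smallmatrix}-m,\ b\\ c\end{smallmatrix}\big|z\right)=\sum_{k=0}^{m}\frac{(-m)_k(b)_k}{(c)_k\,k!}z^k$. -}

module Defs where

open import Data.Nat as ℕ using (ℕ; zero; suc; ⌊_/2⌋; _!)
open import Data.Nat.Combinatorics using (_C_)
open import Data.Integer as ℤ using (ℤ)
open import Data.List using (List; []; _∷_)
open import Data.Rational using (ℚ; 0ℚ; 1ℚ; ½; _+_; _*_; -_; _/_; 1/_; ≢-nonZero)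
open import Data.Rational.Properties using (_≟_)
open import Relation.Nullary using (yes; no)

-- Polynomials with natural-number coefficients, as coefficient lists
-- (constant term first).

Poly : Set
Poly = List ℕ

infixl 6 _⊕_
_⊕_ : Poly → Poly → Poly
[]      ⊕ q       = q
(a ∷ p) ⊕ []      = a ∷ p
(a ∷ p) ⊕ (b ∷ q) = (a ℕ.+ b) ∷ (p ⊕ q)

X* : Poly → Poly
X* p = 0 ∷ p

derivAux : ℕ → Poly → Poly
derivAux k []      = []
derivAux k (b ∷ p) = (k ℕ.* b) ∷ derivAux (suc k) p

deriv : Poly → Poly
deriv []      = []
deriv (a ∷ p) = derivAux 1 p

derivN : ℕ → Poly → Poly
derivN zero    p = p
derivN (suc q) p = deriv (derivN q p)

eval1 : Poly → ℕ
eval1 []      = 0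
eval1 (a ∷ p) = a ℕ.+ eval1 p

fibPoly : ℕ → Poly
fibPoly zero          = []
fibPoly (suc zero)    = 1 ∷ []
fibPoly (suc (suc n)) = X* (fibPoly (suc n)) ⊕ fibPoly n

fibD : ℕ → ℕ → ℕ
fibD q n = eval1 (derivN q (fibPoly n))

ι : ℕ → ℚ
ι n = ℤ.+ n / 1

-- total inverse, with the convention inv 0 = 0 (only ever applied to
-- nonzero values in the statement)
inv : ℚ → ℚ
inv p with p ≟ 0ℚ
... | yes _  = 0ℚ
... | no p≢0 = 1/_ p {{≢-nonZero p≢0}}

infixl 7 _÷_
_÷_ : ℚ → ℚ → ℚ
p ÷ q = p * inv q

infixr 8 _^_
_^_ : ℚ → ℕ → ℚ
p ^ zero  = 1ℚ
p ^ suc n = p * (p ^ n)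

poch : ℚ → ℕ → ℚ
poch a zero    = 1ℚ
poch a (suc k) = poch a k * (a + ι k)

sumTo : ℕ → (ℕ → ℚ) → ℚ
sumTo zero    f = f 0
sumTo (suc N) f = sumTo N f + f (suc N)

-- terminating hypergeometric 2F1(-m, b; c | z), m a nonnegative integer
hyp2F1 : ℕ → ℚ → ℚ → ℚ → ℚ
hyp2F1 m b c z =
  sumTo m (λ k → (poch (- ι m) k * poch b k) ÷ (poch c k * ι (k !)) * z ^ k)

cc : ℕ → ℚ
cc zero    = ι 2
cc (suc _) = 1ℚ

-- √π / Γ(q + 1/2) = 1 / (1/2)_q   (since Γ(q+1/2) = (1/2)_q Γ(1/2), Γ(1/2) = √π)
sqrtPiOverGammaHalf : ℕ → ℚ
sqrtPiOverGammaHalf q = inv (poch ½ q)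

-- √π / Γ(q + 3/2) = 1 / (1/2)_{q+1}
sqrtPiOverGammaThreeHalves : ℕ → ℚ
sqrtPiOverGammaThreeHalves q = inv (poch ½ (suc q))

rhs1 : ℕ → ℕ → ℚ
rhs1 j q =
  (- 1ℚ) ^ suc q * sqrtPiOverGammaHalf q *
  sumTo ⌊ j /2⌋ (λ m →
    inv (cc (j ℕ.∸ 2 ℕ.* m))
    * ι ((j ℕ.∸ m) C (j ℕ.∸ 2 ℕ.* m))
    -- 2^{-j+2m-q+1} = 2^{2m+1} / 2^{j+q}
    * (ι 2 ^ (2 ℕ.* m ℕ.+ 1) ÷ ι 2 ^ (j ℕ.+ q))
    * ι (j ℕ.∸ 2 ℕ.* m) ^ 2
    * poch (ι (j ℕ.∸ 2 ℕ.* m ℕ.+ 1)) (q ℕ.∸ 1)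
    * poch (- ι j + ι (2 ℕ.* m ℕ.+ 1)) (q ℕ.∸ 1)
    * hyp2F1 m (ι (j ℕ.∸ m ℕ.+ 1)) (ι (j ℕ.∸ 2 ℕ.* m ℕ.+ 1)) (- (1ℚ ÷ ι 4)))

rhs2 : ℕ → ℕ → ℚ
rhs2 j q =
  (- 1ℚ) ^ suc q * sqrtPiOverGammaThreeHalves q ÷ ι 2 ^ (j ℕ.+ q ℕ.+ 1) *
  sumTo ⌊ j /2⌋ (λ m →
    ι (j C m)
    * (ι (j ℕ.∸ 2 ℕ.* m) * ι (j ℕ.∸ 2 ℕ.* m ℕ.+ 1) ^ 2 * ι (j ℕ.∸ 2 ℕ.* m ℕ.+ 2)
        ÷ ι (j ℕ.∸ m ℕ.+ 1))
    * poch (- ι j + ι (2 ℕ.* m ℕ.+ 1)) (q ℕ.∸ 1)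
    * poch (ι (j ℕ.∸ 2 ℕ.* m ℕ.+ 3)) (q ℕ.∸ 1)
    * hyp2F1 m (- ι j + ι m + - 1ℚ) (- ι j) (- ι 4))

-- Expanding Fⱼ₊₁(x) = Σᵢ (j − i choose i) x^(j−2i) gives F⁽q⁾ⱼ₊₁(1) = Σᵢ (j − i choose i) (j − 2i)⁽q⁾, a sum of
-- falling factorials. On the right-hand sides, exchanging the sum over m with the hypergeometric sum over k and
-- grouping the terms by i = m − k (first formula) or i = k (second formula) leaves, for each i, the coefficient
-- (j − i choose i) times a half sum over l of binomially weighted values at 1 of the q-th derivatives of the
-- Chebyshev polynomials T (resp. U) of degree p − 2l, p = j − 2i. By the symmetry l ↔ p − l these half sums are
-- full binomial transforms Σₗ (p choose l) g(p − 2l), and Pascal's rule turns the three-term recurrence of the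
-- Chebyshev polynomials into a recurrence in p showing that they equal 2ᵖ (2q − 1)!! p⁽q⁾ (resp. 2ᵖ (2q + 1)!! p⁽q⁾),
-- up to the normalising factors. Hence both right-hand sides agree with the left-hand side term by term.

module Submission where

open import Defs
open import Data.Nat using (ℕ; suc; _≤_)
open import Data.Product using (_×_)
open import Relation.Binary.PropositionalEquality using (_≡_)

open import Data.Nat as ℕ using (zero; _<_; z≤n; s≤s; ⌊_/2⌋; _!)
import Data.Nat.Properties as ℕP
open import Data.Nat.Combinatorics using (_C_; nCk+nC[k+1]≡[n+1]C[k+1]; k>n⇒nCk≡0; nCk≡nC[n∸k]; nC1≡n)
import Data.Nat.Solver
import Data.Nat.Coprimality as Cop
import Data.Integer as ℤ
import Data.Integer.Properties as ℤP
import Data.Integer.Solver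
open import Data.List using ([]; _∷_)
open import Data.Empty using (⊥-elim)
open import Data.Sum using (_⊎_; inj₁; inj₂; [_,_]′)
open import Data.Product using (_,_)
open import Relation.Nullary using (Dec; yes; no)
open import Relation.Binary.PropositionalEquality
open ≡-Reasoning

module NS = Data.Nat.Solver.+-*-Solver
module ZS = Data.Integer.Solver.+-*-Solver

module _ where
  open import Data.Nat using (_+_; _*_; _∸_)
  open NS

  [1+k]*[1+n]C[1+k]≡[1+n]*nCk : ∀ n k → suc k * (suc n C suc k) ≡ suc n * (n C k)
  [1+k]*[1+n]C[1+k]≡[1+n]*nCk zero    zero    = refl
  [1+k]*[1+n]C[1+k]≡[1+n]*nCk zero    (suc k) = begin
    suc (suc k) * (1 C suc (suc k)) ≡⟨ cong (suc (suc k) *_) (k>n⇒nCk≡0 {1} {suc (suc k)} (s≤s (s≤s z≤n))) ⟩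
    suc (suc k) * 0                 ≡⟨ ℕP.*-zeroʳ (suc (suc k)) ⟩
    0                               ≡⟨ cong (1 *_) (k>n⇒nCk≡0 {0} {suc k} (s≤s z≤n)) ⟨
    1 * (0 C suc k)                 ∎
  [1+k]*[1+n]C[1+k]≡[1+n]*nCk (suc n) zero    =
    trans (ℕP.*-identityˡ _) (trans (nC1≡n (suc (suc n))) (sym (ℕP.*-identityʳ (suc (suc n)))))
  [1+k]*[1+n]C[1+k]≡[1+n]*nCk (suc n) (suc k) = begin
    suc (suc k) * (suc (suc n) C suc (suc k))
      ≡⟨ cong (suc (suc k) *_) (nCk+nC[k+1]≡[n+1]C[k+1] (suc n) (suc k)) ⟨
    suc (suc k) * (suc n C suc k + suc n C suc (suc k))
      ≡⟨ ℕP.*-distribˡ-+ (suc (suc k)) (suc n C suc k) _ ⟩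
    suc n C suc k + suc k * (suc n C suc k) + suc (suc k) * (suc n C suc (suc k))
      ≡⟨ cong₂ (λ x y → suc n C suc k + x + y) ([1+k]*[1+n]C[1+k]≡[1+n]*nCk n k) ([1+k]*[1+n]C[1+k]≡[1+n]*nCk n (suc k)) ⟩
    suc n C suc k + suc n * (n C k) + suc n * (n C suc k)
      ≡⟨ ℕP.+-assoc (suc n C suc k) _ _ ⟩
    suc n C suc k + (suc n * (n C k) + suc n * (n C suc k))
      ≡⟨ cong (suc n C suc k +_) (ℕP.*-distribˡ-+ (suc n) (n C k) (n C suc k)) ⟨
    suc n C suc k + suc n * (n C k + n C suc k)
      ≡⟨ cong (λ z → suc n C suc k + suc n * z) (nCk+nC[k+1]≡[n+1]C[k+1] n k) ⟩
    suc (suc n) * (suc n C suc k) ∎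

  nCk*k!*[n∸k]!≡n! : ∀ n k → k ≤ n → (n C k) * k ! * (n ∸ k) ! ≡ n !
  nCk*k!*[n∸k]!≡n! zero    zero    _         = refl
  nCk*k!*[n∸k]!≡n! (suc n) zero    _         = ℕP.+-identityʳ _
  nCk*k!*[n∸k]!≡n! (suc n) (suc k) (s≤s k≤n) = begin
    (suc n C suc k) * (suc k * k !) * (n ∸ k) !
      ≡⟨ solve 4 (λ c s f g → c :* (s :* f) :* g := (s :* c) :* f :* g) refl (suc n C suc k) (suc k) (k !) ((n ∸ k) !) ⟩
    suc k * (suc n C suc k) * k ! * (n ∸ k) !
      ≡⟨ cong (λ z → z * k ! * (n ∸ k) !) ([1+k]*[1+n]C[1+k]≡[1+n]*nCk n k) ⟩
    suc n * (n C k) * k ! * (n ∸ k) !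
      ≡⟨ solve 4 (λ s c f g → s :* c :* f :* g := s :* (c :* f :* g)) refl (suc n) (n C k) (k !) ((n ∸ k) !) ⟩
    suc n * ((n C k) * k ! * (n ∸ k) !)
      ≡⟨ cong (suc n *_) (nCk*k!*[n∸k]!≡n! n k k≤n) ⟩
    suc n ! ∎

  [m+n]Cm*m!*n!≡[m+n]! : ∀ m n → ((m + n) C m) * m ! * n ! ≡ (m + n) !
  [m+n]Cm*m!*n!≡[m+n]! m n = begin
    ((m + n) C m) * m ! * n !           ≡⟨ cong (λ z → ((m + n) C m) * m ! * z !) (ℕP.m+n∸m≡n m n) ⟨
    ((m + n) C m) * m ! * (m + n ∸ m) ! ≡⟨ nCk*k!*[n∸k]!≡n! (m + n) m (ℕP.m≤m+n m n) ⟩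
    (m + n) !                           ∎

  fallingℕ : ℕ → ℕ → ℕ
  fallingℕ m zero    = 1
  fallingℕ m (suc l) = fallingℕ m l * (m ∸ l)

  risingℕ : ℕ → ℕ → ℕ
  risingℕ c zero    = 1
  risingℕ c (suc l) = risingℕ c l * (c + l)

  fallingℕ*[m∸l]!≡m! : ∀ m l → l ≤ m → fallingℕ m l * (m ∸ l) ! ≡ m !
  fallingℕ*[m∸l]!≡m! m zero    _   = ℕP.+-identityʳ _
  fallingℕ*[m∸l]!≡m! m (suc l) l<m = begin
    fallingℕ m l * (m ∸ l) * (m ∸ suc l) !   ≡⟨ ℕP.*-assoc (fallingℕ m l) (m ∸ l) _ ⟩
    fallingℕ m l * ((m ∸ l) * (m ∸ suc l) !) ≡⟨ cong (λ z → fallingℕ m l * (z * (m ∸ suc l) !)) m∸l≡1+m∸1+l ⟩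
    fallingℕ m l * (suc (m ∸ suc l)) !       ≡⟨ cong (λ z → fallingℕ m l * z !) m∸l≡1+m∸1+l ⟨
    fallingℕ m l * (m ∸ l) !                 ≡⟨ fallingℕ*[m∸l]!≡m! m l (ℕP.<⇒≤ l<m) ⟩
    m !                                      ∎
    where
    m∸l≡1+m∸1+l : m ∸ l ≡ suc (m ∸ suc l)
    m∸l≡1+m∸1+l = ℕP.+-∸-assoc 1 l<m

  risingℕ*c!≡[c+l]! : ∀ c l → risingℕ (suc c) l * c ! ≡ (c + l) !
  risingℕ*c!≡[c+l]! c zero    = trans (ℕP.+-identityʳ _) (cong _! (sym (ℕP.+-identityʳ c)))
  risingℕ*c!≡[c+l]! c (suc l) = begin
    risingℕ (suc c) l * (suc c + l) * c ! ≡⟨ solve 3 (λ r s f → r :* s :* f := s :* (r :* f)) refl (risingℕ (suc c) l) (suc c + l) (c !) ⟩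
    (suc c + l) * (risingℕ (suc c) l * c !) ≡⟨ cong ((suc c + l) *_) (risingℕ*c!≡[c+l]! c l) ⟩
    (suc c + l) * (c + l) !                 ≡⟨ cong _! (ℕP.+-suc c l) ⟨
    (c + suc l) !                           ∎

  n!≢0 : ∀ n → n ! ≢ 0
  n!≢0 n n!≡0 = ℕP.<⇒≢ (ℕP.1≤n! n) (sym n!≡0)

  m!*n!≢0 : ∀ m n → m ! * n ! ≢ 0
  m!*n!≢0 m n e = [ n!≢0 m , n!≢0 n ]′ (ℕP.m*n≡0⇒m≡0∨n≡0 (m !) e)

  risingℕ≢0 : ∀ c l → risingℕ (suc c) l ≢ 0
  risingℕ≢0 c l e = n!≢0 (c + l) (trans (sym (risingℕ*c!≡[c+l]! c l)) (cong (_* c !) e))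

  fallingℕ≢0 : ∀ m l → l ≤ m → fallingℕ m l ≢ 0
  fallingℕ≢0 m l l≤m e = n!≢0 m (trans (sym (fallingℕ*[m∸l]!≡m! m l l≤m)) (cong (_* (m ∸ l) !) e))

  *-cancelʳ-≢0 : ∀ x y z → z ≢ 0 → x * z ≡ y * z → x ≡ y
  *-cancelʳ-≢0 x y z z≢0 = ℕP.*-cancelʳ-≡ x y z {{ℕ.≢-nonZero z≢0}}

  -- Both sides, multiplied by a! n!, equal (a + n + 2l)!.
  coefficient-identityᵀ : ∀ a n l →
    ((a + (n + l)) C a) * fallingℕ (n + l) l * risingℕ (suc (a + (n + l))) l
      ≡ ((n + (l + (a + l))) C n) * ((l + (a + l)) C l) * risingℕ (suc a) l * l !
  coefficient-identityᵀ a n l = *-cancelʳ-≢0 _ _ (a ! * n !) (m!*n!≢0 a n) (begin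
    ((a + m) C a) * fallingℕ m l * risingℕ (suc (a + m)) l * (a ! * n !)
      ≡⟨ solve 5 (λ c f r A N → c :* f :* r :* (A :* N) := (c :* A :* (f :* N)) :* r) refl ((a + m) C a) (fallingℕ m l) (risingℕ (suc (a + m)) l) (a !) (n !) ⟩
    ((a + m) C a) * a ! * (fallingℕ m l * n !) * risingℕ (suc (a + m)) l
      ≡⟨ cong (λ z → ((a + m) C a) * a ! * (fallingℕ m l * z !) * risingℕ (suc (a + m)) l) (ℕP.m+n∸n≡m n l) ⟨
    ((a + m) C a) * a ! * (fallingℕ m l * (m ∸ l) !) * risingℕ (suc (a + m)) l
      ≡⟨ cong (λ z → ((a + m) C a) * a ! * z * risingℕ (suc (a + m)) l) (fallingℕ*[m∸l]!≡m! m l (ℕP.m≤n+m l n)) ⟩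
    ((a + m) C a) * a ! * m ! * risingℕ (suc (a + m)) l
      ≡⟨ cong (_* risingℕ (suc (a + m)) l) ([m+n]Cm*m!*n!≡[m+n]! a m) ⟩
    (a + m) ! * risingℕ (suc (a + m)) l
      ≡⟨ trans (ℕP.*-comm ((a + m) !) _) (risingℕ*c!≡[c+l]! (a + m) l) ⟩
    (a + m + l) !
      ≡⟨ cong _! (solve 3 (λ a n l → a :+ (n :+ l) :+ l := n :+ (l :+ (a :+ l))) refl a n l) ⟩
    (n + p) !
      ≡⟨ [m+n]Cm*m!*n!≡[m+n]! n p ⟨
    ((n + p) C n) * n ! * p !
      ≡⟨ cong (((n + p) C n) * n ! *_) ([m+n]Cm*m!*n!≡[m+n]! l (a + l)) ⟨
    ((n + p) C n) * n ! * ((p C l) * l ! * (a + l) !)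
      ≡⟨ cong (λ z → ((n + p) C n) * n ! * ((p C l) * l ! * z)) (risingℕ*c!≡[c+l]! a l) ⟨
    ((n + p) C n) * n ! * ((p C l) * l ! * (risingℕ (suc a) l * a !))
      ≡⟨ solve 6 (λ c N pc L r A → c :* N :* (pc :* L :* (r :* A)) := c :* pc :* r :* L :* (A :* N)) refl ((n + p) C n) (n !) (p C l) (l !) (risingℕ (suc a) l) (a !) ⟩
    ((n + p) C n) * (p C l) * risingℕ (suc a) l * l ! * (a ! * n !) ∎)
    where
    m = n + l
    p = l + (a + l)

  -- Both sides, multiplied by l! (a + l + 1)!, equal (a + 2m)! (a + m + 1) (a + 2l + 1), where m = i + l.
  coefficient-identityᵁ : ∀ a i l →
    (((i + l) + (a + (i + l))) C (i + l)) * fallingℕ (i + l) i * fallingℕ (suc (a + (i + l))) i * suc (l + (a + l))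
      ≡ ((i + (l + (a + l))) C i) * (suc (l + (a + l)) C l) * suc (a + (i + l)) * fallingℕ ((i + l) + (a + (i + l))) i * i !
  coefficient-identityᵁ a i l = *-cancelʳ-≢0 _ _ (l ! * r !) (m!*n!≢0 l r) (begin
    (j C m) * fallingℕ m i * fallingℕ (suc (a + m)) i * suc p * (l ! * r !)
      ≡⟨ solve 6 (λ c f g s L R → c :* f :* g :* s :* (L :* R) := c :* (f :* L) :* (g :* R) :* s) refl (j C m) (fallingℕ m i) (fallingℕ (suc (a + m)) i) (suc p) (l !) (r !) ⟩
    (j C m) * (fallingℕ m i * l !) * (fallingℕ (suc (a + m)) i * r !) * suc p
      ≡⟨ cong₂ (λ x y → (j C m) * x * y * suc p) falling-m falling-1+a+m ⟩
    (j C m) * m ! * (suc (a + m)) ! * suc p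
      ≡⟨ solve 5 (λ c M s f P → c :* M :* (s :* f) :* P := c :* M :* f :* s :* P) refl (j C m) (m !) (suc (a + m)) ((a + m) !) (suc p) ⟩
    (j C m) * m ! * (a + m) ! * suc (a + m) * suc p
      ≡⟨ cong (λ z → z * suc (a + m) * suc p) ([m+n]Cm*m!*n!≡[m+n]! m (a + m)) ⟩
    j ! * suc (a + m) * suc p
      ≡⟨ cong (λ z → z * suc (a + m) * suc p) (fallingℕ*[m∸l]!≡m! j i i≤j) ⟨
    fallingℕ j i * (j ∸ i) ! * suc (a + m) * suc p
      ≡⟨ cong (λ z → fallingℕ j i * z ! * suc (a + m) * suc p) j∸i≡i+p ⟩
    fallingℕ j i * (i + p) ! * suc (a + m) * suc p
      ≡⟨ cong (λ z → fallingℕ j i * z * suc (a + m) * suc p) ([m+n]Cm*m!*n!≡[m+n]! i p) ⟨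
    fallingℕ j i * (((i + p) C i) * i ! * p !) * suc (a + m) * suc p
      ≡⟨ solve 6 (λ f c I P s S → f :* (c :* I :* P) :* s :* S := c :* (S :* P) :* s :* f :* I) refl (fallingℕ j i) ((i + p) C i) (i !) (p !) (suc (a + m)) (suc p) ⟩
    ((i + p) C i) * (suc p) ! * suc (a + m) * fallingℕ j i * i !
      ≡⟨ cong (λ z → ((i + p) C i) * z * suc (a + m) * fallingℕ j i * i !) factorial-1+p ⟩
    ((i + p) C i) * ((suc p C l) * l ! * r !) * suc (a + m) * fallingℕ j i * i !
      ≡⟨ solve 7 (λ c d L R s f I → c :* (d :* L :* R) :* s :* f :* I := c :* d :* s :* f :* I :* (L :* R)) refl ((i + p) C i) (suc p C l) (l !) (r !) (suc (a + m)) (fallingℕ j i) (i !) ⟩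
    ((i + p) C i) * (suc p C l) * suc (a + m) * fallingℕ j i * i ! * (l ! * r !) ∎)
    where
    m = i + l
    j = m + (a + m)
    p = l + (a + l)
    r = suc (a + l)
    1+a+m≡i+r : suc (a + m) ≡ i + r
    1+a+m≡i+r = solve 3 (λ a i l → con 1 :+ (a :+ (i :+ l)) := i :+ (con 1 :+ (a :+ l))) refl a i l
    j≡i+[i+p] : j ≡ i + (i + p)
    j≡i+[i+p] = solve 3 (λ a i l → (i :+ l) :+ (a :+ (i :+ l)) := i :+ (i :+ (l :+ (a :+ l)))) refl a i l
    i≤j : i ≤ j
    i≤j = subst (i ≤_) (sym j≡i+[i+p]) (ℕP.m≤m+n i (i + p))
    j∸i≡i+p : j ∸ i ≡ i + p
    j∸i≡i+p = trans (cong (_∸ i) j≡i+[i+p]) (ℕP.m+n∸m≡n i (i + p))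
    falling-m : fallingℕ m i * l ! ≡ m !
    falling-m = trans (cong (λ z → fallingℕ m i * z !) (sym (ℕP.m+n∸m≡n i l))) (fallingℕ*[m∸l]!≡m! m i (ℕP.m≤m+n i l))
    falling-1+a+m : fallingℕ (suc (a + m)) i * r ! ≡ (suc (a + m)) !
    falling-1+a+m = trans (cong (λ z → fallingℕ (suc (a + m)) i * z !) (sym (trans (cong (_∸ i) 1+a+m≡i+r) (ℕP.m+n∸m≡n i r))))
                          (fallingℕ*[m∸l]!≡m! (suc (a + m)) i (subst (i ≤_) (sym 1+a+m≡i+r) (ℕP.m≤m+n i r)))
    factorial-1+p : (suc p) ! ≡ (suc p C l) * l ! * r !
    factorial-1+p = trans (cong _! 1+p≡l+r) (trans (sym ([m+n]Cm*m!*n!≡[m+n]! l r)) (cong (λ z → (z C l) * l ! * r !) (sym 1+p≡l+r)))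
      where
      1+p≡l+r : suc p ≡ l + r
      1+p≡l+r = solve 2 (λ a l → con 1 :+ (l :+ (a :+ l)) := l :+ (con 1 :+ (a :+ l))) refl a l

parity : ∀ n → n ≡ ⌊ n /2⌋ ℕ.+ ⌊ n /2⌋ ⊎ n ≡ suc (⌊ n /2⌋ ℕ.+ ⌊ n /2⌋)
parity zero          = inj₁ refl
parity (suc zero)    = inj₂ refl
parity (suc (suc n)) with parity n
... | inj₁ e = inj₁ (cong suc (trans (cong suc e) (sym (ℕP.+-suc ⌊ n /2⌋ ⌊ n /2⌋))))
... | inj₂ e = inj₂ (cong (λ z → suc (suc z)) (trans e (sym (ℕP.+-suc ⌊ n /2⌋ ⌊ n /2⌋))))

2*n≡n+n : ∀ n → 2 ℕ.* n ≡ n ℕ.+ n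
2*n≡n+n n = cong (n ℕ.+_) (ℕP.+-identityʳ n)

[1+n]+[1+n]≡2+[n+n] : ∀ n → suc n ℕ.+ suc n ≡ suc (suc (n ℕ.+ n))
[1+n]+[1+n]≡2+[n+n] n = cong suc (ℕP.+-suc n n)

l≤h⇒2l≤h+h : ∀ {l h} → l ≤ h → 2 ℕ.* l ≤ h ℕ.+ h
l≤h⇒2l≤h+h {l} {h} l≤h = subst (2 ℕ.* l ≤_) (2*n≡n+n h) (ℕP.*-monoʳ-≤ 2 l≤h)

n≤1+2⌊n/2⌋ : ∀ n → n ≤ suc (⌊ n /2⌋ ℕ.+ ⌊ n /2⌋)
n≤1+2⌊n/2⌋ n with parity n
... | inj₁ e = ℕP.≤-trans (ℕP.≤-reflexive e) (ℕP.n≤1+n _)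
... | inj₂ e = ℕP.≤-reflexive e

i≤⌊n/2⌋⇒2i≤n : ∀ n {i} → i ≤ ⌊ n /2⌋ → 2 ℕ.* i ≤ n
i≤⌊n/2⌋⇒2i≤n n i≤⌊n/2⌋ with parity n
... | inj₁ e = subst (_ ≤_) (sym e) (l≤h⇒2l≤h+h i≤⌊n/2⌋)
... | inj₂ e = subst (_ ≤_) (sym e) (ℕP.m≤n⇒m≤1+n (l≤h⇒2l≤h+h i≤⌊n/2⌋))

⌊n/2⌋<i⇒n∸i<i : ∀ n i → ⌊ n /2⌋ < i → n ℕ.∸ i < i
⌊n/2⌋<i⇒n∸i<i n (suc i) (s≤s ⌊n/2⌋≤i) = ℕP.m<n+o⇒m∸n<o n (suc i) (s≤s (ℕP.≤-trans (n≤1+2⌊n/2⌋ n)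
  (subst (suc (⌊ n /2⌋ ℕ.+ ⌊ n /2⌋) ≤_) (sym (ℕP.+-suc i i)) (s≤s (ℕP.+-mono-≤ ⌊n/2⌋≤i ⌊n/2⌋≤i)))))

⌊n∸2i/2⌋≡⌊n/2⌋∸i : ∀ n i → 2 ℕ.* i ≤ n → ⌊ (n ℕ.∸ 2 ℕ.* i) /2⌋ ≡ ⌊ n /2⌋ ℕ.∸ i
⌊n∸2i/2⌋≡⌊n/2⌋∸i n             zero    _     = refl
⌊n∸2i/2⌋≡⌊n/2⌋∸i zero          (suc i) ()
⌊n∸2i/2⌋≡⌊n/2⌋∸i (suc zero)    (suc i) 2i≤1 with subst (ℕ._≤ 1) (ℕP.*-suc 2 i) 2i≤1
... | s≤s ()
⌊n∸2i/2⌋≡⌊n/2⌋∸i (suc (suc n)) (suc i) 2i≤n = begin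
  ⌊ (suc (suc n) ℕ.∸ 2 ℕ.* suc i) /2⌋ ≡⟨ cong (λ z → ⌊ (suc (suc n) ℕ.∸ z) /2⌋) (ℕP.*-suc 2 i) ⟩
  ⌊ (n ℕ.∸ 2 ℕ.* i) /2⌋               ≡⟨ ⌊n∸2i/2⌋≡⌊n/2⌋∸i n i (ℕP.≤-pred (ℕP.≤-pred (subst (ℕ._≤ suc (suc n)) (ℕP.*-suc 2 i) 2i≤n))) ⟩
  ⌊ n /2⌋ ℕ.∸ i                       ∎

open import Data.Rational as Q using (ℚ; mkℚ; 0ℚ; 1ℚ; ½; _+_; _*_; -_; _-_; ↥_)
import Data.Rational.Properties as QP
import Data.Rational.Unnormalised as U
import Data.Rational.Unnormalised.Properties as UP
open import Data.Rational.Solver using (module +-*-Solver)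

ι≡mkℚ : ∀ n → ι n ≡ mkℚ (ℤ.+ n) 0 (Cop.sym (Cop.1-coprimeTo n))
ι≡mkℚ n = QP.↥p/↧p≡p (mkℚ (ℤ.+ n) 0 (Cop.sym (Cop.1-coprimeTo n)))

ι-suc : ∀ n → ι (suc n) ≡ 1ℚ + ι n
ι-suc n = QP.toℚᵘ-injective (UP.≃-trans (UP.≃-reflexive (cong Q.toℚᵘ (ι≡mkℚ (suc n))))
  (UP.≃-trans 1+n≃1+n (UP.≃-sym (UP.≃-trans (QP.toℚᵘ-homo-+ 1ℚ (ι n)) (UP.≃-reflexive (cong (λ z → Q.toℚᵘ 1ℚ U.+ Q.toℚᵘ z) (ι≡mkℚ n)))))))
  where
  open ZS
  1+n≃1+n : U.mkℚᵘ (ℤ.+ suc n) 0 U.≃ U.mkℚᵘ (ℤ.+ 1) 0 U.+ U.mkℚᵘ (ℤ.+ n) 0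
  1+n≃1+n = U.*≡* (solve 1 (λ x → (con (ℤ.+ 1) :+ x) :* (con (ℤ.+ 1) :* con (ℤ.+ 1)) := (con (ℤ.+ 1) :* con (ℤ.+ 1) :+ x :* con (ℤ.+ 1)) :* con (ℤ.+ 1)) refl (ℤ.+ n))

open +-*-Solver

ι-+ : ∀ m n → ι (m ℕ.+ n) ≡ ι m + ι n
ι-+ zero    n = sym (QP.+-identityˡ (ι n))
ι-+ (suc m) n = begin
  ι (suc (m ℕ.+ n)) ≡⟨ ι-suc (m ℕ.+ n) ⟩
  1ℚ + ι (m ℕ.+ n)  ≡⟨ cong (1ℚ +_) (ι-+ m n) ⟩
  1ℚ + (ι m + ι n)  ≡⟨ QP.+-assoc 1ℚ (ι m) (ι n) ⟨
  (1ℚ + ι m) + ι n  ≡⟨ cong (_+ ι n) (ι-suc m) ⟨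
  ι (suc m) + ι n   ∎

ι-* : ∀ m n → ι (m ℕ.* n) ≡ ι m * ι n
ι-* zero    n = sym (QP.*-zeroˡ (ι n))
ι-* (suc m) n = begin
  ι (n ℕ.+ m ℕ.* n) ≡⟨ trans (ι-+ n (m ℕ.* n)) (cong (ι n +_) (ι-* m n)) ⟩
  ι n + ι m * ι n   ≡⟨ solve 2 (λ a b → b :+ a :* b := (con 1ℚ :+ a) :* b) refl (ι m) (ι n) ⟩
  (1ℚ + ι m) * ι n  ≡⟨ cong (_* ι n) (ι-suc m) ⟨
  ι (suc m) * ι n   ∎

ι-∸ : ∀ m n → n ≤ m → ι (m ℕ.∸ n) ≡ ι m - ι n
ι-∸ m       zero    _         = solve 1 (λ a → a := a :- con 0ℚ) refl (ι m)
ι-∸ (suc m) (suc n) (s≤s n≤m) = begin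
  ι (m ℕ.∸ n)             ≡⟨ ι-∸ m n n≤m ⟩
  ι m - ι n               ≡⟨ solve 2 (λ a b → a :- b := (con 1ℚ :+ a) :- (con 1ℚ :+ b)) refl (ι m) (ι n) ⟩
  (1ℚ + ι m) - (1ℚ + ι n) ≡⟨ cong₂ _-_ (ι-suc m) (ι-suc n) ⟨
  ι (suc m) - ι (suc n)   ∎

ι-injective : ∀ {m n} → ι m ≡ ι n → m ≡ n
ι-injective {m} {n} eq = ℤP.+-injective (cong ↥_ (trans (sym (ι≡mkℚ m)) (trans eq (ι≡mkℚ n))))

ι-≢0 : ∀ n → n ≢ 0 → ι n ≢ 0ℚ
ι-≢0 n n≢0 eq = n≢0 (ι-injective eq)

ι-suc≢0 : ∀ n → ι (suc n) ≢ 0ℚ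
ι-suc≢0 n = ι-≢0 (suc n) (λ ())

two : ℚ
two = ι 2

two≡1+1 : two ≡ 1ℚ + 1ℚ
two≡1+1 = ι-suc 1

two≢0 : two ≢ 0ℚ
two≢0 = ι-suc≢0 1

two*x≡x+x : ∀ x → two * x ≡ x + x
two*x≡x+x x = trans (cong (_* x) two≡1+1) (solve 1 (λ a → (con 1ℚ :+ con 1ℚ) :* a := a :+ a) refl x)

ι-2* : ∀ n → ι (2 ℕ.* n) ≡ two * ι n
ι-2* n = ι-* 2 n

ι-∸-2* : ∀ p l → 2 ℕ.* l ≤ p → ι (p ℕ.∸ 2 ℕ.* l) ≡ ι p - two * ι l
ι-∸-2* p l 2l≤p = trans (ι-∸ p (2 ℕ.* l) 2l≤p) (cong (λ z → ι p - z) (ι-2* l))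

ι-1+2n : ∀ n → ι (suc (n ℕ.+ n)) ≡ 1ℚ + ι n + ι n
ι-1+2n n = trans (ι-suc (n ℕ.+ n)) (trans (cong (1ℚ +_) (ι-+ n n)) (sym (QP.+-assoc 1ℚ (ι n) (ι n))))

ι-2+2n : ∀ n → ι (suc n ℕ.+ suc n) ≡ two + ι n + ι n
ι-2+2n n = begin
  ι (suc n ℕ.+ suc n)         ≡⟨ cong ι ([1+n]+[1+n]≡2+[n+n] n) ⟩
  ι (suc (suc (n ℕ.+ n)))     ≡⟨ trans (ι-suc (suc (n ℕ.+ n))) (cong (1ℚ +_) (ι-1+2n n)) ⟩
  1ℚ + (1ℚ + ι n + ι n)       ≡⟨ solve 2 (λ a b → con 1ℚ :+ (con 1ℚ :+ a :+ b) := (con 1ℚ :+ con 1ℚ) :+ a :+ b) refl (ι n) (ι n) ⟩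
  (1ℚ + 1ℚ) + ι n + ι n       ≡⟨ cong (λ z → z + ι n + ι n) two≡1+1 ⟨
  two + ι n + ι n             ∎

a+b≡c⇒a≡c-b : ∀ a b c → a + b ≡ c → a ≡ c - b
a+b≡c⇒a≡c-b a b c e = trans (solve 2 (λ x y → x := (x :+ y) :- y) refl a b) (cong (_- b) e)

inv-inverseʳ : ∀ p → p ≢ 0ℚ → p * inv p ≡ 1ℚ
inv-inverseʳ p p≢0 with p QP.≟ 0ℚ
... | yes p≡0 = ⊥-elim (p≢0 p≡0)
... | no  p≢0 = QP.*-inverseʳ p {{Q.≢-nonZero p≢0}}

inv-cancelˡ : ∀ p x → p ≢ 0ℚ → inv p * (p * x) ≡ x
inv-cancelˡ p x p≢0 = begin
  inv p * (p * x) ≡⟨ solve 3 (λ a b c → a :* (b :* c) := (b :* a) :* c) refl (inv p) p x ⟩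
  p * inv p * x   ≡⟨ cong (_* x) (inv-inverseʳ p p≢0) ⟩
  1ℚ * x          ≡⟨ QP.*-identityˡ x ⟩
  x               ∎

*-cancelˡ-≢0 : ∀ p x y → p ≢ 0ℚ → p * x ≡ p * y → x ≡ y
*-cancelˡ-≢0 p x y p≢0 e = trans (sym (inv-cancelˡ p x p≢0)) (trans (cong (inv p *_) e) (inv-cancelˡ p y p≢0))

*-≢0 : ∀ p q → p ≢ 0ℚ → q ≢ 0ℚ → p * q ≢ 0ℚ
*-≢0 p q p≢0 q≢0 pq≡0 = q≢0 (*-cancelˡ-≢0 p q 0ℚ p≢0 (trans pq≡0 (sym (QP.*-zeroʳ p))))

inv-unique : ∀ p x → p * x ≡ 1ℚ → inv p ≡ x
inv-unique p x px≡1 = *-cancelˡ-≢0 p (inv p) x p≢0 (trans (inv-inverseʳ p p≢0) (sym px≡1))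
  where
  p≢0 : p ≢ 0ℚ
  p≢0 p≡0 = QP.1≢0 (trans (sym px≡1) (trans (cong (_* x) p≡0) (QP.*-zeroˡ x)))

inv-distrib-* : ∀ p q → inv (p * q) ≡ inv p * inv q
inv-distrib-* p q = by-cases (p QP.≟ 0ℚ) (q QP.≟ 0ℚ)
  where
  by-cases : Dec (p ≡ 0ℚ) → Dec (q ≡ 0ℚ) → inv (p * q) ≡ inv p * inv q
  by-cases (yes p≡0) _ = begin
    inv (p * q)    ≡⟨ cong (λ z → inv (z * q)) p≡0 ⟩
    inv (0ℚ * q)   ≡⟨ cong inv (QP.*-zeroˡ q) ⟩
    0ℚ             ≡⟨ QP.*-zeroˡ (inv q) ⟨
    inv 0ℚ * inv q ≡⟨ cong (λ z → inv z * inv q) p≡0 ⟨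
    inv p * inv q  ∎
  by-cases (no _) (yes q≡0) = begin
    inv (p * q)    ≡⟨ cong (λ z → inv (p * z)) q≡0 ⟩
    inv (p * 0ℚ)   ≡⟨ cong inv (QP.*-zeroʳ p) ⟩
    0ℚ             ≡⟨ QP.*-zeroʳ (inv p) ⟨
    inv p * inv 0ℚ ≡⟨ cong (λ z → inv p * inv z) q≡0 ⟨
    inv p * inv q  ∎
  by-cases (no p≢0) (no q≢0) = inv-unique (p * q) (inv p * inv q) (begin
    p * q * (inv p * inv q) ≡⟨ solve 4 (λ a b c d → (a :* c) :* (b :* d) := (a :* b) :* (c :* d)) refl p (inv p) q (inv q) ⟩
    p * inv p * (q * inv q) ≡⟨ cong₂ _*_ (inv-inverseʳ p p≢0) (inv-inverseʳ q q≢0) ⟩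
    1ℚ                      ∎)

^-distribˡ-+-* : ∀ x m n → x ^ (m ℕ.+ n) ≡ x ^ m * x ^ n
^-distribˡ-+-* x zero    n = sym (QP.*-identityˡ _)
^-distribˡ-+-* x (suc m) n = trans (cong (x *_) (^-distribˡ-+-* x m n)) (sym (QP.*-assoc x _ _))

^-distribʳ-* : ∀ x y n → (x * y) ^ n ≡ x ^ n * y ^ n
^-distribʳ-* x y zero    = refl
^-distribʳ-* x y (suc n) = trans (cong ((x * y) *_) (^-distribʳ-* x y n))
  (solve 4 (λ a b c d → (a :* b) :* (c :* d) := (a :* c) :* (b :* d)) refl x y (x ^ n) (y ^ n))

^-2* : ∀ x n → x ^ (2 ℕ.* n) ≡ (x * x) ^ n
^-2* x n = trans (cong (x ^_) (2*n≡n+n n)) (trans (^-distribˡ-+-* x n n) (sym (^-distribʳ-* x x n)))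

1^n≡1 : ∀ n → 1ℚ ^ n ≡ 1ℚ
1^n≡1 zero    = refl
1^n≡1 (suc n) = trans (QP.*-identityˡ _) (1^n≡1 n)

[-1]^n*[-1]^n≡1 : ∀ n → (- 1ℚ) ^ n * (- 1ℚ) ^ n ≡ 1ℚ
[-1]^n*[-1]^n≡1 n = trans (sym (^-distribʳ-* (- 1ℚ) (- 1ℚ) n)) (1^n≡1 n)

^-≢0 : ∀ x n → x ≢ 0ℚ → x ^ n ≢ 0ℚ
^-≢0 x zero    _   = QP.1≢0
^-≢0 x (suc n) x≢0 = *-≢0 x (x ^ n) x≢0 (^-≢0 x n x≢0)

two^n*inv-two^n≡1 : ∀ n → two ^ n * inv (two ^ n) ≡ 1ℚ
two^n*inv-two^n≡1 n = inv-inverseʳ (two ^ n) (^-≢0 two n two≢0)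

two^2n*inv4^n≡1 : ∀ n → two ^ (2 ℕ.* n) * inv (ι 4) ^ n ≡ 1ℚ
two^2n*inv4^n≡1 n = begin
  two ^ (2 ℕ.* n) * inv (ι 4) ^ n   ≡⟨ cong (_* inv (ι 4) ^ n) (^-2* two n) ⟩
  (two * two) ^ n * inv (ι 4) ^ n   ≡⟨ ^-distribʳ-* (ι 4) (inv (ι 4)) n ⟨
  (ι 4 * inv (ι 4)) ^ n             ≡⟨ 1^n≡1 n ⟩
  1ℚ                                ∎

sumTo-cong : ∀ N {f g : ℕ → ℚ} → (∀ i → i ≤ N → f i ≡ g i) → sumTo N f ≡ sumTo N g
sumTo-cong zero    f≗g = f≗g 0 z≤n
sumTo-cong (suc N) f≗g = cong₂ _+_ (sumTo-cong N (λ i i≤N → f≗g i (ℕP.m≤n⇒m≤1+n i≤N))) (f≗g (suc N) ℕP.≤-refl)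

sumTo-+ : ∀ N (f g : ℕ → ℚ) → sumTo N (λ i → f i + g i) ≡ sumTo N f + sumTo N g
sumTo-+ zero    f g = refl
sumTo-+ (suc N) f g = trans (cong (_+ (f (suc N) + g (suc N))) (sumTo-+ N f g))
  (solve 4 (λ a b c d → (a :+ b) :+ (c :+ d) := (a :+ c) :+ (b :+ d)) refl (sumTo N f) (sumTo N g) (f (suc N)) (g (suc N)))

sumTo-*ˡ : ∀ N c (f : ℕ → ℚ) → sumTo N (λ i → c * f i) ≡ c * sumTo N f
sumTo-*ˡ zero    c f = refl
sumTo-*ˡ (suc N) c f = trans (cong (_+ (c * f (suc N))) (sumTo-*ˡ N c f)) (sym (QP.*-distribˡ-+ c (sumTo N f) (f (suc N))))

sumTo-suc : ∀ N (f : ℕ → ℚ) → sumTo (suc N) f ≡ f 0 + sumTo N (λ i → f (suc i))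
sumTo-suc zero    f = refl
sumTo-suc (suc N) f = trans (cong (_+ f (suc (suc N))) (sumTo-suc N f)) (QP.+-assoc (f 0) _ _)

sumTo-vanishing-tail : ∀ M N (f : ℕ → ℚ) → M ≤ N → (∀ i → M < i → f i ≡ 0ℚ) → sumTo N f ≡ sumTo M f
sumTo-vanishing-tail M N f M≤N tail≡0 = trans (cong (λ z → sumTo z f) (sym (ℕP.m∸n+n≡m M≤N))) (drop-tail (N ℕ.∸ M))
  where
  drop-tail : ∀ k → sumTo (k ℕ.+ M) f ≡ sumTo M f
  drop-tail zero    = refl
  drop-tail (suc k) = trans (cong₂ _+_ (drop-tail k) (tail≡0 (suc (k ℕ.+ M)) (s≤s (ℕP.m≤n+m M k)))) (QP.+-identityʳ _)

sumTo-reverse : ∀ N (f : ℕ → ℚ) → sumTo N f ≡ sumTo N (λ i → f (N ℕ.∸ i))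
sumTo-reverse zero    f = refl
sumTo-reverse (suc N) f = begin
  sumTo N f + f (suc N)                      ≡⟨ cong (_+ f (suc N)) (sumTo-reverse N f) ⟩
  sumTo N (λ i → f (N ℕ.∸ i)) + f (suc N)    ≡⟨ QP.+-comm _ (f (suc N)) ⟩
  f (suc N) + sumTo N (λ i → f (N ℕ.∸ i))    ≡⟨ sumTo-suc N (λ i → f (suc N ℕ.∸ i)) ⟨
  sumTo (suc N) (λ i → f (suc N ℕ.∸ i))      ∎

sumTo-*ˡ² : ∀ M c (a : ℕ → ℚ) (h : ℕ → ℕ → ℚ) →
  c * sumTo M (λ m → a m * sumTo m (h m)) ≡ sumTo M (λ m → sumTo m (λ k → c * (a m * h m k)))
sumTo-*ˡ² M c a h = trans (sym (sumTo-*ˡ M c _)) (sumTo-cong M (λ m _ →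
  trans (cong (c *_) (sym (sumTo-*ˡ m (a m) (h m)))) (sym (sumTo-*ˡ m c _))))

sumTo-triangle : ∀ M (F : ℕ → ℕ → ℚ) →
  sumTo M (λ m → sumTo m (F m)) ≡ sumTo M (λ i → sumTo (M ℕ.∸ i) (λ l → F (i ℕ.+ l) l))
sumTo-triangle zero    F = refl
sumTo-triangle (suc M) F = begin
  sumTo M (λ m → sumTo m (F m)) + sumTo (suc M) (F (suc M))
    ≡⟨ cong₂ _+_ (sumTo-triangle M F) (sumTo-reverse (suc M) (F (suc M))) ⟩
  sumTo M (row M) + (sumTo M (λ i → F (suc M) (suc M ℕ.∸ i)) + F (suc M) (M ℕ.∸ M))
    ≡⟨ trans (sym (QP.+-assoc (sumTo M (row M)) _ _)) (cong (_+ F (suc M) (M ℕ.∸ M)) (sym (sumTo-+ M (row M) (λ i → F (suc M) (suc M ℕ.∸ i))))) ⟩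
  sumTo M (λ i → row M i + F (suc M) (suc M ℕ.∸ i)) + F (suc M) (M ℕ.∸ M)
    ≡⟨ cong₂ _+_ (sumTo-cong M row-suc) (cong₂ F (sym (ℕP.+-identityʳ (suc M))) (ℕP.n∸n≡0 M)) ⟩
  sumTo M (row (suc M)) + sumTo 0 (λ l → F (suc M ℕ.+ l) l)
    ≡⟨ cong (λ z → sumTo M (row (suc M)) + sumTo z (λ l → F (suc M ℕ.+ l) l)) (ℕP.n∸n≡0 M) ⟨
  sumTo (suc M) (row (suc M)) ∎
  where
  row : ℕ → ℕ → ℚ
  row N i = sumTo (N ℕ.∸ i) (λ l → F (i ℕ.+ l) l)
  row-suc : ∀ i → i ≤ M → row M i + F (suc M) (suc M ℕ.∸ i) ≡ row (suc M) i
  row-suc i i≤M = begin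
    row M i + F (suc M) (suc M ℕ.∸ i)    ≡⟨ cong₂ (λ a b → row M i + F a b) 1+M≡i+[1+M∸i] 1+M∸i≡1+[M∸i] ⟩
    sumTo (suc (M ℕ.∸ i)) (λ l → F (i ℕ.+ l) l) ≡⟨ cong (λ z → sumTo z (λ l → F (i ℕ.+ l) l)) 1+M∸i≡1+[M∸i] ⟨
    row (suc M) i                         ∎
    where
    1+M∸i≡1+[M∸i] : suc M ℕ.∸ i ≡ suc (M ℕ.∸ i)
    1+M∸i≡1+[M∸i] = ℕP.+-∸-assoc 1 i≤M
    1+M≡i+[1+M∸i] : suc M ≡ i ℕ.+ suc (M ℕ.∸ i)
    1+M≡i+[1+M∸i] = trans (cong suc (sym (ℕP.m+[n∸m]≡n i≤M))) (sym (ℕP.+-suc i (M ℕ.∸ i)))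

sumTo-triangle′ : ∀ M (F : ℕ → ℕ → ℚ) →
  sumTo M (λ m → sumTo m (F m)) ≡ sumTo M (λ i → sumTo (M ℕ.∸ i) (λ l → F (i ℕ.+ l) i))
sumTo-triangle′ M F = begin
  sumTo M (λ m → sumTo m (F m))                                       ≡⟨ sumTo-cong M (λ m _ → sumTo-reverse m (F m)) ⟩
  sumTo M (λ m → sumTo m (λ k → F m (m ℕ.∸ k)))                       ≡⟨ sumTo-triangle M (λ m k → F m (m ℕ.∸ k)) ⟩
  sumTo M (λ i → sumTo (M ℕ.∸ i) (λ l → F (i ℕ.+ l) (i ℕ.+ l ℕ.∸ l))) ≡⟨ sumTo-cong M (λ i _ → sumTo-cong (M ℕ.∸ i) (λ l _ → cong (F (i ℕ.+ l)) (ℕP.m+n∸n≡m i l))) ⟩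
  sumTo M (λ i → sumTo (M ℕ.∸ i) (λ l → F (i ℕ.+ l) i))               ∎

sumTo-fold-odd : ∀ h n (f : ℕ → ℚ) → n ≡ h ℕ.+ h → sumTo (suc n) f ≡ sumTo h (λ l → f l + f (suc n ℕ.∸ l))
sumTo-fold-odd zero    .0            f refl = refl
sumTo-fold-odd (suc h) zero          f ()
sumTo-fold-odd (suc h) (suc zero)    f e    = ⊥-elim (ℕP.1+n≢0 (sym (trans (ℕP.suc-injective e) (ℕP.+-suc h h))))
sumTo-fold-odd (suc h) (suc (suc n)) f e    = begin
  sumTo (suc (suc (suc n))) f
    ≡⟨ cong (_+ f (suc (suc (suc n)))) (sumTo-suc (suc n) f) ⟩
  f 0 + sumTo (suc n) (λ i → f (suc i)) + f (suc (suc (suc n)))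
    ≡⟨ cong (λ z → f 0 + z + f (suc (suc (suc n)))) (sumTo-fold-odd h n (λ i → f (suc i)) n≡h+h) ⟩
  f 0 + S + f (suc (suc (suc n)))
    ≡⟨ solve 3 (λ a b c → a :+ b :+ c := (a :+ c) :+ b) refl (f 0) S (f (suc (suc (suc n)))) ⟩
  (f 0 + f (suc (suc (suc n)))) + S
    ≡⟨ cong ((f 0 + f (suc (suc (suc n)))) +_) (sumTo-cong h (λ l l≤h → cong (λ z → f (suc l) + f z) (sym (ℕP.+-∸-assoc 1 (ℕP.m≤n⇒m≤1+n (l≤n l l≤h)))))) ⟩
  (f 0 + f (suc (suc (suc n)))) + sumTo h (λ l → f (suc l) + f (suc (suc n) ℕ.∸ l))
    ≡⟨ sumTo-suc h (λ l → f l + f (suc (suc (suc n)) ℕ.∸ l)) ⟨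
  sumTo (suc h) (λ l → f l + f (suc (suc (suc n)) ℕ.∸ l)) ∎
  where
  S = sumTo h (λ l → f (suc l) + f (suc (suc n ℕ.∸ l)))
  n≡h+h : n ≡ h ℕ.+ h
  n≡h+h = ℕP.suc-injective (trans (ℕP.suc-injective e) (ℕP.+-suc h h))
  l≤n : ∀ l → l ≤ h → l ≤ n
  l≤n l l≤h = subst (l ≤_) (sym n≡h+h) (ℕP.≤-trans l≤h (ℕP.m≤m+n h h))

sumTo-fold-even : ∀ h n (f : ℕ → ℚ) → n ≡ h ℕ.+ h → sumTo n f + f h ≡ sumTo h (λ l → f l + f (n ℕ.∸ l))
sumTo-fold-even zero    .0            f refl = refl
sumTo-fold-even (suc h) zero          f ()
sumTo-fold-even (suc h) (suc zero)    f e    = ⊥-elim (ℕP.1+n≢0 (sym (trans (ℕP.suc-injective e) (ℕP.+-suc h h))))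
sumTo-fold-even (suc h) (suc (suc n)) f e    = begin
  sumTo (suc (suc n)) f + f (suc h)
    ≡⟨ cong (_+ f (suc h)) (sumTo-suc (suc n) f) ⟩
  f 0 + (sumTo n (λ i → f (suc i)) + f (suc (suc n))) + f (suc h)
    ≡⟨ solve 4 (λ a b c d → (a :+ (b :+ c)) :+ d := (a :+ c) :+ (b :+ d)) refl (f 0) (sumTo n (λ i → f (suc i))) (f (suc (suc n))) (f (suc h)) ⟩
  (f 0 + f (suc (suc n))) + (sumTo n (λ i → f (suc i)) + f (suc h))
    ≡⟨ cong ((f 0 + f (suc (suc n))) +_) (sumTo-fold-even h n (λ i → f (suc i)) n≡h+h) ⟩
  (f 0 + f (suc (suc n))) + sumTo h (λ l → f (suc l) + f (suc (n ℕ.∸ l)))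
    ≡⟨ cong ((f 0 + f (suc (suc n))) +_) (sumTo-cong h (λ l l≤h → cong (λ z → f (suc l) + f z) (sym (ℕP.+-∸-assoc 1 (l≤n l l≤h))))) ⟩
  (f 0 + f (suc (suc n))) + sumTo h (λ l → f (suc l) + f (suc n ℕ.∸ l))
    ≡⟨ sumTo-suc h (λ l → f l + f (suc (suc n) ℕ.∸ l)) ⟨
  sumTo (suc h) (λ l → f l + f (suc (suc n) ℕ.∸ l)) ∎
  where
  n≡h+h : n ≡ h ℕ.+ h
  n≡h+h = ℕP.suc-injective (trans (ℕP.suc-injective e) (ℕP.+-suc h h))
  l≤n : ∀ l → l ≤ h → l ≤ n
  l≤n l l≤h = subst (l ≤_) (sym n≡h+h) (ℕP.≤-trans l≤h (ℕP.m≤m+n h h))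

sumTo-symmetric : ∀ h p (f : ℕ → ℚ) → (∀ l → l ≤ h → f (p ℕ.∸ l) ≡ f l) →
  sumTo h (λ l → f l + f (p ℕ.∸ l)) ≡ two * sumTo h f
sumTo-symmetric h p f f-sym = trans (sumTo-cong h (λ l l≤h → trans (cong (f l +_) (f-sym l l≤h)) (sym (two*x≡x+x (f l))))) (sumTo-*ˡ h two f)

prev : (ℕ → ℚ) → ℕ → ℚ
prev a zero    = 0ℚ
prev a (suc l) = a l

abel-summation : ∀ h (a u : ℕ → ℚ) →
  sumTo h (λ l → (a l - prev a l) * u l) ≡ sumTo h (λ l → a l * (u l - u (suc l))) + a h * u (suc h)
abel-summation zero    a u = solve 3 (λ x y z → (x :- con 0ℚ) :* y := x :* (y :- z) :+ x :* z) refl (a 0) (u 0) (u 1)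
abel-summation (suc h) a u = begin
  sumTo h (λ l → (a l - prev a l) * u l) + (a (suc h) - a h) * u (suc h)
    ≡⟨ cong (_+ (a (suc h) - a h) * u (suc h)) (abel-summation h a u) ⟩
  S + a h * u (suc h) + (a (suc h) - a h) * u (suc h)
    ≡⟨ solve 5 (λ S ah u1 a1 u2 → S :+ ah :* u1 :+ (a1 :- ah) :* u1 := (S :+ a1 :* (u1 :- u2)) :+ a1 :* u2) refl S (a h) (u (suc h)) (a (suc h)) (u (suc (suc h))) ⟩
  S + a (suc h) * (u (suc h) - u (suc (suc h))) + a (suc h) * u (suc (suc h)) ∎
  where
  S = sumTo h (λ l → a l * (u l - u (suc l)))

sumTo-pascal : ∀ p (g : ℕ → ℚ) → sumTo (suc p) (λ l → ι (suc p C l) * g l) ≡ sumTo p (λ l → ι (p C l) * (g l + g (suc l)))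
sumTo-pascal p g = begin
  sumTo (suc p) (λ l → ι (suc p C l) * g l)
    ≡⟨ sumTo-suc p _ ⟩
  1ℚ * g 0 + sumTo p (λ l → ι (suc p C suc l) * g (suc l))
    ≡⟨ cong (1ℚ * g 0 +_) (trans (sumTo-cong p (λ l _ → pascal l)) (sumTo-+ p _ _)) ⟩
  1ℚ * g 0 + (A + B)
    ≡⟨ cong (λ z → 1ℚ * g 0 + (A + z)) B≡S-g0 ⟩
  1ℚ * g 0 + (A + (S - 1ℚ * g 0))
    ≡⟨ solve 3 (λ g a s → g :+ (a :+ (s :- g)) := s :+ a) refl (1ℚ * g 0) A S ⟩
  S + A
    ≡⟨ sumTo-+ p _ _ ⟨
  sumTo p (λ l → ι (p C l) * g l + ι (p C l) * g (suc l))
    ≡⟨ sumTo-cong p (λ l _ → sym (QP.*-distribˡ-+ (ι (p C l)) (g l) (g (suc l)))) ⟩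
  sumTo p (λ l → ι (p C l) * (g l + g (suc l))) ∎
  where
  A = sumTo p (λ l → ι (p C l) * g (suc l))
  B = sumTo p (λ l → ι (p C suc l) * g (suc l))
  S = sumTo p (λ l → ι (p C l) * g l)
  pascal : ∀ l → ι (suc p C suc l) * g (suc l) ≡ ι (p C l) * g (suc l) + ι (p C suc l) * g (suc l)
  pascal l = trans (cong (λ z → ι z * g (suc l)) (sym (nCk+nC[k+1]≡[n+1]C[k+1] p l)))
                   (trans (cong (_* g (suc l)) (ι-+ (p C l) (p C suc l))) (QP.*-distribʳ-+ (g (suc l)) (ι (p C l)) (ι (p C suc l))))
  B≡S-g0 : B ≡ S - 1ℚ * g 0
  B≡S-g0 = a+b≡c⇒a≡c-b B (1ℚ * g 0) S (begin
    B + 1ℚ * g 0                  ≡⟨ QP.+-comm B (1ℚ * g 0) ⟩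
    1ℚ * g 0 + B                  ≡⟨ sumTo-suc p (λ l → ι (p C l) * g l) ⟨
    S + ι (p C suc p) * g (suc p) ≡⟨ cong (λ z → S + ι z * g (suc p)) (k>n⇒nCk≡0 (ℕP.n<1+n p)) ⟩
    S + 0ℚ * g (suc p)            ≡⟨ trans (cong (S +_) (QP.*-zeroˡ (g (suc p)))) (QP.+-identityʳ S) ⟩
    S                             ∎)

falling : ℚ → ℕ → ℚ
falling x zero    = 1ℚ
falling x (suc n) = x * falling (x - 1ℚ) n

falling-sucʳ : ∀ x n → falling x (suc n) ≡ falling x n * (x - ι n)
falling-sucʳ x zero    = solve 1 (λ a → a :* con 1ℚ := con 1ℚ :* (a :- con 0ℚ)) refl x
falling-sucʳ x (suc n) = begin
  x * falling (x - 1ℚ) (suc n)                ≡⟨ cong (x *_) (falling-sucʳ (x - 1ℚ) n) ⟩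
  x * (falling (x - 1ℚ) n * (x - 1ℚ - ι n))   ≡⟨ solve 3 (λ a F b → a :* (F :* (a :- con 1ℚ :- b)) := (a :* F) :* (a :- (con 1ℚ :+ b))) refl x (falling (x - 1ℚ) n) (ι n) ⟩
  x * falling (x - 1ℚ) n * (x - (1ℚ + ι n))   ≡⟨ cong (λ z → x * falling (x - 1ℚ) n * (x - z)) (ι-suc n) ⟨
  x * falling (x - 1ℚ) n * (x - ι (suc n))    ∎

falling-sucʳ² : ∀ x n → falling x (suc (suc n)) ≡ falling x n * (x - ι n) * (x - ι (suc n))
falling-sucʳ² x n = trans (falling-sucʳ x (suc n)) (cong (_* (x - ι (suc n))) (falling-sucʳ x n))

falling-+2 : ∀ x n → falling (x + two) (suc (suc n)) ≡ (x + two) * (x + 1ℚ) * falling x n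
falling-+2 x n = begin
  (x + two) * ((x + two - 1ℚ) * falling (x + two - 1ℚ - 1ℚ) n)
    ≡⟨ cong₂ (λ a b → (x + two) * (a * falling b n))
         (solve 1 (λ a → a :+ (con 1ℚ :+ con 1ℚ) :- con 1ℚ := a :+ con 1ℚ) refl x)
         (solve 1 (λ a → a :+ (con 1ℚ :+ con 1ℚ) :- con 1ℚ :- con 1ℚ := a) refl x) ⟩
  (x + two) * ((x + 1ℚ) * falling x n)
    ≡⟨ QP.*-assoc (x + two) (x + 1ℚ) (falling x n) ⟨
  (x + two) * (x + 1ℚ) * falling x n ∎

falling-pascal : ∀ x n → falling (x + 1ℚ) (suc n) ≡ falling x (suc n) + ι (suc n) * falling x n
falling-pascal x n = begin
  (x + 1ℚ) * falling (x + 1ℚ - 1ℚ) n             ≡⟨ cong (λ z → (x + 1ℚ) * falling z n) (solve 1 (λ a → a :+ con 1ℚ :- con 1ℚ := a) refl x) ⟩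
  (x + 1ℚ) * falling x n                         ≡⟨ solve 3 (λ a F b → (a :+ con 1ℚ) :* F := F :* (a :- b) :+ (con 1ℚ :+ b) :* F) refl x (falling x n) (ι n) ⟩
  falling x n * (x - ι n) + (1ℚ + ι n) * falling x n ≡⟨ cong₂ _+_ (falling-sucʳ x n) (cong (_* falling x n) (ι-suc n)) ⟨
  falling x (suc n) + ι (suc n) * falling x n    ∎

falling-pascal′ : ∀ x n → falling (x + 1ℚ) n ≡ falling x n + ι n * falling x (n ℕ.∸ 1)
falling-pascal′ x zero    = refl
falling-pascal′ x (suc n) = falling-pascal x n

falling-vanishes : ∀ k n → k < n → falling (ι k) n ≡ 0ℚ
falling-vanishes zero    (suc n) _         = QP.*-zeroˡ (falling (0ℚ - 1ℚ) n)
falling-vanishes (suc k) (suc n) (s≤s k<n) = begin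
  ι (suc k) * falling (ι (suc k) - 1ℚ) n ≡⟨ cong (λ z → ι (suc k) * falling z n) (trans (cong (_- 1ℚ) (ι-suc k)) (solve 1 (λ a → con 1ℚ :+ a :- con 1ℚ := a) refl (ι k))) ⟩
  ι (suc k) * falling (ι k) n            ≡⟨ cong (ι (suc k) *_) (falling-vanishes k n k<n) ⟩
  ι (suc k) * 0ℚ                         ≡⟨ QP.*-zeroʳ (ι (suc k)) ⟩
  0ℚ                                     ∎

falling-second-difference : ∀ x n →
  falling (x + two) (suc (suc n)) + falling x (suc (suc n))
    ≡ two * falling (x + 1ℚ) (suc (suc n)) + ι (suc (suc n)) * ι (suc n) * falling x n
falling-second-difference x n = begin
  falling (x + two) (suc (suc n)) + falling x (suc (suc n))
    ≡⟨ cong (λ z → falling z (suc (suc n)) + falling x (suc (suc n))) (trans (cong (x +_) two≡1+1) (sym (QP.+-assoc x 1ℚ 1ℚ))) ⟩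
  falling (x + 1ℚ + 1ℚ) (suc (suc n)) + falling x (suc (suc n))
    ≡⟨ cong₂ _+_ (trans (falling-pascal (x + 1ℚ) (suc n)) (cong (λ z → F₂ + N₂ * z) (falling-pascal x n))) x-case ⟩
  F₂ + N₂ * (falling x (suc n) + N₁ * falling x n) + (F₂ - N₂ * falling x (suc n))
    ≡⟨ solve 5 (λ A N2 F1 N1 F0 → A :+ N2 :* (F1 :+ N1 :* F0) :+ (A :- N2 :* F1) := (con 1ℚ :+ con 1ℚ) :* A :+ N2 :* N1 :* F0) refl F₂ N₂ (falling x (suc n)) N₁ (falling x n) ⟩
  (1ℚ + 1ℚ) * F₂ + N₂ * N₁ * falling x n
    ≡⟨ cong (λ z → z * F₂ + N₂ * N₁ * falling x n) two≡1+1 ⟨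
  two * F₂ + N₂ * N₁ * falling x n ∎
  where
  F₂ = falling (x + 1ℚ) (suc (suc n))
  N₂ = ι (suc (suc n))
  N₁ = ι (suc n)
  x-case : falling x (suc (suc n)) ≡ F₂ - N₂ * falling x (suc n)
  x-case = a+b≡c⇒a≡c-b _ _ F₂ (sym (falling-pascal x (suc n)))

-- Chebyshev derivatives at 1: T⁽q⁾ₙ(1) = tNum n q / (2q-1)!!  and  U⁽q⁾ₙ₋₁(1) = uNum n q / (2q+1)!!.

tNum : ℚ → ℕ → ℚ
tNum d zero    = 1ℚ
tNum d (suc q) = tNum d q * (d * d - ι q * ι q)

uNum : ℚ → ℕ → ℚ
uNum e q = falling (e + ι q) (suc (q ℕ.+ q))

oddFactorial : ℕ → ℚ
oddFactorial zero    = 1ℚ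
oddFactorial (suc q) = oddFactorial q * ι (suc (q ℕ.+ q))

oddFactorial≢0 : ∀ q → oddFactorial q ≢ 0ℚ
oddFactorial≢0 zero    = QP.1≢0
oddFactorial≢0 (suc q) = *-≢0 (oddFactorial q) (ι (suc (q ℕ.+ q))) (oddFactorial≢0 q) (ι-suc≢0 (q ℕ.+ q))

uNum-suc : ∀ e q → uNum e (suc q) ≡ uNum e q * (e * e - ι (suc q) * ι (suc q))
uNum-suc e q = begin
  falling y (suc (suc q ℕ.+ suc q))
    ≡⟨ cong (falling y) (cong suc ([1+n]+[1+n]≡2+[n+n] q)) ⟩
  y * falling (y - 1ℚ) (suc (suc (q ℕ.+ q)))
    ≡⟨ cong (y *_) (falling-sucʳ (y - 1ℚ) (suc (q ℕ.+ q))) ⟩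
  y * (falling (y - 1ℚ) (suc (q ℕ.+ q)) * (y - 1ℚ - ι (suc (q ℕ.+ q))))
    ≡⟨ cong₂ (λ a b → y * (falling a (suc (q ℕ.+ q)) * (y - 1ℚ - b))) y-1≡e+q (ι-1+2n q) ⟩
  y * (F * (y - 1ℚ - (1ℚ + ι q + ι q)))
    ≡⟨ cong (λ z → z * (F * (z - 1ℚ - (1ℚ + ι q + ι q)))) y≡e+[1+q] ⟩
  (e + (1ℚ + ι q)) * (F * (e + (1ℚ + ι q) - 1ℚ - (1ℚ + ι q + ι q)))
    ≡⟨ solve 3 (λ a F b → (a :+ (con 1ℚ :+ b)) :* (F :* (a :+ (con 1ℚ :+ b) :- con 1ℚ :- (con 1ℚ :+ b :+ b))) := F :* (a :* a :- (con 1ℚ :+ b) :* (con 1ℚ :+ b))) refl e F (ι q) ⟩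
  F * (e * e - (1ℚ + ι q) * (1ℚ + ι q))
    ≡⟨ cong (λ z → F * (e * e - z * z)) (ι-suc q) ⟨
  F * (e * e - ι (suc q) * ι (suc q)) ∎
  where
  y = e + ι (suc q)
  F = falling (e + ι q) (suc (q ℕ.+ q))
  y≡e+[1+q] : y ≡ e + (1ℚ + ι q)
  y≡e+[1+q] = cong (e +_) (ι-suc q)
  y-1≡e+q : y - 1ℚ ≡ e + ι q
  y-1≡e+q = trans (cong (_- 1ℚ) y≡e+[1+q]) (solve 2 (λ a b → a :+ (con 1ℚ :+ b) :- con 1ℚ := a :+ b) refl e (ι q))

-- T′ₙ = n Uₙ₋₁
tNum-suc : ∀ d q → tNum d (suc q) ≡ d * uNum d q
tNum-suc d zero    = solve 1 (λ a → con 1ℚ :* (a :* a :- con 0ℚ :* con 0ℚ) := a :* ((a :+ con 0ℚ) :* con 1ℚ)) refl d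
tNum-suc d (suc q) = begin
  tNum d (suc q) * (d * d - ι (suc q) * ι (suc q)) ≡⟨ cong (_* (d * d - ι (suc q) * ι (suc q))) (tNum-suc d q) ⟩
  d * uNum d q * (d * d - ι (suc q) * ι (suc q))   ≡⟨ QP.*-assoc d (uNum d q) _ ⟩
  d * (uNum d q * (d * d - ι (suc q) * ι (suc q))) ≡⟨ cong (d *_) (uNum-suc d q) ⟨
  d * uNum d (suc q)                               ∎

tNum-neg : ∀ d q → tNum (- d) q ≡ tNum d q
tNum-neg d zero    = refl
tNum-neg d (suc q) = cong₂ _*_ (tNum-neg d q) (cong (_- ι q * ι q) (solve 1 (λ a → (:- a) :* (:- a) := a :* a) refl d))

uNum-neg : ∀ e q → uNum (- e) q ≡ - uNum e q
uNum-neg e zero    = solve 1 (λ a → (:- a :+ con 0ℚ) :* con 1ℚ := :- ((a :+ con 0ℚ) :* con 1ℚ)) refl e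
uNum-neg e (suc q) = begin
  uNum (- e) (suc q)                             ≡⟨ uNum-suc (- e) q ⟩
  uNum (- e) q * (- e * - e - ι (suc q) * ι (suc q)) ≡⟨ cong (_* (- e * - e - ι (suc q) * ι (suc q))) (uNum-neg e q) ⟩
  - uNum e q * (- e * - e - ι (suc q) * ι (suc q))   ≡⟨ solve 3 (λ u a b → (:- u) :* ((:- a) :* (:- a) :- b) := :- (u :* (a :* a :- b))) refl (uNum e q) e (ι (suc q) * ι (suc q)) ⟩
  - (uNum e q * (e * e - ι (suc q) * ι (suc q)))     ≡⟨ cong -_ (uNum-suc e q) ⟨
  - uNum e (suc q)                                   ∎

tNum-0 : ∀ q → tNum 0ℚ (suc q) ≡ 0ℚ
tNum-0 zero    = refl
tNum-0 (suc q) = trans (cong (_* (0ℚ * 0ℚ - ι (suc q) * ι (suc q))) (tNum-0 q)) (QP.*-zeroˡ (0ℚ * 0ℚ - ι (suc q) * ι (suc q)))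

uNum-0 : ∀ q → uNum 0ℚ q ≡ 0ℚ
uNum-0 q = trans (cong (λ z → falling z (suc (q ℕ.+ q))) (QP.+-identityˡ (ι q))) (falling-vanishes q (suc (q ℕ.+ q)) (s≤s (ℕP.m≤m+n q q)))

uNum-1 : ∀ q → uNum 1ℚ (suc q) ≡ 0ℚ
uNum-1 q = trans (cong (λ z → falling z (suc (suc q ℕ.+ suc q))) (sym (ι-suc (suc q))))
                 (falling-vanishes (suc (suc q)) (suc (suc q ℕ.+ suc q)) (s≤s (s≤s (ℕP.m≤n+m (suc q) q))))

uCoeff : ℕ → ℚ
uCoeff q = ι (suc (suc q ℕ.+ suc q)) * ι (suc q ℕ.+ suc q)

tCoeff : ℕ → ℚ
tCoeff q = ι (suc q ℕ.+ suc q) * ι (suc (q ℕ.+ q))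

uNum-recurrence₀ : ∀ e → uNum (e + 1ℚ) 0 + uNum (e - 1ℚ) 0 ≡ two * uNum e 0
uNum-recurrence₀ e = trans (solve 1 (λ a → (a :+ con 1ℚ :+ con 0ℚ) :* con 1ℚ :+ (a :- con 1ℚ :+ con 0ℚ) :* con 1ℚ := (con 1ℚ :+ con 1ℚ) :* ((a :+ con 0ℚ) :* con 1ℚ)) refl e)
                           (cong (_* uNum e 0) (sym two≡1+1))

uNum-recurrence : ∀ e q → uNum (e + 1ℚ) (suc q) + uNum (e - 1ℚ) (suc q) ≡ two * uNum e (suc q) + uCoeff q * uNum e q
uNum-recurrence e q = begin
  falling (e + 1ℚ + ι (suc q)) (suc (suc q ℕ.+ suc q)) + falling (e - 1ℚ + ι (suc q)) (suc (suc q ℕ.+ suc q))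
    ≡⟨ cong₂ _+_ (cong₂ falling e+1+[1+q]≡x+2 length) (cong₂ falling e-1+[1+q]≡x length) ⟩
  falling (x + two) (suc (suc n)) + falling x (suc (suc n))
    ≡⟨ falling-second-difference x n ⟩
  two * falling (x + 1ℚ) (suc (suc n)) + ι (suc (suc n)) * ι (suc n) * falling x n
    ≡⟨ cong₂ (λ a b → two * a + b * falling x n) (cong₂ falling (sym e+[1+q]≡x+1) (sym length)) (sym (cong₂ (λ a b → ι a * ι b) length ([1+n]+[1+n]≡2+[n+n] q))) ⟩
  two * falling (e + ι (suc q)) (suc (suc q ℕ.+ suc q)) + uCoeff q * falling x n ∎
  where
  x = e + ι q
  n = suc (q ℕ.+ q)
  length : suc (suc q ℕ.+ suc q) ≡ suc (suc n)
  length = cong suc ([1+n]+[1+n]≡2+[n+n] q)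
  e+1+[1+q]≡x+2 : e + 1ℚ + ι (suc q) ≡ x + two
  e+1+[1+q]≡x+2 = trans (cong (e + 1ℚ +_) (ι-suc q))
    (trans (solve 2 (λ a b → a :+ con 1ℚ :+ (con 1ℚ :+ b) := a :+ b :+ (con 1ℚ :+ con 1ℚ)) refl e (ι q)) (cong (x +_) (sym two≡1+1)))
  e-1+[1+q]≡x : e - 1ℚ + ι (suc q) ≡ x
  e-1+[1+q]≡x = trans (cong (e - 1ℚ +_) (ι-suc q)) (solve 2 (λ a b → a :- con 1ℚ :+ (con 1ℚ :+ b) := a :+ b) refl e (ι q))
  e+[1+q]≡x+1 : e + ι (suc q) ≡ x + 1ℚ
  e+[1+q]≡x+1 = trans (cong (e +_) (ι-suc q)) (solve 2 (λ a b → a :+ (con 1ℚ :+ b) := a :+ b :+ con 1ℚ) refl e (ι q))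

-- 2 Tₙ = Uₙ - Uₙ₋₂, differentiated q times.
tNum-uNum-difference : ∀ d q → two * ι (suc (q ℕ.+ q)) * tNum d q ≡ uNum (d + 1ℚ) q - uNum (d - 1ℚ) q
tNum-uNum-difference d zero    = trans (cong (λ z → z * 1ℚ * 1ℚ) two≡1+1)
  (solve 1 (λ a → (con 1ℚ :+ con 1ℚ) :* con 1ℚ :* con 1ℚ := (a :+ con 1ℚ :+ con 0ℚ) :* con 1ℚ :- (a :- con 1ℚ :+ con 0ℚ) :* con 1ℚ) refl d)
tNum-uNum-difference d (suc q) = begin
  two * ι (suc (suc q ℕ.+ suc q)) * tNum d (suc q)
    ≡⟨ cong₂ (λ a b → two * a * b) (trans (ι-suc (suc q ℕ.+ suc q)) (cong (1ℚ +_) (ι-2+2n q))) (tNum-suc d q) ⟩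
  two * (1ℚ + (two + ι q + ι q)) * (d * F)
    ≡⟨ cong (λ t → t * (1ℚ + (t + ι q + ι q)) * (d * F)) two≡1+1 ⟩
  (1ℚ + 1ℚ) * (1ℚ + ((1ℚ + 1ℚ) + ι q + ι q)) * (d * F)
    ≡⟨ solve 3 (λ D Q F → (con 1ℚ :+ con 1ℚ) :* (con 1ℚ :+ ((con 1ℚ :+ con 1ℚ) :+ Q :+ Q)) :* (D :* F)
                       := (D :+ Q :+ (con 1ℚ :+ con 1ℚ)) :* (D :+ Q :+ con 1ℚ) :* F :- F :* (D :+ Q :- (con 1ℚ :+ Q :+ Q)) :* (D :+ Q :- (con 1ℚ :+ (con 1ℚ :+ Q :+ Q))))
             refl d (ι q) F ⟩
  (x + (1ℚ + 1ℚ)) * (x + 1ℚ) * F - F * (x - (1ℚ + ι q + ι q)) * (x - (1ℚ + (1ℚ + ι q + ι q)))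
    ≡⟨ cong₂ (λ a b → (x + a) * (x + 1ℚ) * F - b) (sym two≡1+1)
         (cong₂ (λ b c → F * (x - b) * (x - c)) (sym (ι-1+2n q)) (trans (cong (1ℚ +_) (sym (ι-1+2n q))) (sym (ι-suc n)))) ⟩
  (x + two) * (x + 1ℚ) * F - F * (x - ι n) * (x - ι (suc n))
    ≡⟨ cong₂ _-_ (falling-+2 x n) (falling-sucʳ² x n) ⟨
  falling (x + two) (suc (suc n)) - falling x (suc (suc n))
    ≡⟨ cong₂ _-_ (cong₂ falling x+2≡d+1+[1+q] length) (cong₂ falling x≡d-1+[1+q] length) ⟩
  uNum (d + 1ℚ) (suc q) - uNum (d - 1ℚ) (suc q) ∎
  where
  x = d + ι q
  n = suc (q ℕ.+ q)
  F = falling x n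
  length : suc (suc n) ≡ suc (suc q ℕ.+ suc q)
  length = sym (cong suc ([1+n]+[1+n]≡2+[n+n] q))
  x+2≡d+1+[1+q] : x + two ≡ d + 1ℚ + ι (suc q)
  x+2≡d+1+[1+q] = trans (cong (x +_) two≡1+1)
    (trans (solve 2 (λ a b → a :+ b :+ (con 1ℚ :+ con 1ℚ) := a :+ con 1ℚ :+ (con 1ℚ :+ b)) refl d (ι q)) (cong (d + 1ℚ +_) (sym (ι-suc q))))
  x≡d-1+[1+q] : x ≡ d - 1ℚ + ι (suc q)
  x≡d-1+[1+q] = trans (solve 2 (λ a b → a :+ b := a :- con 1ℚ :+ (con 1ℚ :+ b)) refl d (ι q)) (cong (d - 1ℚ +_) (sym (ι-suc q)))

tNum-recurrence₀ : ∀ d → tNum (d + 1ℚ) 0 + tNum (d - 1ℚ) 0 ≡ two * tNum d 0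
tNum-recurrence₀ d = trans (sym two≡1+1) (sym (QP.*-identityʳ two))

tNum-recurrence : ∀ d q → tNum (d + 1ℚ) (suc q) + tNum (d - 1ℚ) (suc q) ≡ two * tNum d (suc q) + tCoeff q * tNum d q
tNum-recurrence d q = *-cancelˡ-≢0 A _ _ (*-≢0 two X₃ two≢0 (ι-suc≢0 (suc q ℕ.+ suc q))) (begin
  A * (tNum (d + 1ℚ) (suc q) + tNum (d - 1ℚ) (suc q))
    ≡⟨ QP.*-distribˡ-+ A _ _ ⟩
  A * tNum (d + 1ℚ) (suc q) + A * tNum (d - 1ℚ) (suc q)
    ≡⟨ cong₂ _+_ (trans (tNum-uNum-difference (d + 1ℚ) (suc q)) (cong (λ z → u₊₂ - uNum z (suc q)) d+1-1≡d))
                 (trans (tNum-uNum-difference (d - 1ℚ) (suc q)) (cong (λ z → uNum z (suc q) - u₋₂) d-1+1≡d)) ⟩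
  (u₊₂ - u₀) + (u₀ - u₋₂)
    ≡⟨ cong₂ (λ a b → (a - u₀) + (u₀ - b)) u₊₂≡ u₋₂≡ ⟩
  (((two * u₊ + uCoeff q * v₊) - u₀) - u₀) + (u₀ - ((two * u₋ + uCoeff q * v₋) - u₀))
    ≡⟨ solve 7 (λ t a b c e f g → (((t :* a :+ c :* e) :- b) :- b) :+ (b :- ((t :* f :+ c :* g) :- b)) := t :* (a :- f) :+ c :* (e :- g)) refl two u₊ u₀ (uCoeff q) v₊ u₋ v₋ ⟩
  two * (u₊ - u₋) + uCoeff q * (v₊ - v₋)
    ≡⟨ cong₂ (λ a b → two * a + uCoeff q * b) (tNum-uNum-difference d (suc q)) (tNum-uNum-difference d q) ⟨
  two * (A * tNum d (suc q)) + uCoeff q * (two * X₁ * tNum d q)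
    ≡⟨ solve 6 (λ t x3 x2 x1 p0 p00 → t :* (t :* x3 :* p0) :+ x3 :* x2 :* (t :* x1 :* p00) := t :* x3 :* (t :* p0 :+ x2 :* x1 :* p00)) refl two X₃ X₂ X₁ (tNum d (suc q)) (tNum d q) ⟩
  A * (two * tNum d (suc q) + tCoeff q * tNum d q) ∎)
  where
  X₃ = ι (suc (suc q ℕ.+ suc q))
  X₂ = ι (suc q ℕ.+ suc q)
  X₁ = ι (suc (q ℕ.+ q))
  A = two * X₃
  u₊ = uNum (d + 1ℚ) (suc q)
  u₋ = uNum (d - 1ℚ) (suc q)
  u₀ = uNum d (suc q)
  v₊ = uNum (d + 1ℚ) q
  v₋ = uNum (d - 1ℚ) q
  u₊₂ = uNum (d + 1ℚ + 1ℚ) (suc q)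
  u₋₂ = uNum (d - 1ℚ - 1ℚ) (suc q)
  d+1-1≡d : d + 1ℚ - 1ℚ ≡ d
  d+1-1≡d = solve 1 (λ a → a :+ con 1ℚ :- con 1ℚ := a) refl d
  d-1+1≡d : d - 1ℚ + 1ℚ ≡ d
  d-1+1≡d = solve 1 (λ a → a :- con 1ℚ :+ con 1ℚ := a) refl d
  u₊₂≡ : u₊₂ ≡ (two * u₊ + uCoeff q * v₊) - u₀
  u₊₂≡ = a+b≡c⇒a≡c-b u₊₂ u₀ _ (trans (cong (λ z → u₊₂ + uNum z (suc q)) (sym d+1-1≡d)) (uNum-recurrence (d + 1ℚ) q))
  u₋₂≡ : u₋₂ ≡ (two * u₋ + uCoeff q * v₋) - u₀
  u₋₂≡ = a+b≡c⇒a≡c-b u₋₂ u₀ _ (trans (QP.+-comm u₋₂ u₀) (trans (cong (λ z → uNum z (suc q) + u₋₂) (sym d-1+1≡d)) (uNum-recurrence (d - 1ℚ) q)))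

-- Binomial transforms

-- The transform S p = Σₗ (p choose l) g (s + p − 2l) obeys S (p + 1) = S p ∘ (+1) + S p ∘ (−1) by Pascal's rule,
-- so a second-order recurrence of g in its first argument becomes a recurrence in p, which 2ᵖ K q p⁽q⁾ also satisfies.
module BinomialSum (g : ℚ → ℕ → ℚ) (c K : ℕ → ℚ) (s : ℚ)
  (g-rec₀  : ∀ e → g (e + 1ℚ) 0 + g (e - 1ℚ) 0 ≡ two * g e 0)
  (g-rec   : ∀ e q → g (e + 1ℚ) (suc q) + g (e - 1ℚ) (suc q) ≡ two * g e (suc q) + c q * g e q)
  (g-s-0   : g s 0 ≡ K 0)
  (g-s-suc : ∀ q → g s (suc q) ≡ 0ℚ)
  (K-rec   : ∀ q → c q * K q ≡ two * ι (suc q) * K (suc q)) where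

  private
    arg : ℕ → ℕ → ℚ
    arg p l = s + ι p - two * ι l

  binomialSum : ℕ → ℕ → ℚ
  binomialSum p q = sumTo p (λ l → ι (p C l) * g (arg p l) q)

  private
    arg-suc : ∀ p l → arg (suc p) l ≡ arg p l + 1ℚ
    arg-suc p l = trans (cong (λ z → s + z - two * ι l) (ι-suc p))
      (solve 4 (λ a b t c → a :+ (con 1ℚ :+ b) :- t :* c := a :+ b :- t :* c :+ con 1ℚ) refl s (ι p) two (ι l))

    arg-suc-suc : ∀ p l → arg (suc p) (suc l) ≡ arg p l - 1ℚ
    arg-suc-suc p l = begin
      s + ι (suc p) - two * ι (suc l)         ≡⟨ cong₂ (λ z w → s + z - two * w) (ι-suc p) (ι-suc l) ⟩
      s + (1ℚ + ι p) - two * (1ℚ + ι l)       ≡⟨ cong (λ t → s + (1ℚ + ι p) - t * (1ℚ + ι l)) two≡1+1 ⟩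
      s + (1ℚ + ι p) - (1ℚ + 1ℚ) * (1ℚ + ι l) ≡⟨ solve 3 (λ a b c → a :+ (con 1ℚ :+ b) :- (con 1ℚ :+ con 1ℚ) :* (con 1ℚ :+ c) := a :+ b :- (con 1ℚ :+ con 1ℚ) :* c :- con 1ℚ) refl s (ι p) (ι l) ⟩
      s + ι p - (1ℚ + 1ℚ) * ι l - 1ℚ          ≡⟨ cong (λ t → s + ι p - t * ι l - 1ℚ) two≡1+1 ⟨
      arg p l - 1ℚ                            ∎

  binomialSum-suc : ∀ p q → binomialSum (suc p) q ≡ sumTo p (λ l → ι (p C l) * (g (arg p l + 1ℚ) q + g (arg p l - 1ℚ) q))
  binomialSum-suc p q = trans (sumTo-pascal p (λ l → g (arg (suc p) l) q))
    (sumTo-cong p (λ l _ → cong₂ (λ a b → ι (p C l) * (g a q + g b q)) (arg-suc p l) (arg-suc-suc p l)))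

  binomialSum-rec₀ : ∀ p → binomialSum (suc p) 0 ≡ two * binomialSum p 0
  binomialSum-rec₀ p = begin
    binomialSum (suc p) 0
      ≡⟨ binomialSum-suc p 0 ⟩
    sumTo p (λ l → ι (p C l) * (g (arg p l + 1ℚ) 0 + g (arg p l - 1ℚ) 0))
      ≡⟨ sumTo-cong p (λ l _ → trans (cong (ι (p C l) *_) (g-rec₀ (arg p l))) (solve 3 (λ a t b → a :* (t :* b) := t :* (a :* b)) refl (ι (p C l)) two (g (arg p l) 0))) ⟩
    sumTo p (λ l → two * (ι (p C l) * g (arg p l) 0))
      ≡⟨ sumTo-*ˡ p two _ ⟩
    two * binomialSum p 0 ∎

  binomialSum-rec : ∀ p q → binomialSum (suc p) (suc q) ≡ two * binomialSum p (suc q) + c q * binomialSum p q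
  binomialSum-rec p q = begin
    binomialSum (suc p) (suc q)
      ≡⟨ binomialSum-suc p (suc q) ⟩
    sumTo p (λ l → ι (p C l) * (g (arg p l + 1ℚ) (suc q) + g (arg p l - 1ℚ) (suc q)))
      ≡⟨ sumTo-cong p (λ l _ → trans (cong (ι (p C l) *_) (g-rec (arg p l) q))
           (solve 5 (λ a t b cq d → a :* (t :* b :+ cq :* d) := t :* (a :* b) :+ cq :* (a :* d)) refl (ι (p C l)) two (g (arg p l) (suc q)) (c q) (g (arg p l) q))) ⟩
    sumTo p (λ l → two * (ι (p C l) * g (arg p l) (suc q)) + c q * (ι (p C l) * g (arg p l) q))
      ≡⟨ trans (sumTo-+ p _ _) (cong₂ _+_ (sumTo-*ˡ p two _) (sumTo-*ˡ p (c q) _)) ⟩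
    two * binomialSum p (suc q) + c q * binomialSum p q ∎

  binomialSum-closed : ∀ p q → binomialSum p q ≡ two ^ p * K q * falling (ι p) q
  binomialSum-closed zero    zero    = begin
    1ℚ * g (s + 0ℚ - two * 0ℚ) 0 ≡⟨ trans (QP.*-identityˡ _) (cong (λ z → g z 0) (solve 2 (λ a t → a :+ con 0ℚ :- t :* con 0ℚ := a) refl s two)) ⟩
    g s 0                        ≡⟨ g-s-0 ⟩
    K 0                          ≡⟨ solve 1 (λ k → k := con 1ℚ :* k :* con 1ℚ) refl (K 0) ⟩
    1ℚ * K 0 * 1ℚ                ∎
  binomialSum-closed zero    (suc q) = begin
    1ℚ * g (s + 0ℚ - two * 0ℚ) (suc q) ≡⟨ trans (QP.*-identityˡ _) (cong (λ z → g z (suc q)) (solve 2 (λ a t → a :+ con 0ℚ :- t :* con 0ℚ := a) refl s two)) ⟩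
    g s (suc q)                        ≡⟨ g-s-suc q ⟩
    0ℚ                                 ≡⟨ QP.*-zeroʳ (1ℚ * K (suc q)) ⟨
    1ℚ * K (suc q) * 0ℚ                ≡⟨ cong (1ℚ * K (suc q) *_) (QP.*-zeroˡ (falling (0ℚ - 1ℚ) q)) ⟨
    1ℚ * K (suc q) * falling 0ℚ (suc q) ∎
  binomialSum-closed (suc p) zero    = begin
    binomialSum (suc p) 0      ≡⟨ binomialSum-rec₀ p ⟩
    two * binomialSum p 0      ≡⟨ cong (two *_) (binomialSum-closed p 0) ⟩
    two * (two ^ p * K 0 * 1ℚ) ≡⟨ solve 3 (λ t a k → t :* (a :* k :* con 1ℚ) := t :* a :* k :* con 1ℚ) refl two (two ^ p) (K 0) ⟩
    two ^ suc p * K 0 * 1ℚ     ∎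
  binomialSum-closed (suc p) (suc q) = begin
    binomialSum (suc p) (suc q)
      ≡⟨ binomialSum-rec p q ⟩
    two * binomialSum p (suc q) + c q * binomialSum p q
      ≡⟨ cong₂ (λ a b → two * a + c q * b) (binomialSum-closed p (suc q)) (binomialSum-closed p q) ⟩
    two * (2ᵖ * K (suc q) * F₁) + c q * (2ᵖ * K q * F₀)
      ≡⟨ solve 7 (λ t P cq Kq K1 F0 F1 → t :* (P :* K1 :* F1) :+ cq :* (P :* Kq :* F0) := t :* (P :* K1 :* F1) :+ (cq :* Kq) :* (P :* F0)) refl two 2ᵖ (c q) (K q) (K (suc q)) F₀ F₁ ⟩
    two * (2ᵖ * K (suc q) * F₁) + (c q * K q) * (2ᵖ * F₀)
      ≡⟨ cong (λ z → two * (2ᵖ * K (suc q) * F₁) + z * (2ᵖ * F₀)) (K-rec q) ⟩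
    two * (2ᵖ * K (suc q) * F₁) + (two * ι (suc q) * K (suc q)) * (2ᵖ * F₀)
      ≡⟨ solve 6 (λ t P K1 F1 N F0 → t :* (P :* K1 :* F1) :+ (t :* N :* K1) :* (P :* F0) := t :* P :* K1 :* (F1 :+ N :* F0)) refl two 2ᵖ (K (suc q)) F₁ (ι (suc q)) F₀ ⟩
    two * 2ᵖ * K (suc q) * (F₁ + ι (suc q) * F₀)
      ≡⟨ cong (two * 2ᵖ * K (suc q) *_) (falling-pascal (ι p) q) ⟨
    two * 2ᵖ * K (suc q) * falling (ι p + 1ℚ) (suc q)
      ≡⟨ cong (λ z → two * 2ᵖ * K (suc q) * falling z (suc q)) (trans (QP.+-comm (ι p) 1ℚ) (sym (ι-suc p))) ⟩
    two ^ suc p * K (suc q) * falling (ι (suc p)) (suc q) ∎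
    where
    2ᵖ = two ^ p
    F₀ = falling (ι p) q
    F₁ = falling (ι p) (suc q)

tCoeff-oddFactorial : ∀ q → tCoeff q * oddFactorial q ≡ two * ι (suc q) * oddFactorial (suc q)
tCoeff-oddFactorial q = begin
  ι (suc q ℕ.+ suc q) * ι (suc (q ℕ.+ q)) * oddFactorial q
    ≡⟨ cong (λ z → z * ι (suc (q ℕ.+ q)) * oddFactorial q) (trans (ι-+ (suc q) (suc q)) (sym (two*x≡x+x (ι (suc q))))) ⟩
  two * ι (suc q) * ι (suc (q ℕ.+ q)) * oddFactorial q
    ≡⟨ solve 4 (λ t b a d → t :* b :* a :* d := t :* b :* (d :* a)) refl two (ι (suc q)) (ι (suc (q ℕ.+ q))) (oddFactorial q) ⟩
  two * ι (suc q) * oddFactorial (suc q) ∎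

uCoeff-oddFactorial : ∀ q → uCoeff q * oddFactorial (suc q) ≡ two * ι (suc q) * oddFactorial (suc (suc q))
uCoeff-oddFactorial q = begin
  ι (suc (suc q ℕ.+ suc q)) * ι (suc q ℕ.+ suc q) * oddFactorial (suc q)
    ≡⟨ cong (λ z → ι (suc (suc q ℕ.+ suc q)) * z * oddFactorial (suc q)) (trans (ι-+ (suc q) (suc q)) (sym (two*x≡x+x (ι (suc q))))) ⟩
  ι (suc (suc q ℕ.+ suc q)) * (two * ι (suc q)) * oddFactorial (suc q)
    ≡⟨ solve 4 (λ a t b d → a :* (t :* b) :* d := t :* b :* (d :* a)) refl (ι (suc (suc q ℕ.+ suc q))) two (ι (suc q)) (oddFactorial (suc q)) ⟩
  two * ι (suc q) * oddFactorial (suc (suc q)) ∎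

module TBinomial = BinomialSum tNum tCoeff oddFactorial 0ℚ tNum-recurrence₀ tNum-recurrence refl tNum-0 tCoeff-oddFactorial

module UBinomial = BinomialSum uNum uCoeff (λ q → oddFactorial (suc q)) 1ℚ uNum-recurrence₀ uNum-recurrence refl uNum-1 uCoeff-oddFactorial

tTerm : ℕ → ℕ → ℕ → ℚ
tTerm p q l = ι (p C l) * tNum (0ℚ + ι p - two * ι l) q

tTerm-reflect : ∀ p q l → l ≤ p → tTerm p q (p ℕ.∸ l) ≡ tTerm p q l
tTerm-reflect p q l l≤p = cong₂ _*_ (cong ι (sym (nCk≡nC[n∸k] l≤p))) (begin
  tNum (0ℚ + ι p - two * ι (p ℕ.∸ l)) q       ≡⟨ cong (λ z → tNum (0ℚ + ι p - two * z) q) (ι-∸ p l l≤p) ⟩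
  tNum (0ℚ + ι p - two * (ι p - ι l)) q       ≡⟨ cong (λ z → tNum z q) reflected ⟩
  tNum (- (0ℚ + ι p - two * ι l)) q           ≡⟨ tNum-neg _ q ⟩
  tNum (0ℚ + ι p - two * ι l) q               ∎)
  where
  reflected : 0ℚ + ι p - two * (ι p - ι l) ≡ - (0ℚ + ι p - two * ι l)
  reflected = trans (cong (λ t → 0ℚ + ι p - t * (ι p - ι l)) two≡1+1) (trans
    (solve 2 (λ a b → con 0ℚ :+ a :- (con 1ℚ :+ con 1ℚ) :* (a :- b) := :- (con 0ℚ :+ a :- (con 1ℚ :+ con 1ℚ) :* b)) refl (ι p) (ι l))
    (cong (λ t → - (0ℚ + ι p - t * ι l)) (sym two≡1+1)))

tHalfTerm : ℕ → ℕ → ℕ → ℚ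
tHalfTerm p q l = inv (cc (p ℕ.∸ 2 ℕ.* l)) * (ι (p C l) * tNum (ι (p ℕ.∸ 2 ℕ.* l)) q)

tHalfTerm≡tTerm : ∀ p q l → 2 ℕ.* l < p → tHalfTerm p q l ≡ tTerm p q l
tHalfTerm≡tTerm p q l 2l<p = begin
  inv (cc (p ℕ.∸ 2 ℕ.* l)) * (ι (p C l) * tNum (ι (p ℕ.∸ 2 ℕ.* l)) q)
    ≡⟨ cong (λ z → inv z * (ι (p C l) * tNum (ι (p ℕ.∸ 2 ℕ.* l)) q)) (cc-suc (p ℕ.∸ 2 ℕ.* l) (ℕP.m>n⇒m∸n≢0 2l<p)) ⟩
  1ℚ * (ι (p C l) * tNum (ι (p ℕ.∸ 2 ℕ.* l)) q)
    ≡⟨ QP.*-identityˡ _ ⟩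
  ι (p C l) * tNum (ι (p ℕ.∸ 2 ℕ.* l)) q
    ≡⟨ cong (λ z → ι (p C l) * tNum z q) (trans (ι-∸-2* p l (ℕP.<⇒≤ 2l<p)) (cong (_- two * ι l) (sym (QP.+-identityˡ (ι p))))) ⟩
  tTerm p q l ∎
  where
  cc-suc : ∀ n → n ≢ 0 → cc n ≡ 1ℚ
  cc-suc zero    n≢0 = ⊥-elim (n≢0 refl)
  cc-suc (suc n) _   = refl

-- Terms l and p − l of the full binomial sum are equal; for even p the middle one is counted once, whence 1/c₀ = 1/2.
tHalfSum-odd : ∀ h q → two * sumTo h (tHalfTerm (suc (h ℕ.+ h)) q) ≡ TBinomial.binomialSum (suc (h ℕ.+ h)) q
tHalfSum-odd h q = begin
  two * sumTo h (tHalfTerm p q)                       ≡⟨ cong (two *_) (sumTo-cong h (λ l l≤h → tHalfTerm≡tTerm p q l (s≤s (l≤h⇒2l≤h+h l≤h)))) ⟩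
  two * sumTo h (tTerm p q)                           ≡⟨ sumTo-symmetric h p (tTerm p q) (λ l l≤h → tTerm-reflect p q l (ℕP.m≤n⇒m≤1+n (ℕP.≤-trans l≤h (ℕP.m≤m+n h h)))) ⟨
  sumTo h (λ l → tTerm p q l + tTerm p q (p ℕ.∸ l)) ≡⟨ sumTo-fold-odd h (h ℕ.+ h) (tTerm p q) refl ⟨
  TBinomial.binomialSum p q                           ∎
  where
  p = suc (h ℕ.+ h)

tHalfSum-even : ∀ h q → two * sumTo h (tHalfTerm (h ℕ.+ h) q) ≡ TBinomial.binomialSum (h ℕ.+ h) q
tHalfSum-even zero    q = begin
  two * (inv two * (1ℚ * tNum (ι 0) q)) ≡⟨ solve 3 (λ t i P → t :* (i :* (con 1ℚ :* P)) := (t :* i) :* P) refl two (inv two) (tNum (ι 0) q) ⟩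
  two * inv two * tNum (ι 0) q          ≡⟨ cong (_* tNum (ι 0) q) (inv-inverseʳ two two≢0) ⟩
  1ℚ * tNum 0ℚ q                        ≡⟨ cong (λ z → 1ℚ * tNum z q) (solve 1 (λ t → con 0ℚ := con 0ℚ :+ con 0ℚ :- t :* con 0ℚ) refl two) ⟩
  TBinomial.binomialSum 0 q             ∎
tHalfSum-even (suc h) q = begin
  two * (S + tHalfTerm p q (suc h))
    ≡⟨ cong₂ (λ a b → two * (a + b)) (sumTo-cong h (λ l l≤h → tHalfTerm≡tTerm p q l (2l<p l≤h))) middle ⟩
  two * (S′ + inv two * t)
    ≡⟨ solve 4 (λ w S i F → w :* (S :+ i :* F) := w :* S :+ (w :* i) :* F) refl two S′ (inv two) t ⟩
  two * S′ + two * inv two * t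
    ≡⟨ cong (λ z → two * S′ + z * t) (inv-inverseʳ two two≢0) ⟩
  two * S′ + 1ℚ * t
    ≡⟨ trans (cong (λ w → w * S′ + 1ℚ * t) two≡1+1) (trans (solve 2 (λ S F → (con 1ℚ :+ con 1ℚ) :* S :+ con 1ℚ :* F := (con 1ℚ :+ con 1ℚ) :* (S :+ F) :- F) refl S′ t) (cong (λ w → w * (S′ + t) - t) (sym two≡1+1))) ⟩
  two * sumTo (suc h) (tTerm p q) - t
    ≡⟨ cong (_- t) (sumTo-symmetric (suc h) p (tTerm p q) (λ l l≤h → tTerm-reflect p q l (ℕP.≤-trans l≤h (ℕP.m≤m+n (suc h) (suc h))))) ⟨
  sumTo (suc h) (λ l → tTerm p q l + tTerm p q (p ℕ.∸ l)) - t
    ≡⟨ cong (_- t) (sumTo-fold-even (suc h) p (tTerm p q) refl) ⟨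
  TBinomial.binomialSum p q + t - t
    ≡⟨ solve 2 (λ a b → a :+ b :- b := a) refl (TBinomial.binomialSum p q) t ⟩
  TBinomial.binomialSum p q ∎
  where
  p = suc h ℕ.+ suc h
  S = sumTo h (tHalfTerm p q)
  S′ = sumTo h (tTerm p q)
  t = tTerm p q (suc h)
  2l<p : ∀ {l} → l ≤ h → 2 ℕ.* l < p
  2l<p {l} l≤h = subst (2 ℕ.* l <_) (sym ([1+n]+[1+n]≡2+[n+n] h)) (s≤s (ℕP.m≤n⇒m≤1+n (l≤h⇒2l≤h+h l≤h)))
  p∸2[1+h]≡0 : p ℕ.∸ 2 ℕ.* suc h ≡ 0
  p∸2[1+h]≡0 = trans (cong (p ℕ.∸_) (2*n≡n+n (suc h))) (ℕP.n∸n≡0 p)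
  middle : tHalfTerm p q (suc h) ≡ inv two * tTerm p q (suc h)
  middle = cong₂ (λ a b → inv (cc a) * (ι (p C suc h) * tNum b q)) p∸2[1+h]≡0
    (trans (ι-∸-2* p (suc h) (ℕP.≤-reflexive (2*n≡n+n (suc h)))) (cong (_- two * ι (suc h)) (sym (QP.+-identityˡ (ι p)))))

tHalfSum : ∀ p q → two * sumTo ⌊ p /2⌋ (tHalfTerm p q) ≡ TBinomial.binomialSum p q
tHalfSum p q with parity p
... | inj₁ e = subst (λ z → two * sumTo ⌊ p /2⌋ (tHalfTerm z q) ≡ TBinomial.binomialSum z q) (sym e) (tHalfSum-even ⌊ p /2⌋ q)
... | inj₂ e = subst (λ z → two * sumTo ⌊ p /2⌋ (tHalfTerm z q) ≡ TBinomial.binomialSum z q) (sym e) (tHalfSum-odd ⌊ p /2⌋ q)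

binomial : ℕ → ℕ → ℚ
binomial p l = ι (p C l)

uTerm : ℕ → ℕ → ℕ → ℚ
uTerm p q l = uNum (1ℚ + ι p - two * ι l) q

uHalfTerm : ℕ → ℕ → ℕ → ℚ
uHalfTerm p q l = ι (suc p C l) * ι (suc p ℕ.∸ 2 ℕ.* l) * uNum (ι (suc p ℕ.∸ 2 ℕ.* l)) q

binomial-difference : ∀ p l → 2 ℕ.* l ≤ suc p →
  ι (suc p C l) * ι (suc p ℕ.∸ 2 ℕ.* l) ≡ ι (suc p) * (binomial p l - prev (binomial p) l)
binomial-difference p zero    _    = solve 1 (λ n → con 1ℚ :* n := n :* (con 1ℚ :- con 0ℚ)) refl (ι (suc p))
binomial-difference p (suc l) 2l≤p = begin
  X * ι (suc p ℕ.∸ 2 ℕ.* suc l)        ≡⟨ cong (X *_) (ι-∸-2* (suc p) (suc l) 2l≤p) ⟩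
  X * (N - two * L)                     ≡⟨ cong (λ t → X * (N - t * L)) two≡1+1 ⟩
  X * (N - (1ℚ + 1ℚ) * L)               ≡⟨ solve 3 (λ x n l → x :* (n :- (con 1ℚ :+ con 1ℚ) :* l) := n :* x :- (con 1ℚ :+ con 1ℚ) :* (l :* x)) refl X N L ⟩
  N * X - (1ℚ + 1ℚ) * (L * X)           ≡⟨ cong₂ (λ a b → N * a - (1ℚ + 1ℚ) * b) pascal absorption ⟩
  N * (c₀ + c₁) - (1ℚ + 1ℚ) * (N * c₀)  ≡⟨ solve 3 (λ n a b → n :* (a :+ b) :- (con 1ℚ :+ con 1ℚ) :* (n :* a) := n :* (b :- a)) refl N c₀ c₁ ⟩
  N * (c₁ - c₀)                         ∎
  where
  X = ι (suc p C suc l)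
  N = ι (suc p)
  L = ι (suc l)
  c₀ = ι (p C l)
  c₁ = ι (p C suc l)
  absorption : L * X ≡ N * c₀
  absorption = trans (sym (ι-* (suc l) (suc p C suc l))) (trans (cong ι ([1+k]*[1+n]C[1+k]≡[1+n]*nCk p l)) (ι-* (suc p) (p C l)))
  pascal : X ≡ c₀ + c₁
  pascal = trans (cong ι (sym (nCk+nC[k+1]≡[n+1]C[k+1] p l))) (ι-+ (p C l) (p C suc l))

uHalfTerm-difference : ∀ p q l → 2 ℕ.* l ≤ suc p → uHalfTerm p q l ≡ ι (suc p) * ((binomial p l - prev (binomial p) l) * uTerm p q l)
uHalfTerm-difference p q l 2l≤p = begin
  ι (suc p C l) * ι (suc p ℕ.∸ 2 ℕ.* l) * uNum (ι (suc p ℕ.∸ 2 ℕ.* l)) q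
    ≡⟨ cong₂ _*_ (binomial-difference p l 2l≤p) (cong (λ z → uNum z q) (trans (ι-∸-2* (suc p) l 2l≤p) (cong (_- two * ι l) (ι-suc p)))) ⟩
  ι (suc p) * (binomial p l - prev (binomial p) l) * uTerm p q l
    ≡⟨ QP.*-assoc (ι (suc p)) _ _ ⟩
  ι (suc p) * ((binomial p l - prev (binomial p) l) * uTerm p q l) ∎

uTerm-reflect : ∀ p q l → l ≤ p → uTerm p q (p ℕ.∸ l) ≡ - uTerm p q (suc l)
uTerm-reflect p q l l≤p = trans (cong (λ z → uNum z q) reflected) (uNum-neg (1ℚ + ι p - two * ι (suc l)) q)
  where
  reflected : 1ℚ + ι p - two * ι (p ℕ.∸ l) ≡ - (1ℚ + ι p - two * ι (suc l))
  reflected = begin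
    1ℚ + ι p - two * ι (p ℕ.∸ l)           ≡⟨ cong₂ (λ a b → 1ℚ + ι p - a * b) two≡1+1 (ι-∸ p l l≤p) ⟩
    1ℚ + ι p - (1ℚ + 1ℚ) * (ι p - ι l)     ≡⟨ solve 2 (λ a b → con 1ℚ :+ a :- (con 1ℚ :+ con 1ℚ) :* (a :- b) := :- (con 1ℚ :+ a :- (con 1ℚ :+ con 1ℚ) :* (con 1ℚ :+ b))) refl (ι p) (ι l) ⟩
    - (1ℚ + ι p - (1ℚ + 1ℚ) * (1ℚ + ι l))  ≡⟨ cong₂ (λ a b → - (1ℚ + ι p - a * b)) two≡1+1 (ι-suc l) ⟨
    - (1ℚ + ι p - two * ι (suc l))         ∎

uTerm-pair : ∀ p q l → l ≤ p →
  binomial p l * uTerm p q l + binomial p (p ℕ.∸ l) * uTerm p q (p ℕ.∸ l) ≡ binomial p l * (uTerm p q l - uTerm p q (suc l))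
uTerm-pair p q l l≤p = begin
  binomial p l * uTerm p q l + binomial p (p ℕ.∸ l) * uTerm p q (p ℕ.∸ l)
    ≡⟨ cong₂ (λ a b → binomial p l * uTerm p q l + a * b) (cong ι (sym (nCk≡nC[n∸k] l≤p))) (uTerm-reflect p q l l≤p) ⟩
  binomial p l * uTerm p q l + binomial p l * (- uTerm p q (suc l))
    ≡⟨ solve 3 (λ a u v → a :* u :+ a :* (:- v) := a :* (u :- v)) refl (binomial p l) (uTerm p q l) (uTerm p q (suc l)) ⟩
  binomial p l * (uTerm p q l - uTerm p q (suc l)) ∎

uHalfSum-abel : ∀ p h q → h ℕ.+ h ≤ p →
  sumTo h (uHalfTerm p q) ≡ ι (suc p) * (sumTo h (λ l → binomial p l * (uTerm p q l - uTerm p q (suc l))) + binomial p h * uTerm p q (suc h))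
uHalfSum-abel p h q 2h≤p = begin
  sumTo h (uHalfTerm p q)
    ≡⟨ sumTo-cong h (λ l l≤h → uHalfTerm-difference p q l (ℕP.m≤n⇒m≤1+n (ℕP.≤-trans (l≤h⇒2l≤h+h l≤h) 2h≤p))) ⟩
  sumTo h (λ l → ι (suc p) * ((binomial p l - prev (binomial p) l) * uTerm p q l))
    ≡⟨ sumTo-*ˡ h (ι (suc p)) _ ⟩
  ι (suc p) * sumTo h (λ l → (binomial p l - prev (binomial p) l) * uTerm p q l)
    ≡⟨ cong (ι (suc p) *_) (abel-summation h (binomial p) (uTerm p q)) ⟩
  ι (suc p) * (sumTo h (λ l → binomial p l * (uTerm p q l - uTerm p q (suc l))) + binomial p h * uTerm p q (suc h)) ∎

uHalfSum-odd : ∀ h q → sumTo h (uHalfTerm (suc (h ℕ.+ h)) q) ≡ ι (suc (suc (h ℕ.+ h))) * UBinomial.binomialSum (suc (h ℕ.+ h)) q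
uHalfSum-odd h q = begin
  sumTo h (uHalfTerm p q)
    ≡⟨ uHalfSum-abel p h q (ℕP.n≤1+n _) ⟩
  ι (suc p) * (S + binomial p h * uTerm p q (suc h))
    ≡⟨ cong (λ z → ι (suc p) * (S + binomial p h * z)) boundary ⟩
  ι (suc p) * (S + binomial p h * 0ℚ)
    ≡⟨ cong (ι (suc p) *_) (trans (cong (S +_) (QP.*-zeroʳ (binomial p h))) (QP.+-identityʳ S)) ⟩
  ι (suc p) * S
    ≡⟨ cong (ι (suc p) *_) (sumTo-cong h (λ l l≤h → uTerm-pair p q l (ℕP.m≤n⇒m≤1+n (ℕP.≤-trans l≤h (ℕP.m≤m+n h h))))) ⟨
  ι (suc p) * sumTo h (λ l → binomial p l * uTerm p q l + binomial p (p ℕ.∸ l) * uTerm p q (p ℕ.∸ l))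
    ≡⟨ cong (ι (suc p) *_) (sumTo-fold-odd h (h ℕ.+ h) (λ l → binomial p l * uTerm p q l) refl) ⟨
  ι (suc p) * UBinomial.binomialSum p q ∎
  where
  p = suc (h ℕ.+ h)
  S = sumTo h (λ l → binomial p l * (uTerm p q l - uTerm p q (suc l)))
  boundary : uTerm p q (suc h) ≡ 0ℚ
  boundary = trans (cong (λ z → uNum z q) (begin
    1ℚ + ι p - two * ι (suc h)                     ≡⟨ cong₂ (λ a b → 1ℚ + a - b) (ι-1+2n h) (cong₂ _*_ two≡1+1 (ι-suc h)) ⟩
    1ℚ + (1ℚ + ι h + ι h) - (1ℚ + 1ℚ) * (1ℚ + ι h) ≡⟨ solve 1 (λ a → con 1ℚ :+ (con 1ℚ :+ a :+ a) :- (con 1ℚ :+ con 1ℚ) :* (con 1ℚ :+ a) := con 0ℚ) refl (ι h) ⟩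
    0ℚ                                             ∎)) (uNum-0 q)

uHalfSum-even : ∀ h q → sumTo h (uHalfTerm (h ℕ.+ h) q) ≡ ι (suc (h ℕ.+ h)) * UBinomial.binomialSum (h ℕ.+ h) q
uHalfSum-even h q = begin
  sumTo h (uHalfTerm p q)
    ≡⟨ uHalfSum-abel p h q ℕP.≤-refl ⟩
  ι (suc p) * (S + binomial p h * uTerm p q (suc h))
    ≡⟨ cong (λ z → ι (suc p) * (S + binomial p h * z)) beyond-middle ⟩
  ι (suc p) * (S + binomial p h * (- uNum 1ℚ q))
    ≡⟨ cong (λ z → ι (suc p) * (z + binomial p h * (- uNum 1ℚ q))) (sumTo-cong h (λ l l≤h → uTerm-pair p q l (ℕP.≤-trans l≤h (ℕP.m≤m+n h h)))) ⟨
  ι (suc p) * (sumTo h (λ l → binomial p l * uTerm p q l + binomial p (p ℕ.∸ l) * uTerm p q (p ℕ.∸ l)) + binomial p h * (- uNum 1ℚ q))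
    ≡⟨ cong (λ z → ι (suc p) * (z + binomial p h * (- uNum 1ℚ q))) (sumTo-fold-even h p (λ l → binomial p l * uTerm p q l) refl) ⟨
  ι (suc p) * (B + binomial p h * uTerm p q h + binomial p h * (- uNum 1ℚ q))
    ≡⟨ cong (λ z → ι (suc p) * (B + binomial p h * uNum z q + binomial p h * (- uNum 1ℚ q))) middle ⟩
  ι (suc p) * (B + binomial p h * uNum 1ℚ q + binomial p h * (- uNum 1ℚ q))
    ≡⟨ cong (ι (suc p) *_) (solve 3 (λ F a u → F :+ a :* u :+ a :* (:- u) := F) refl B (binomial p h) (uNum 1ℚ q)) ⟩
  ι (suc p) * B ∎
  where
  p = h ℕ.+ h
  B = UBinomial.binomialSum p q
  S = sumTo h (λ l → binomial p l * (uTerm p q l - uTerm p q (suc l)))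
  beyond-middle : uTerm p q (suc h) ≡ - uNum 1ℚ q
  beyond-middle = trans (cong (λ z → uNum z q) (begin
    1ℚ + ι p - two * ι (suc h)                 ≡⟨ cong₂ (λ a b → 1ℚ + a - b) (ι-+ h h) (cong₂ _*_ two≡1+1 (ι-suc h)) ⟩
    1ℚ + (ι h + ι h) - (1ℚ + 1ℚ) * (1ℚ + ι h)  ≡⟨ solve 1 (λ a → con 1ℚ :+ (a :+ a) :- (con 1ℚ :+ con 1ℚ) :* (con 1ℚ :+ a) := :- con 1ℚ) refl (ι h) ⟩
    - 1ℚ                                       ∎)) (uNum-neg 1ℚ q)
  middle : 1ℚ + ι p - two * ι h ≡ 1ℚ
  middle = begin
    1ℚ + ι p - two * ι h              ≡⟨ cong₂ (λ a b → 1ℚ + a - b * ι h) (ι-+ h h) two≡1+1 ⟩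
    1ℚ + (ι h + ι h) - (1ℚ + 1ℚ) * ι h ≡⟨ solve 1 (λ a → con 1ℚ :+ (a :+ a) :- (con 1ℚ :+ con 1ℚ) :* a := con 1ℚ) refl (ι h) ⟩
    1ℚ                                ∎

-- (p+1 choose l)(p+1−2l) = (p+1)((p choose l) − (p choose l−1)); after Abel summation the terms l and p − l
-- of the full sum combine, uNum being odd.
uHalfSum : ∀ p q → sumTo ⌊ p /2⌋ (uHalfTerm p q) ≡ ι (suc p) * UBinomial.binomialSum p q
uHalfSum p q with parity p
... | inj₁ e = subst (λ z → sumTo ⌊ p /2⌋ (uHalfTerm z q) ≡ ι (suc z) * UBinomial.binomialSum z q) (sym e) (uHalfSum-even ⌊ p /2⌋ q)
... | inj₂ e = subst (λ z → sumTo ⌊ p /2⌋ (uHalfTerm z q) ≡ ι (suc z) * UBinomial.binomialSum z q) (sym e) (uHalfSum-odd ⌊ p /2⌋ q)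

-- Derivatives of Fibonacci polynomials at 1

derivAt1 : ℕ → Poly → ℕ
derivAt1 q p = eval1 (derivN q p)

⊕-identityʳ : ∀ p → p ⊕ [] ≡ p
⊕-identityʳ []      = refl
⊕-identityʳ (a ∷ p) = refl

derivAux-⊕ : ∀ k p r → derivAux k (p ⊕ r) ≡ derivAux k p ⊕ derivAux k r
derivAux-⊕ k []      r       = refl
derivAux-⊕ k (a ∷ p) []      = refl
derivAux-⊕ k (a ∷ p) (b ∷ r) = cong₂ _∷_ (ℕP.*-distribˡ-+ k a b) (derivAux-⊕ (suc k) p r)

deriv-⊕ : ∀ p r → deriv (p ⊕ r) ≡ deriv p ⊕ deriv r
deriv-⊕ []      r       = refl
deriv-⊕ (a ∷ p) []      = sym (⊕-identityʳ (derivAux 1 p))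
deriv-⊕ (a ∷ p) (b ∷ r) = derivAux-⊕ 1 p r

derivN-⊕ : ∀ q p r → derivN q (p ⊕ r) ≡ derivN q p ⊕ derivN q r
derivN-⊕ zero    p r = refl
derivN-⊕ (suc q) p r = trans (cong deriv (derivN-⊕ q p r)) (deriv-⊕ (derivN q p) (derivN q r))

derivN-suc : ∀ q p → derivN (suc q) p ≡ derivN q (deriv p)
derivN-suc zero    p = refl
derivN-suc (suc q) p = cong deriv (derivN-suc q p)

derivN-[] : ∀ q → derivN q [] ≡ []
derivN-[] zero    = refl
derivN-[] (suc q) = cong deriv (derivN-[] q)

-- the product rule for x · p, in the form (x p)′ = p + x p′
derivAux-suc : ∀ k p → derivAux (suc k) p ≡ p ⊕ derivAux k p
derivAux-suc k []      = refl
derivAux-suc k (b ∷ p) = cong (suc k ℕ.* b ∷_) (derivAux-suc (suc k) p)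

eval1-⊕ : ∀ p r → eval1 (p ⊕ r) ≡ eval1 p ℕ.+ eval1 r
eval1-⊕ []      r       = refl
eval1-⊕ (a ∷ p) []      = sym (ℕP.+-identityʳ _)
eval1-⊕ (a ∷ p) (b ∷ r) = trans (cong ((a ℕ.+ b) ℕ.+_) (eval1-⊕ p r))
  (NS.solve 4 (λ a b x y → a NS.:+ b NS.:+ (x NS.:+ y) NS.:= a NS.:+ x NS.:+ (b NS.:+ y)) refl a b (eval1 p) (eval1 r))

derivAt1-⊕ : ∀ q p r → derivAt1 q (p ⊕ r) ≡ derivAt1 q p ℕ.+ derivAt1 q r
derivAt1-⊕ q p r = trans (cong eval1 (derivN-⊕ q p r)) (eval1-⊕ (derivN q p) (derivN q r))

derivAt1-[] : ∀ q → derivAt1 q [] ≡ 0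
derivAt1-[] q = cong eval1 (derivN-[] q)

derivAt1-deriv : ∀ q p → derivAt1 q (deriv p) ≡ derivAt1 (suc q) p
derivAt1-deriv q p = cong eval1 (sym (derivN-suc q p))

derivAt1-X* : ∀ q p → derivAt1 q (X* p) ≡ derivAt1 q p ℕ.+ q ℕ.* derivAt1 (q ℕ.∸ 1) p
derivAt1-X* zero    p       = sym (ℕP.+-identityʳ (eval1 p))
derivAt1-X* (suc q) []      = begin
  derivAt1 (suc q) (0 ∷ [])                          ≡⟨ derivAt1-deriv q (0 ∷ []) ⟨
  derivAt1 q []                                      ≡⟨ derivAt1-[] q ⟩
  0                                                  ≡⟨ ℕP.*-zeroʳ (suc q) ⟨
  0 ℕ.+ suc q ℕ.* 0                                  ≡⟨ cong₂ (λ a b → a ℕ.+ suc q ℕ.* b) (derivAt1-[] (suc q)) (derivAt1-[] q) ⟨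
  derivAt1 (suc q) [] ℕ.+ suc q ℕ.* derivAt1 q []    ∎
derivAt1-X* (suc q) (b ∷ p) = begin
  derivAt1 (suc q) (X* r)                                 ≡⟨ derivAt1-deriv q (X* r) ⟨
  derivAt1 q (derivAux 1 r)                               ≡⟨ cong (derivAt1 q) (derivAux-suc 0 r) ⟩
  derivAt1 q (r ⊕ X* (deriv r))                           ≡⟨ derivAt1-⊕ q r (X* (deriv r)) ⟩
  derivAt1 q r ℕ.+ derivAt1 q (X* (deriv r))              ≡⟨ cong (derivAt1 q r ℕ.+_) (derivAt1-X* q (deriv r)) ⟩
  derivAt1 q r ℕ.+ (derivAt1 q (deriv r) ℕ.+ q ℕ.* derivAt1 (q ℕ.∸ 1) (deriv r))
    ≡⟨ cong₂ (λ x y → derivAt1 q r ℕ.+ (x ℕ.+ y)) (derivAt1-deriv q r) (lower q) ⟩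
  derivAt1 q r ℕ.+ (derivAt1 (suc q) r ℕ.+ q ℕ.* derivAt1 q r)
    ≡⟨ NS.solve 3 (λ x y q → x NS.:+ (y NS.:+ q NS.:* x) NS.:= y NS.:+ (NS.con 1 NS.:+ q) NS.:* x) refl (derivAt1 q r) (derivAt1 (suc q) r) q ⟩
  derivAt1 (suc q) r ℕ.+ suc q ℕ.* derivAt1 q r           ∎
  where
  r = b ∷ p
  lower : ∀ k → k ℕ.* derivAt1 (k ℕ.∸ 1) (deriv r) ≡ k ℕ.* derivAt1 k r
  lower zero    = refl
  lower (suc k) = cong (suc k ℕ.*_) (derivAt1-deriv k r)

fibD-rec : ∀ q n → fibD q (suc (suc n)) ≡ fibD q (suc n) ℕ.+ q ℕ.* fibD (q ℕ.∸ 1) (suc n) ℕ.+ fibD q n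
fibD-rec q n = trans (derivAt1-⊕ q (X* (fibPoly (suc n))) (fibPoly n)) (cong (ℕ._+ fibD q n) (derivAt1-X* q (fibPoly (suc n))))

fibTerm : ℕ → ℕ → ℕ → ℚ
fibTerm q j i = ι ((j ℕ.∸ i) C i) * falling (ι (j ℕ.∸ 2 ℕ.* i)) q

fibSum : ℕ → ℕ → ℚ
fibSum j q = sumTo ⌊ j /2⌋ (fibTerm q j)

fibSum-extend : ∀ N j q → ⌊ j /2⌋ ≤ N → sumTo N (fibTerm q j) ≡ fibSum j q
fibSum-extend N j q ⌊j/2⌋≤N = sumTo-vanishing-tail ⌊ j /2⌋ N (fibTerm q j) ⌊j/2⌋≤N (λ i ⌊j/2⌋<i →
  trans (cong (λ z → ι z * falling (ι (j ℕ.∸ 2 ℕ.* i)) q) (k>n⇒nCk≡0 (⌊n/2⌋<i⇒n∸i<i j i ⌊j/2⌋<i))) (QP.*-zeroˡ (falling (ι (j ℕ.∸ 2 ℕ.* i)) q)))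

pascal-step : ∀ (c₀ c₁ A B B′ z : ℚ) → A ≡ B + z * B′ ⊎ c₁ ≡ 0ℚ → (c₀ + c₁) * A ≡ c₁ * B + z * (c₁ * B′) + c₀ * A
pascal-step c₀ c₁ A B B′ z (inj₁ A≡B+zB′) = begin
  (c₀ + c₁) * A                               ≡⟨ cong ((c₀ + c₁) *_) A≡B+zB′ ⟩
  (c₀ + c₁) * (B + z * B′)                    ≡⟨ solve 5 (λ a b x z w → (a :+ b) :* (x :+ z :* w) := b :* x :+ z :* (b :* w) :+ a :* (x :+ z :* w)) refl c₀ c₁ B z B′ ⟩
  c₁ * B + z * (c₁ * B′) + c₀ * (B + z * B′)  ≡⟨ cong (λ w → c₁ * B + z * (c₁ * B′) + c₀ * w) A≡B+zB′ ⟨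
  c₁ * B + z * (c₁ * B′) + c₀ * A             ∎
pascal-step c₀ c₁ A B B′ z (inj₂ c₁≡0) = begin
  (c₀ + c₁) * A                   ≡⟨ cong (λ w → (c₀ + w) * A) c₁≡0 ⟩
  (c₀ + 0ℚ) * A                   ≡⟨ solve 5 (λ a x y w v → (a :+ con 0ℚ) :* x := con 0ℚ :* y :+ w :* (con 0ℚ :* v) :+ a :* x) refl c₀ A B z B′ ⟩
  0ℚ * B + z * (0ℚ * B′) + c₀ * A ≡⟨ cong (λ w → w * B + z * (w * B′) + c₀ * A) c₁≡0 ⟨
  c₁ * B + z * (c₁ * B′) + c₀ * A ∎

falling-pascal-or-vanish : ∀ j q i → 2 ℕ.* i ≤ j →
  falling (ι (j ℕ.∸ 2 ℕ.* i)) q ≡ falling (ι (j ℕ.∸ suc (2 ℕ.* i))) q + ι q * falling (ι (j ℕ.∸ suc (2 ℕ.* i))) (q ℕ.∸ 1)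
    ⊎ ι ((j ℕ.∸ i) C suc i) ≡ 0ℚ
falling-pascal-or-vanish j q i 2i≤j with suc (2 ℕ.* i) ℕ.≤? j
... | yes 2i<j = inj₁ (trans (cong (λ z → falling z q) j-2i≡j-2i-1+1) (falling-pascal′ (ι (j ℕ.∸ suc (2 ℕ.* i))) q))
  where
  j-2i≡j-2i-1+1 : ι (j ℕ.∸ 2 ℕ.* i) ≡ ι (j ℕ.∸ suc (2 ℕ.* i)) + 1ℚ
  j-2i≡j-2i-1+1 = begin
    ι (j ℕ.∸ 2 ℕ.* i)                 ≡⟨ ι-∸ j (2 ℕ.* i) 2i≤j ⟩
    ι j - ι (2 ℕ.* i)                 ≡⟨ solve 2 (λ a b → a :- b := a :- (con 1ℚ :+ b) :+ con 1ℚ) refl (ι j) (ι (2 ℕ.* i)) ⟩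
    ι j - (1ℚ + ι (2 ℕ.* i)) + 1ℚ     ≡⟨ cong (λ z → ι j - z + 1ℚ) (ι-suc (2 ℕ.* i)) ⟨
    ι j - ι (suc (2 ℕ.* i)) + 1ℚ      ≡⟨ cong (_+ 1ℚ) (ι-∸ j (suc (2 ℕ.* i)) 2i<j) ⟨
    ι (j ℕ.∸ suc (2 ℕ.* i)) + 1ℚ      ∎
... | no 2i≮j = inj₂ (cong ι (k>n⇒nCk≡0 (s≤s (subst (j ℕ.∸ i ≤_) (ℕP.m+n∸m≡n i i)
        (subst (λ z → j ℕ.∸ i ≤ z ℕ.∸ i) (cong (i ℕ.+_) (ℕP.+-identityʳ i)) (ℕP.∸-monoˡ-≤ i (ℕP.≤-pred (ℕP.≰⇒> 2i≮j))))))))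

fibTerm-rec : ∀ j q i → 2 ℕ.* i ≤ j →
  fibTerm q (suc (suc j)) (suc i) ≡ fibTerm q (suc j) (suc i) + ι q * fibTerm (q ℕ.∸ 1) (suc j) (suc i) + fibTerm q j i
fibTerm-rec j q i 2i≤j = begin
  ι ((suc j ℕ.∸ i) C suc i) * falling (ι (suc (suc j) ℕ.∸ 2 ℕ.* suc i)) q
    ≡⟨ cong₂ (λ a b → ι (a C suc i) * falling (ι b) q) (ℕP.+-∸-assoc 1 i≤j) (cong (suc (suc j) ℕ.∸_) (ℕP.*-suc 2 i)) ⟩
  ι (suc (j ℕ.∸ i) C suc i) * A
    ≡⟨ cong (λ z → ι z * A) (sym (nCk+nC[k+1]≡[n+1]C[k+1] (j ℕ.∸ i) i)) ⟩
  ι ((j ℕ.∸ i) C i ℕ.+ (j ℕ.∸ i) C suc i) * A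
    ≡⟨ cong (_* A) (ι-+ ((j ℕ.∸ i) C i) ((j ℕ.∸ i) C suc i)) ⟩
  (c₀ + c₁) * A
    ≡⟨ pascal-step c₀ c₁ A (falling y q) (falling y (q ℕ.∸ 1)) (ι q) (falling-pascal-or-vanish j q i 2i≤j) ⟩
  c₁ * falling y q + ι q * (c₁ * falling y (q ℕ.∸ 1)) + c₀ * A
    ≡⟨ cong (λ a → c₁ * falling (ι a) q + ι q * (c₁ * falling (ι a) (q ℕ.∸ 1)) + c₀ * A) (cong (suc j ℕ.∸_) (sym (ℕP.*-suc 2 i))) ⟩
  fibTerm q (suc j) (suc i) + ι q * fibTerm (q ℕ.∸ 1) (suc j) (suc i) + fibTerm q j i ∎
  where
  i≤j : i ≤ j
  i≤j = ℕP.≤-trans (ℕP.m≤m+n i (i ℕ.+ 0)) 2i≤j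
  c₀ = ι ((j ℕ.∸ i) C i)
  c₁ = ι ((j ℕ.∸ i) C suc i)
  A = falling (ι (j ℕ.∸ 2 ℕ.* i)) q
  y = ι (j ℕ.∸ suc (2 ℕ.* i))

fibTerm-rec₀ : ∀ j q → fibTerm q (suc (suc j)) 0 ≡ fibTerm q (suc j) 0 + ι q * fibTerm (q ℕ.∸ 1) (suc j) 0
fibTerm-rec₀ j q = begin
  1ℚ * falling (ι (suc (suc j))) q
    ≡⟨ cong (λ z → 1ℚ * falling z q) (trans (ι-suc (suc j)) (QP.+-comm 1ℚ (ι (suc j)))) ⟩
  1ℚ * falling (ι (suc j) + 1ℚ) q
    ≡⟨ cong (1ℚ *_) (falling-pascal′ (ι (suc j)) q) ⟩
  1ℚ * (falling (ι (suc j)) q + ι q * falling (ι (suc j)) (q ℕ.∸ 1))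
    ≡⟨ solve 3 (λ a z b → con 1ℚ :* (a :+ z :* b) := con 1ℚ :* a :+ z :* (con 1ℚ :* b)) refl (falling (ι (suc j)) q) (ι q) (falling (ι (suc j)) (q ℕ.∸ 1)) ⟩
  1ℚ * falling (ι (suc j)) q + ι q * (1ℚ * falling (ι (suc j)) (q ℕ.∸ 1)) ∎

fibSum-rec : ∀ j q → fibSum (suc (suc j)) q ≡ fibSum (suc j) q + ι q * fibSum (suc j) (q ℕ.∸ 1) + fibSum j q
fibSum-rec j q = begin
  sumTo (suc h) (fibTerm q (suc (suc j)))
    ≡⟨ sumTo-suc h (fibTerm q (suc (suc j))) ⟩
  fibTerm q (suc (suc j)) 0 + sumTo h (λ i → fibTerm q (suc (suc j)) (suc i))
    ≡⟨ cong₂ _+_ (fibTerm-rec₀ j q) (sumTo-cong h (λ i i≤h → fibTerm-rec j q i (i≤⌊n/2⌋⇒2i≤n j i≤h))) ⟩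
  (a₀ + ι q * b₀) + sumTo h (λ i → fibTerm q (suc j) (suc i) + ι q * fibTerm (q ℕ.∸ 1) (suc j) (suc i) + fibTerm q j i)
    ≡⟨ cong ((a₀ + ι q * b₀) +_) (trans (sumTo-+ h _ _) (cong (_+ fibSum j q) (trans (sumTo-+ h _ _) (cong (Sa +_) (sumTo-*ˡ h (ι q) _))))) ⟩
  (a₀ + ι q * b₀) + ((Sa + ι q * Sb) + fibSum j q)
    ≡⟨ solve 6 (λ a z b sa sb l → (a :+ z :* b) :+ ((sa :+ z :* sb) :+ l) := (a :+ sa) :+ z :* (b :+ sb) :+ l) refl a₀ (ι q) b₀ Sa Sb (fibSum j q) ⟩
  (a₀ + Sa) + ι q * (b₀ + Sb) + fibSum j q
    ≡⟨ cong₂ (λ x y → x + ι q * y + fibSum j q) (sumTo-suc h (fibTerm q (suc j))) (sumTo-suc h (fibTerm (q ℕ.∸ 1) (suc j))) ⟨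
  sumTo (suc h) (fibTerm q (suc j)) + ι q * sumTo (suc h) (fibTerm (q ℕ.∸ 1) (suc j)) + fibSum j q
    ≡⟨ cong₂ (λ x y → x + ι q * y + fibSum j q) (fibSum-extend (suc h) (suc j) q ⌊1+j/2⌋≤1+h) (fibSum-extend (suc h) (suc j) (q ℕ.∸ 1) ⌊1+j/2⌋≤1+h) ⟩
  fibSum (suc j) q + ι q * fibSum (suc j) (q ℕ.∸ 1) + fibSum j q ∎
  where
  h = ⌊ j /2⌋
  a₀ = fibTerm q (suc j) 0
  b₀ = fibTerm (q ℕ.∸ 1) (suc j) 0
  Sa = sumTo h (λ i → fibTerm q (suc j) (suc i))
  Sb = sumTo h (λ i → fibTerm (q ℕ.∸ 1) (suc j) (suc i))
  ⌊1+j/2⌋≤1+h : ⌊ suc j /2⌋ ≤ suc h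
  ⌊1+j/2⌋≤1+h = ℕP.⌊n/2⌋-mono (ℕP.n≤1+n (suc j))

-- Both sides satisfy a(j + 2, q) = a(j + 1, q) + q a(j + 1, q − 1) + a(j, q), the Leibniz rule applied to Fⱼ₊₂ = x Fⱼ₊₁ + Fⱼ.
fibD≡fibSum : ∀ j q → ι (fibD q (suc j)) ≡ fibSum j q
fibD≡fibSum zero          zero          = refl
fibD≡fibSum zero          (suc q)       = begin
  ι (eval1 (derivN (suc q) (1 ∷ [])))   ≡⟨ cong ι (trans (sym (derivAt1-deriv q (1 ∷ []))) (derivAt1-[] q)) ⟩
  0ℚ                                    ≡⟨ trans (cong (1ℚ *_) (falling-vanishes 0 (suc q) (s≤s z≤n))) (QP.*-zeroʳ 1ℚ) ⟨
  fibSum 0 (suc q)                      ∎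
fibD≡fibSum (suc zero)    zero          = refl
fibD≡fibSum (suc zero)    (suc zero)    = refl
fibD≡fibSum (suc zero)    (suc (suc q)) = begin
  ι (eval1 (derivN (suc (suc q)) (0 ∷ 1 ∷ []))) ≡⟨ cong ι (trans (sym (trans (derivAt1-deriv q (1 ∷ [])) (derivAt1-deriv (suc q) (0 ∷ 1 ∷ [])))) (derivAt1-[] q)) ⟩
  0ℚ                                            ≡⟨ trans (cong (1ℚ *_) (falling-vanishes 1 (suc (suc q)) (s≤s (s≤s z≤n)))) (QP.*-zeroʳ 1ℚ) ⟨
  fibSum 1 (suc (suc q))                        ∎
fibD≡fibSum (suc (suc j)) q             = begin
  ι (fibD q (suc (suc (suc j))))
    ≡⟨ cong ι (fibD-rec q (suc j)) ⟩
  ι (fibD q (suc (suc j)) ℕ.+ q ℕ.* fibD (q ℕ.∸ 1) (suc (suc j)) ℕ.+ fibD q (suc j))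
    ≡⟨ trans (ι-+ (fibD q (suc (suc j)) ℕ.+ q ℕ.* fibD (q ℕ.∸ 1) (suc (suc j))) (fibD q (suc j)))
         (cong (_+ ι (fibD q (suc j))) (trans (ι-+ (fibD q (suc (suc j))) (q ℕ.* fibD (q ℕ.∸ 1) (suc (suc j)))) (cong (ι (fibD q (suc (suc j))) +_) (ι-* q (fibD (q ℕ.∸ 1) (suc (suc j))))))) ⟩
  ι (fibD q (suc (suc j))) + ι q * ι (fibD (q ℕ.∸ 1) (suc (suc j))) + ι (fibD q (suc j))
    ≡⟨ cong₂ (λ a b → a + ι q * b + ι (fibD q (suc j))) (fibD≡fibSum (suc j) q) (fibD≡fibSum (suc j) (q ℕ.∸ 1)) ⟩
  fibSum (suc j) q + ι q * fibSum (suc j) (q ℕ.∸ 1) + ι (fibD q (suc j))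
    ≡⟨ cong (λ c → fibSum (suc j) q + ι q * fibSum (suc j) (q ℕ.∸ 1) + c) (fibD≡fibSum j q) ⟩
  fibSum (suc j) q + ι q * fibSum (suc j) (q ℕ.∸ 1) + fibSum j q
    ≡⟨ fibSum-rec j q ⟨
  fibSum (suc (suc j)) q ∎

poch-ι : ∀ c k → poch (ι c) k ≡ ι (risingℕ c k)
poch-ι c zero    = refl
poch-ι c (suc k) = trans (cong₂ _*_ (poch-ι c k) (sym (ι-+ c k))) (sym (ι-* (risingℕ c k) (c ℕ.+ k)))

poch-neg : ∀ m k → k ≤ m → poch (- ι m) k * (- 1ℚ) ^ k ≡ ι (fallingℕ m k)
poch-neg m zero    _   = refl
poch-neg m (suc k) k<m = begin
  poch (- ι m) k * (- ι m + ι k) * (- 1ℚ * (- 1ℚ) ^ k)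
    ≡⟨ solve 4 (λ P x y s → P :* (:- x :+ y) :* (:- con 1ℚ :* s) := (P :* s) :* (x :- y)) refl (poch (- ι m) k) (ι m) (ι k) ((- 1ℚ) ^ k) ⟩
  poch (- ι m) k * (- 1ℚ) ^ k * (ι m - ι k)
    ≡⟨ cong₂ _*_ (poch-neg m k (ℕP.<⇒≤ k<m)) (sym (ι-∸ m k (ℕP.<⇒≤ k<m))) ⟩
  ι (fallingℕ m k) * ι (m ℕ.∸ k)
    ≡⟨ ι-* (fallingℕ m k) (m ℕ.∸ k) ⟨
  ι (fallingℕ m (suc k)) ∎

poch-½ : ∀ q → poch ½ q * two ^ q ≡ oddFactorial q
poch-½ zero    = refl
poch-½ (suc q) = begin
  poch ½ q * (½ + ι q) * (two * two ^ q)
    ≡⟨ solve 5 (λ P h x t T → P :* (h :+ x) :* (t :* T) := (P :* T) :* (h :* t :+ x :* t)) refl (poch ½ q) ½ (ι q) two (two ^ q) ⟩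
  poch ½ q * two ^ q * (½ * two + ι q * two)
    ≡⟨ cong (_* (½ * two + ι q * two)) (poch-½ q) ⟩
  oddFactorial q * (1ℚ + ι q * two)
    ≡⟨ cong (λ z → oddFactorial q * (1ℚ + ι q * z)) two≡1+1 ⟩
  oddFactorial q * (1ℚ + ι q * (1ℚ + 1ℚ))
    ≡⟨ cong (oddFactorial q *_) (trans (solve 1 (λ x → con 1ℚ :+ x :* (con 1ℚ :+ con 1ℚ) := con 1ℚ :+ x :+ x) refl (ι q)) (sym (ι-1+2n q))) ⟩
  oddFactorial (suc q) ∎

inv-poch-½ : ∀ q → inv (poch ½ q) ≡ two ^ q * inv (oddFactorial q)
inv-poch-½ q = inv-unique (poch ½ q) (two ^ q * inv (oddFactorial q)) (begin
  poch ½ q * (two ^ q * inv (oddFactorial q)) ≡⟨ QP.*-assoc (poch ½ q) (two ^ q) (inv (oddFactorial q)) ⟨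
  poch ½ q * two ^ q * inv (oddFactorial q)   ≡⟨ cong (_* inv (oddFactorial q)) (poch-½ q) ⟩
  oddFactorial q * inv (oddFactorial q)       ≡⟨ inv-inverseʳ (oddFactorial q) (oddFactorial≢0 q) ⟩
  1ℚ                                          ∎)

tNum-poch : ∀ x q → (- 1ℚ) ^ suc (suc q) * (x ^ 2 * poch (x + 1ℚ) q * poch (1ℚ - x) q) ≡ tNum x (suc q)
tNum-poch x zero    = solve 1 (λ x → (:- con 1ℚ) :* ((:- con 1ℚ) :* con 1ℚ) :* (x :* (x :* con 1ℚ) :* con 1ℚ :* con 1ℚ) := con 1ℚ :* (x :* x :- con 0ℚ :* con 0ℚ)) refl x
tNum-poch x (suc q) = begin
  - 1ℚ * S * (x ^ 2 * (Pa * (x + 1ℚ + ι q)) * (Pb * (1ℚ - x + ι q)))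
    ≡⟨ solve 6 (λ S x2 Pa Pb x y → (:- con 1ℚ) :* S :* (x2 :* (Pa :* (x :+ con 1ℚ :+ y)) :* (Pb :* (con 1ℚ :- x :+ y))) := (S :* (x2 :* Pa :* Pb)) :* (x :* x :- (con 1ℚ :+ y) :* (con 1ℚ :+ y))) refl S (x ^ 2) Pa Pb x (ι q) ⟩
  S * (x ^ 2 * Pa * Pb) * (x * x - (1ℚ + ι q) * (1ℚ + ι q))
    ≡⟨ cong₂ (λ a b → a * (x * x - b * b)) (tNum-poch x q) (sym (ι-suc q)) ⟩
  tNum x (suc q) * (x * x - ι (suc q) * ι (suc q)) ∎
  where
  S = (- 1ℚ) ^ suc (suc q)
  Pa = poch (x + 1ℚ) q
  Pb = poch (1ℚ - x) q

uNum-poch : ∀ x q → (- 1ℚ) ^ suc (suc q) * ((x - 1ℚ) * x ^ 2 * (x + 1ℚ) * poch (two - x) q * poch (x + two) q) ≡ x * uNum x (suc q)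
uNum-poch x zero    = begin
  (- 1ℚ) ^ 2 * ((x - 1ℚ) * x ^ 2 * (x + 1ℚ) * 1ℚ * 1ℚ)
    ≡⟨ solve 1 (λ x → (:- con 1ℚ) :* ((:- con 1ℚ) :* con 1ℚ) :* ((x :- con 1ℚ) :* (x :* (x :* con 1ℚ)) :* (x :+ con 1ℚ) :* con 1ℚ :* con 1ℚ) := x :* ((x :+ con 0ℚ) :* con 1ℚ :* (x :* x :- con 1ℚ :* con 1ℚ))) refl x ⟩
  x * (uNum x 0 * (x * x - ι 1 * ι 1))
    ≡⟨ cong (x *_) (uNum-suc x 0) ⟨
  x * uNum x 1 ∎
uNum-poch x (suc q) = begin
  - 1ℚ * S * (Q * (Pa * (two - x + ι q)) * (Pb * (x + two + ι q)))
    ≡⟨ cong (λ t → - 1ℚ * S * (Q * (Pa * (t - x + ι q)) * (Pb * (x + t + ι q)))) two≡1+1 ⟩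
  - 1ℚ * S * (Q * (Pa * ((1ℚ + 1ℚ) - x + ι q)) * (Pb * (x + (1ℚ + 1ℚ) + ι q)))
    ≡⟨ solve 6 (λ S Q Pa Pb x y → (:- con 1ℚ) :* S :* (Q :* (Pa :* ((con 1ℚ :+ con 1ℚ) :- x :+ y)) :* (Pb :* (x :+ (con 1ℚ :+ con 1ℚ) :+ y))) := (S :* (Q :* Pa :* Pb)) :* (x :* x :- (con 1ℚ :+ (con 1ℚ :+ y)) :* (con 1ℚ :+ (con 1ℚ :+ y)))) refl S Q Pa Pb x (ι q) ⟩
  S * (Q * Pa * Pb) * (x * x - (1ℚ + (1ℚ + ι q)) * (1ℚ + (1ℚ + ι q)))
    ≡⟨ cong₂ (λ a b → a * (x * x - b * b)) (uNum-poch x q) (trans (cong (1ℚ +_) (sym (ι-suc q))) (sym (ι-suc (suc q)))) ⟩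
  x * uNum x (suc q) * (x * x - ι (suc (suc q)) * ι (suc (suc q)))
    ≡⟨ trans (QP.*-assoc x _ _) (cong (x *_) (sym (uNum-suc x (suc q)))) ⟩
  x * uNum x (suc (suc q)) ∎
  where
  S = (- 1ℚ) ^ suc (suc q)
  Q = (x - 1ℚ) * x ^ 2 * (x + 1ℚ)
  Pa = poch (two - x) q
  Pb = poch (x + two) q

-- The summand (m, k) = (i + l, l) of rhs1, resp. (i + l, i) of rhs2, is studied at j = a + 2(i + l), so that j − 2m = a.

[a+2m]∸m≡a+m : ∀ a m → a ℕ.+ 2 ℕ.* m ℕ.∸ m ≡ a ℕ.+ m
[a+2m]∸m≡a+m a m = trans (cong (ℕ._∸ m) (NS.solve 2 (λ a m → a NS.:+ NS.con 2 NS.:* m NS.:= (a NS.:+ m) NS.:+ m) refl a m)) (ℕP.m+n∸n≡m (a ℕ.+ m) m)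

a+2m≡m+[a+m] : ∀ a m → a ℕ.+ 2 ℕ.* m ≡ m ℕ.+ (a ℕ.+ m)
a+2m≡m+[a+m] a m = NS.solve 2 (λ a m → a NS.:+ NS.con 2 NS.:* m NS.:= m NS.:+ (a NS.:+ m)) refl a m

[a+2[i+l]]∸i≡i+[l+[a+l]] : ∀ a i l → a ℕ.+ 2 ℕ.* (i ℕ.+ l) ℕ.∸ i ≡ i ℕ.+ (l ℕ.+ (a ℕ.+ l))
[a+2[i+l]]∸i≡i+[l+[a+l]] a i l = trans (cong (ℕ._∸ i) (NS.solve 3 (λ a i l → a NS.:+ NS.con 2 NS.:* (i NS.:+ l) NS.:= i NS.:+ (i NS.:+ (l NS.:+ (a NS.:+ l)))) refl a i l))
                                        (ℕP.m+n∸m≡n i (i ℕ.+ (l ℕ.+ (a ℕ.+ l))))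

[a+2[i+l]]∸2i≡l+[a+l] : ∀ a i l → a ℕ.+ 2 ℕ.* (i ℕ.+ l) ℕ.∸ 2 ℕ.* i ≡ l ℕ.+ (a ℕ.+ l)
[a+2[i+l]]∸2i≡l+[a+l] a i l = trans (cong (ℕ._∸ 2 ℕ.* i) (NS.solve 3 (λ a i l → a NS.:+ NS.con 2 NS.:* (i NS.:+ l) NS.:= (l NS.:+ (a NS.:+ l)) NS.:+ NS.con 2 NS.:* i) refl a i l))
                                     (ℕP.m+n∸n≡m (l ℕ.+ (a ℕ.+ l)) (2 ℕ.* i))

[l+[a+l]]∸2l≡a : ∀ a l → l ℕ.+ (a ℕ.+ l) ℕ.∸ 2 ℕ.* l ≡ a
[l+[a+l]]∸2l≡a a l = trans (cong (ℕ._∸ 2 ℕ.* l) (NS.solve 2 (λ a l → l NS.:+ (a NS.:+ l) NS.:= a NS.:+ NS.con 2 NS.:* l) refl a l)) (ℕP.m+n∸n≡m a (2 ℕ.* l))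

ι-*-inv-cancelʳ : ∀ c b → b ≢ 0 → ι (c ℕ.* b) * inv (ι b) ≡ ι c
ι-*-inv-cancelʳ c b b≢0 = begin
  ι (c ℕ.* b) * inv (ι b)   ≡⟨ trans (cong (_* inv (ι b)) (ι-* c b)) (QP.*-assoc (ι c) (ι b) (inv (ι b))) ⟩
  ι c * (ι b * inv (ι b))   ≡⟨ cong (ι c *_) (inv-inverseʳ (ι b) (ι-≢0 b b≢0)) ⟩
  ι c * 1ℚ                  ≡⟨ QP.*-identityʳ (ι c) ⟩
  ι c                       ∎

-- Matching the right-hand sides termwise

prefactor₁ : ℕ → ℚ
prefactor₁ q = (- 1ℚ) ^ suc q * sqrtPiOverGammaHalf q

summand₁ : ℕ → ℕ → ℕ → ℚ
summand₁ j q m = inv (cc (j ℕ.∸ 2 ℕ.* m)) * ι ((j ℕ.∸ m) C (j ℕ.∸ 2 ℕ.* m)) * (ι 2 ^ (2 ℕ.* m ℕ.+ 1) ÷ ι 2 ^ (j ℕ.+ q))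
  * ι (j ℕ.∸ 2 ℕ.* m) ^ 2 * poch (ι (j ℕ.∸ 2 ℕ.* m ℕ.+ 1)) (q ℕ.∸ 1) * poch (- ι j + ι (2 ℕ.* m ℕ.+ 1)) (q ℕ.∸ 1)

hyp₁ : ℕ → ℕ → ℕ → ℚ
hyp₁ j m k = (poch (- ι m) k * poch (ι (j ℕ.∸ m ℕ.+ 1)) k) ÷ (poch (ι (j ℕ.∸ 2 ℕ.* m ℕ.+ 1)) k * ι (k !)) * (- (1ℚ ÷ ι 4)) ^ k

summand₁-chebyshev : ∀ a m q → let j = a ℕ.+ 2 ℕ.* m in
  (- 1ℚ) ^ suc (suc q) * (ι (j ℕ.∸ 2 ℕ.* m) ^ 2 * poch (ι (j ℕ.∸ 2 ℕ.* m ℕ.+ 1)) q * poch (- ι j + ι (2 ℕ.* m ℕ.+ 1)) q)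
    ≡ tNum (ι a) (suc q)
summand₁-chebyshev a m q = begin
  S * (ι (j ℕ.∸ 2 ℕ.* m) ^ 2 * poch (ι (j ℕ.∸ 2 ℕ.* m ℕ.+ 1)) q * poch (- ι j + ι (2 ℕ.* m ℕ.+ 1)) q)
    ≡⟨ cong (λ z → S * (ι z ^ 2 * poch (ι (z ℕ.+ 1)) q * poch (- ι j + ι (2 ℕ.* m ℕ.+ 1)) q)) (ℕP.m+n∸n≡m a (2 ℕ.* m)) ⟩
  S * (ι a ^ 2 * poch (ι (a ℕ.+ 1)) q * poch (- ι j + ι (2 ℕ.* m ℕ.+ 1)) q)
    ≡⟨ cong₂ (λ x y → S * (ι a ^ 2 * poch x q * poch y q)) (ι-+ a 1) 1-a ⟩
  S * (ι a ^ 2 * poch (ι a + 1ℚ) q * poch (1ℚ - ι a) q)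
    ≡⟨ tNum-poch (ι a) q ⟩
  tNum (ι a) (suc q) ∎
  where
  S = (- 1ℚ) ^ suc (suc q)
  j = a ℕ.+ 2 ℕ.* m
  1-a : - ι j + ι (2 ℕ.* m ℕ.+ 1) ≡ 1ℚ - ι a
  1-a = trans (cong₂ (λ x y → - x + y) (ι-+ a (2 ℕ.* m)) (ι-+ (2 ℕ.* m) 1))
              (solve 2 (λ x y → :- (x :+ y) :+ (y :+ con 1ℚ) := con 1ℚ :- x) refl (ι a) (ι (2 ℕ.* m)))

summand₁-powers : ∀ a i l q → let m = i ℕ.+ l ; p = l ℕ.+ (a ℕ.+ l) in
  two ^ (2 ℕ.* m ℕ.+ 1) ÷ two ^ (a ℕ.+ 2 ℕ.* m ℕ.+ q) * (- (1ℚ ÷ ι 4)) ^ l ≡ two * (- 1ℚ) ^ l * (inv (two ^ p) * inv (two ^ q))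
summand₁-powers a i l q = begin
  two ^ (2 ℕ.* m ℕ.+ 1) * inv (two ^ (a ℕ.+ 2 ℕ.* m ℕ.+ q)) * (- (1ℚ * inv (ι 4))) ^ l
    ≡⟨ cong₂ _*_ (cong₂ _*_ numerator denominator) quarter ⟩
  two ^ (2 ℕ.* i) * (two ^ (2 ℕ.* l) * (two * 1ℚ)) * (inv (two ^ p) * (inv (two ^ (2 ℕ.* i)) * inv (two ^ q))) * (sl * inv (ι 4) ^ l)
    ≡⟨ solve 8 (λ a b t i2p i2i i2q s f → a :* (b :* (t :* con 1ℚ)) :* (i2p :* (i2i :* i2q)) :* (s :* f) := (a :* i2i) :* (b :* f) :* (t :* s :* (i2p :* i2q))) refl
         (two ^ (2 ℕ.* i)) (two ^ (2 ℕ.* l)) two (inv (two ^ p)) (inv (two ^ (2 ℕ.* i))) (inv (two ^ q)) sl (inv (ι 4) ^ l) ⟩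
  (two ^ (2 ℕ.* i) * inv (two ^ (2 ℕ.* i))) * (two ^ (2 ℕ.* l) * inv (ι 4) ^ l) * (two * sl * (inv (two ^ p) * inv (two ^ q)))
    ≡⟨ cong₂ (λ x y → x * y * (two * sl * (inv (two ^ p) * inv (two ^ q)))) (two^n*inv-two^n≡1 (2 ℕ.* i)) (two^2n*inv4^n≡1 l) ⟩
  1ℚ * 1ℚ * (two * sl * (inv (two ^ p) * inv (two ^ q)))
    ≡⟨ QP.*-identityˡ _ ⟩
  two * sl * (inv (two ^ p) * inv (two ^ q)) ∎
  where
  m = i ℕ.+ l
  p = l ℕ.+ (a ℕ.+ l)
  sl = (- 1ℚ) ^ l
  numerator : two ^ (2 ℕ.* m ℕ.+ 1) ≡ two ^ (2 ℕ.* i) * (two ^ (2 ℕ.* l) * (two * 1ℚ))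
  numerator = begin
    two ^ (2 ℕ.* m ℕ.+ 1)
      ≡⟨ cong (two ^_) (NS.solve 2 (λ i l → NS.con 2 NS.:* (i NS.:+ l) NS.:+ NS.con 1 NS.:= NS.con 2 NS.:* i NS.:+ (NS.con 2 NS.:* l NS.:+ NS.con 1)) refl i l) ⟩
    two ^ (2 ℕ.* i ℕ.+ (2 ℕ.* l ℕ.+ 1))
      ≡⟨ trans (^-distribˡ-+-* two (2 ℕ.* i) (2 ℕ.* l ℕ.+ 1)) (cong (two ^ (2 ℕ.* i) *_) (^-distribˡ-+-* two (2 ℕ.* l) 1)) ⟩
    two ^ (2 ℕ.* i) * (two ^ (2 ℕ.* l) * (two * 1ℚ)) ∎
  denominator : inv (two ^ (a ℕ.+ 2 ℕ.* m ℕ.+ q)) ≡ inv (two ^ p) * (inv (two ^ (2 ℕ.* i)) * inv (two ^ q))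
  denominator = begin
    inv (two ^ (a ℕ.+ 2 ℕ.* m ℕ.+ q))
      ≡⟨ cong (λ z → inv (two ^ z)) (NS.solve 4 (λ a i l q → a NS.:+ NS.con 2 NS.:* (i NS.:+ l) NS.:+ q NS.:= (l NS.:+ (a NS.:+ l)) NS.:+ (NS.con 2 NS.:* i NS.:+ q)) refl a i l q) ⟩
    inv (two ^ (p ℕ.+ (2 ℕ.* i ℕ.+ q)))
      ≡⟨ cong inv (trans (^-distribˡ-+-* two p (2 ℕ.* i ℕ.+ q)) (cong (two ^ p *_) (^-distribˡ-+-* two (2 ℕ.* i) q))) ⟩
    inv (two ^ p * (two ^ (2 ℕ.* i) * two ^ q))
      ≡⟨ trans (inv-distrib-* (two ^ p) _) (cong (inv (two ^ p) *_) (inv-distrib-* (two ^ (2 ℕ.* i)) (two ^ q))) ⟩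
    inv (two ^ p) * (inv (two ^ (2 ℕ.* i)) * inv (two ^ q)) ∎
  quarter : (- (1ℚ * inv (ι 4))) ^ l ≡ sl * inv (ι 4) ^ l
  quarter = trans (cong (_^ l) (solve 1 (λ y → :- (con 1ℚ :* y) := :- con 1ℚ :* y) refl (inv (ι 4)))) (^-distribʳ-* (- 1ℚ) (inv (ι 4)) l)

summand₁-binomials : ∀ a i l → let m = i ℕ.+ l ; j = a ℕ.+ 2 ℕ.* m ; p = l ℕ.+ (a ℕ.+ l) in
  (- 1ℚ) ^ l * (ι ((j ℕ.∸ m) C (j ℕ.∸ 2 ℕ.* m)) * (poch (- ι m) l * poch (ι (j ℕ.∸ m ℕ.+ 1)) l * inv (poch (ι (j ℕ.∸ 2 ℕ.* m ℕ.+ 1)) l * ι (l !))))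
    ≡ ι ((j ℕ.∸ i) C i) * ι (p C l)
summand₁-binomials a i l = begin
  sl * (Cc * (pm * pb * inv (pc * ι (l !))))
    ≡⟨ solve 6 (λ s c x y z w → s :* (c :* ((x :* y) :* w)) := (c :* (x :* s) :* y) :* w) refl sl Cc pm pb (pc * ι (l !)) (inv (pc * ι (l !))) ⟩
  Cc * (pm * sl) * pb * inv (pc * ι (l !))
    ≡⟨ cong₂ (λ x y → x * inv (y * ι (l !))) (cong₂ _*_ (cong₂ _*_ Cc≡ (poch-neg m l (ℕP.m≤n+m l i))) pb≡) pc≡ ⟩
  ι ((a ℕ.+ m) C a) * ι (fallingℕ m l) * ι (risingℕ (suc (a ℕ.+ m)) l) * inv (ι (risingℕ (suc a) l) * ι (l !))
    ≡⟨ cong₂ (λ x y → x * inv y) (trans (cong (_* ι (risingℕ (suc (a ℕ.+ m)) l)) (sym (ι-* ((a ℕ.+ m) C a) (fallingℕ m l)))) (sym (ι-* (((a ℕ.+ m) C a) ℕ.* fallingℕ m l) (risingℕ (suc (a ℕ.+ m)) l))))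
                                   (sym (ι-* (risingℕ (suc a) l) (l !))) ⟩
  ι (((a ℕ.+ m) C a) ℕ.* fallingℕ m l ℕ.* risingℕ (suc (a ℕ.+ m)) l) * inv (ι (risingℕ (suc a) l ℕ.* l !))
    ≡⟨ cong (λ z → ι z * inv (ι (risingℕ (suc a) l ℕ.* l !))) (trans (coefficient-identityᵀ a i l) (ℕP.*-assoc (((i ℕ.+ p) C i) ℕ.* (p C l)) (risingℕ (suc a) l) (l !))) ⟩
  ι (((i ℕ.+ p) C i) ℕ.* (p C l) ℕ.* (risingℕ (suc a) l ℕ.* l !)) * inv (ι (risingℕ (suc a) l ℕ.* l !))
    ≡⟨ ι-*-inv-cancelʳ (((i ℕ.+ p) C i) ℕ.* (p C l)) (risingℕ (suc a) l ℕ.* l !) (λ e → [ risingℕ≢0 a l , n!≢0 l ]′ (ℕP.m*n≡0⇒m≡0∨n≡0 (risingℕ (suc a) l) e)) ⟩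
  ι (((i ℕ.+ p) C i) ℕ.* (p C l))
    ≡⟨ trans (ι-* ((i ℕ.+ p) C i) (p C l)) (cong (λ z → ι (z C i) * ι (p C l)) (sym ([a+2[i+l]]∸i≡i+[l+[a+l]] a i l))) ⟩
  ι ((j ℕ.∸ i) C i) * ι (p C l) ∎
  where
  m = i ℕ.+ l
  j = a ℕ.+ 2 ℕ.* m
  p = l ℕ.+ (a ℕ.+ l)
  sl = (- 1ℚ) ^ l
  Cc = ι ((j ℕ.∸ m) C (j ℕ.∸ 2 ℕ.* m))
  pm = poch (- ι m) l
  pb = poch (ι (j ℕ.∸ m ℕ.+ 1)) l
  pc = poch (ι (j ℕ.∸ 2 ℕ.* m ℕ.+ 1)) l
  Cc≡ : Cc ≡ ι ((a ℕ.+ m) C a)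
  Cc≡ = cong₂ (λ x y → ι (x C y)) ([a+2m]∸m≡a+m a m) (ℕP.m+n∸n≡m a (2 ℕ.* m))
  pb≡ : pb ≡ ι (risingℕ (suc (a ℕ.+ m)) l)
  pb≡ = trans (cong (λ z → poch (ι z) l) (trans (cong (ℕ._+ 1) ([a+2m]∸m≡a+m a m)) (ℕP.+-comm (a ℕ.+ m) 1))) (poch-ι _ l)
  pc≡ : pc ≡ ι (risingℕ (suc a) l)
  pc≡ = trans (cong (λ z → poch (ι z) l) (trans (cong (ℕ._+ 1) (ℕP.m+n∸n≡m a (2 ℕ.* m))) (ℕP.+-comm a 1))) (poch-ι _ l)

rhs₁-term : ∀ a i l q → let j = a ℕ.+ 2 ℕ.* (i ℕ.+ l) ; p = j ℕ.∸ 2 ℕ.* i in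
  prefactor₁ (suc q) * (summand₁ j (suc q) (i ℕ.+ l) * hyp₁ j (i ℕ.+ l) l)
    ≡ ι ((j ℕ.∸ i) C i) * (two * inv (two ^ p * oddFactorial (suc q))) * tHalfTerm p (suc q) l
rhs₁-term a i l q = begin
  S * IH * (W * Cc * T * X² * P₁ * P₂ * (pm * pb * inv (pc * ι (l !)) * G))
    ≡⟨ solve 13 (λ S IH W Cc T X2 P1 P2 pm pb ipk G s → (S :* IH) :* ((W :* Cc :* T :* X2 :* P1 :* P2) :* ((pm :* pb) :* ipk :* G)) := (S :* (X2 :* P1 :* P2)) :* IH :* W :* (T :* G) :* (Cc :* ((pm :* pb) :* ipk))) refl
         S IH W Cc T X² P₁ P₂ pm pb (inv (pc * ι (l !))) G 0ℚ ⟩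
  S * (X² * P₁ * P₂) * IH * W * (T * G) * R
    ≡⟨ cong₂ (λ x y → x * y * W * (T * G) * R) (summand₁-chebyshev a m q) (inv-poch-½ (suc q)) ⟩
  tNum (ι a) (suc q) * (two ^ suc q * inv (oddFactorial (suc q))) * W * (T * G) * R
    ≡⟨ cong (λ z → tNum (ι a) (suc q) * (two ^ suc q * inv (oddFactorial (suc q))) * W * z * R) (summand₁-powers a i l (suc q)) ⟩
  tNum (ι a) (suc q) * (two ^ suc q * inv (oddFactorial (suc q))) * W * (two * sl * (inv (two ^ p′) * inv (two ^ suc q))) * R
    ≡⟨ solve 9 (λ Pa tq iD W t sl i2p i2q R → Pa :* (tq :* iD) :* W :* (t :* sl :* (i2p :* i2q)) :* R := (Pa :* iD :* W :* t :* i2p) :* (tq :* i2q) :* (sl :* R)) refl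
         (tNum (ι a) (suc q)) (two ^ suc q) (inv (oddFactorial (suc q))) W two sl (inv (two ^ p′)) (inv (two ^ suc q)) R ⟩
  tNum (ι a) (suc q) * inv (oddFactorial (suc q)) * W * two * inv (two ^ p′) * (two ^ suc q * inv (two ^ suc q)) * (sl * R)
    ≡⟨ cong₂ (λ x y → tNum (ι a) (suc q) * inv (oddFactorial (suc q)) * W * two * inv (two ^ p′) * x * y) (two^n*inv-two^n≡1 (suc q)) (summand₁-binomials a i l) ⟩
  tNum (ι a) (suc q) * inv (oddFactorial (suc q)) * W * two * inv (two ^ p′) * 1ℚ * (ι ((j ℕ.∸ i) C i) * ι (p′ C l))
    ≡⟨ solve 7 (λ Pa iD W t i2p C2 Cpl → (Pa :* iD :* W :* t :* i2p) :* con 1ℚ :* (C2 :* Cpl) := C2 :* (t :* (i2p :* iD)) :* (W :* (Cpl :* Pa))) refl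
         (tNum (ι a) (suc q)) (inv (oddFactorial (suc q))) W two (inv (two ^ p′)) (ι ((j ℕ.∸ i) C i)) (ι (p′ C l)) ⟩
  ι ((j ℕ.∸ i) C i) * (two * (inv (two ^ p′) * inv (oddFactorial (suc q)))) * (W * (ι (p′ C l) * tNum (ι a) (suc q)))
    ≡⟨ cong₂ (λ x y → ι ((j ℕ.∸ i) C i) * (two * x) * (inv (cc y) * (ι (p′ C l) * tNum (ι a) (suc q)))) (sym (inv-distrib-* (two ^ p′) (oddFactorial (suc q)))) (ℕP.m+n∸n≡m a (2 ℕ.* m)) ⟩
  target p′ a
    ≡⟨ cong₂ target (sym ([a+2[i+l]]∸2i≡l+[a+l] a i l)) (sym (trans (cong (ℕ._∸ 2 ℕ.* l) ([a+2[i+l]]∸2i≡l+[a+l] a i l)) ([l+[a+l]]∸2l≡a a l))) ⟩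
  target (j ℕ.∸ 2 ℕ.* i) (j ℕ.∸ 2 ℕ.* i ℕ.∸ 2 ℕ.* l) ∎
  where
  m = i ℕ.+ l
  j = a ℕ.+ 2 ℕ.* m
  p′ = l ℕ.+ (a ℕ.+ l)
  S = (- 1ℚ) ^ suc (suc q)
  IH = inv (poch ½ (suc q))
  W = inv (cc (j ℕ.∸ 2 ℕ.* m))
  Cc = ι ((j ℕ.∸ m) C (j ℕ.∸ 2 ℕ.* m))
  T = ι 2 ^ (2 ℕ.* m ℕ.+ 1) ÷ ι 2 ^ (j ℕ.+ suc q)
  X² = ι (j ℕ.∸ 2 ℕ.* m) ^ 2
  P₁ = poch (ι (j ℕ.∸ 2 ℕ.* m ℕ.+ 1)) q
  P₂ = poch (- ι j + ι (2 ℕ.* m ℕ.+ 1)) q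
  pm = poch (- ι m) l
  pb = poch (ι (j ℕ.∸ m ℕ.+ 1)) l
  pc = poch (ι (j ℕ.∸ 2 ℕ.* m ℕ.+ 1)) l
  G = (- (1ℚ ÷ ι 4)) ^ l
  sl = (- 1ℚ) ^ l
  R = Cc * (pm * pb * inv (pc * ι (l !)))
  target : ℕ → ℕ → ℚ
  target p d = ι ((j ℕ.∸ i) C i) * (two * inv (two ^ p * oddFactorial (suc q))) * (inv (cc d) * (ι (p C l) * tNum (ι d) (suc q)))

prefactor₂ : ℕ → ℕ → ℚ
prefactor₂ j q = (- 1ℚ) ^ suc q * sqrtPiOverGammaThreeHalves q ÷ ι 2 ^ (j ℕ.+ q ℕ.+ 1)

summand₂ : ℕ → ℕ → ℕ → ℚ
summand₂ j q m = ι (j C m) * (ι (j ℕ.∸ 2 ℕ.* m) * ι (j ℕ.∸ 2 ℕ.* m ℕ.+ 1) ^ 2 * ι (j ℕ.∸ 2 ℕ.* m ℕ.+ 2) ÷ ι (j ℕ.∸ m ℕ.+ 1))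
  * poch (- ι j + ι (2 ℕ.* m ℕ.+ 1)) (q ℕ.∸ 1) * poch (ι (j ℕ.∸ 2 ℕ.* m ℕ.+ 3)) (q ℕ.∸ 1)

hyp₂ : ℕ → ℕ → ℕ → ℚ
hyp₂ j m k = (poch (- ι m) k * poch (- ι j + ι m + - 1ℚ) k) ÷ (poch (- ι j) k * ι (k !)) * (- ι 4) ^ k

ι-ratio : ∀ n d n′ d′ → d ≢ 0 → d′ ≢ 0 → n ℕ.* d′ ≡ n′ ℕ.* d → ι n * inv (ι d) ≡ ι n′ * inv (ι d′)
ι-ratio n d n′ d′ d≢0 d′≢0 eq = *-cancelˡ-≢0 (ι d * ι d′) _ _ (*-≢0 (ι d) (ι d′) (ι-≢0 d d≢0) (ι-≢0 d′ d′≢0)) (begin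
  ι d * ι d′ * (ι n * inv (ι d))     ≡⟨ solve 4 (λ D D′ N I → D :* D′ :* (N :* I) := N :* D′ :* (D :* I)) refl (ι d) (ι d′) (ι n) (inv (ι d)) ⟩
  ι n * ι d′ * (ι d * inv (ι d))     ≡⟨ cong (ι n * ι d′ *_) (inv-inverseʳ (ι d) (ι-≢0 d d≢0)) ⟩
  ι n * ι d′ * 1ℚ                    ≡⟨ trans (QP.*-identityʳ _) (sym (ι-* n d′)) ⟩
  ι (n ℕ.* d′)                       ≡⟨ cong ι eq ⟩
  ι (n′ ℕ.* d)                       ≡⟨ trans (ι-* n′ d) (sym (QP.*-identityʳ _)) ⟩
  ι n′ * ι d * 1ℚ                    ≡⟨ cong (ι n′ * ι d *_) (inv-inverseʳ (ι d′) (ι-≢0 d′ d′≢0)) ⟨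
  ι n′ * ι d * (ι d′ * inv (ι d′))   ≡⟨ solve 4 (λ N D D′ I → N :* D :* (D′ :* I) := D :* D′ :* (N :* I)) refl (ι n′) (ι d) (ι d′) (inv (ι d′)) ⟩
  ι d * ι d′ * (ι n′ * inv (ι d′))   ∎)

summand₂-chebyshev : ∀ a m q → let j = a ℕ.+ 2 ℕ.* m ; x = ι (suc a) in
  (- 1ℚ) ^ suc (suc q) * (ι (j ℕ.∸ 2 ℕ.* m) * ι (j ℕ.∸ 2 ℕ.* m ℕ.+ 1) ^ 2 * ι (j ℕ.∸ 2 ℕ.* m ℕ.+ 2) * poch (- ι j + ι (2 ℕ.* m ℕ.+ 1)) q * poch (ι (j ℕ.∸ 2 ℕ.* m ℕ.+ 3)) q)
    ≡ x * uNum x (suc q)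
summand₂-chebyshev a m q = begin
  S * (ι (j ℕ.∸ 2 ℕ.* m) * ι (j ℕ.∸ 2 ℕ.* m ℕ.+ 1) ^ 2 * ι (j ℕ.∸ 2 ℕ.* m ℕ.+ 2) * poch A q * poch (ι (j ℕ.∸ 2 ℕ.* m ℕ.+ 3)) q)
    ≡⟨ cong (λ z → S * (ι z * ι (z ℕ.+ 1) ^ 2 * ι (z ℕ.+ 2) * poch A q * poch (ι (z ℕ.+ 3)) q)) (ℕP.m+n∸n≡m a (2 ℕ.* m)) ⟩
  S * (ι a * ι (a ℕ.+ 1) ^ 2 * ι (a ℕ.+ 2) * poch A q * poch (ι (a ℕ.+ 3)) q)
    ≡⟨ cong₂ (λ u v → S * (ι a * ι (a ℕ.+ 1) ^ 2 * ι (a ℕ.+ 2) * poch u q * poch v q)) A≡2-x a+3≡x+2 ⟩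
  S * (ι a * ι (a ℕ.+ 1) ^ 2 * ι (a ℕ.+ 2) * poch (two - x) q * poch (x + two) q)
    ≡⟨ cong (λ z → S * (z * poch (two - x) q * poch (x + two) q)) cubic ⟩
  S * ((x - 1ℚ) * x ^ 2 * (x + 1ℚ) * poch (two - x) q * poch (x + two) q)
    ≡⟨ uNum-poch x q ⟩
  x * uNum x (suc q) ∎
  where
  j = a ℕ.+ 2 ℕ.* m
  x = ι (suc a)
  S = (- 1ℚ) ^ suc (suc q)
  A = - ι j + ι (2 ℕ.* m ℕ.+ 1)
  A≡2-x : A ≡ two - x
  A≡2-x = begin
    - ι (a ℕ.+ 2 ℕ.* m) + ι (2 ℕ.* m ℕ.+ 1) ≡⟨ cong₂ (λ u v → - u + v) (ι-+ a (2 ℕ.* m)) (ι-+ (2 ℕ.* m) 1) ⟩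
    - (ι a + ι (2 ℕ.* m)) + (ι (2 ℕ.* m) + ι 1) ≡⟨ solve 2 (λ u v → :- (u :+ v) :+ (v :+ con (ι 1)) := con two :- (con 1ℚ :+ u)) refl (ι a) (ι (2 ℕ.* m)) ⟩
    two - (1ℚ + ι a)                           ≡⟨ cong (λ z → two - z) (ι-suc a) ⟨
    two - x                                    ∎
  a+3≡x+2 : ι (a ℕ.+ 3) ≡ x + two
  a+3≡x+2 = trans (ι-+ a 3) (trans (solve 1 (λ u → u :+ con (ι 3) := (con 1ℚ :+ u) :+ con two) refl (ι a)) (cong (_+ two) (sym (ι-suc a))))
  cubic : ι a * ι (a ℕ.+ 1) ^ 2 * ι (a ℕ.+ 2) ≡ (x - 1ℚ) * x ^ 2 * (x + 1ℚ)
  cubic = begin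
    ι a * ι (a ℕ.+ 1) ^ 2 * ι (a ℕ.+ 2)
      ≡⟨ cong₂ (λ u v → ι a * u ^ 2 * v) (ι-+ a 1) (ι-+ a 2) ⟩
    ι a * (ι a + ι 1) ^ 2 * (ι a + ι 2)
      ≡⟨ solve 1 (λ y → y :* ((y :+ con (ι 1)) :* ((y :+ con (ι 1)) :* con 1ℚ)) :* (y :+ con (ι 2))
                     := ((con 1ℚ :+ y) :- con 1ℚ) :* ((con 1ℚ :+ y) :* ((con 1ℚ :+ y) :* con 1ℚ)) :* ((con 1ℚ :+ y) :+ con 1ℚ)) refl (ι a) ⟩
    (1ℚ + ι a - 1ℚ) * (1ℚ + ι a) ^ 2 * (1ℚ + ι a + 1ℚ)
      ≡⟨ cong (λ z → (z - 1ℚ) * z ^ 2 * (z + 1ℚ)) (ι-suc a) ⟨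
    (x - 1ℚ) * x ^ 2 * (x + 1ℚ) ∎

summand₂-powers : ∀ a i l q → let p = l ℕ.+ (a ℕ.+ l) in
  inv (two ^ (a ℕ.+ 2 ℕ.* (i ℕ.+ l) ℕ.+ q ℕ.+ 1)) * (- ι 4) ^ i ≡ (- 1ℚ) ^ i * inv (two ^ p) * inv (two ^ suc q)
summand₂-powers a i l q = begin
  inv (two ^ (a ℕ.+ 2 ℕ.* (i ℕ.+ l) ℕ.+ q ℕ.+ 1)) * (- ι 4) ^ i
    ≡⟨ cong₂ _*_ denominator four ⟩
  inv (two ^ p) * (inv (two ^ (2 ℕ.* i)) * inv (two ^ suc q)) * (si * two ^ (2 ℕ.* i))
    ≡⟨ solve 5 (λ a b c s t → a :* (b :* c) :* (s :* t) := s :* a :* c :* (t :* b)) refl (inv (two ^ p)) (inv (two ^ (2 ℕ.* i))) (inv (two ^ suc q)) si (two ^ (2 ℕ.* i)) ⟩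
  si * inv (two ^ p) * inv (two ^ suc q) * (two ^ (2 ℕ.* i) * inv (two ^ (2 ℕ.* i)))
    ≡⟨ trans (cong (si * inv (two ^ p) * inv (two ^ suc q) *_) (two^n*inv-two^n≡1 (2 ℕ.* i))) (QP.*-identityʳ _) ⟩
  si * inv (two ^ p) * inv (two ^ suc q) ∎
  where
  p = l ℕ.+ (a ℕ.+ l)
  si = (- 1ℚ) ^ i
  denominator : inv (two ^ (a ℕ.+ 2 ℕ.* (i ℕ.+ l) ℕ.+ q ℕ.+ 1)) ≡ inv (two ^ p) * (inv (two ^ (2 ℕ.* i)) * inv (two ^ suc q))
  denominator = begin
    inv (two ^ (a ℕ.+ 2 ℕ.* (i ℕ.+ l) ℕ.+ q ℕ.+ 1))
      ≡⟨ cong (λ z → inv (two ^ z)) (NS.solve 4 (λ a i l q → a NS.:+ NS.con 2 NS.:* (i NS.:+ l) NS.:+ q NS.:+ NS.con 1 NS.:= (l NS.:+ (a NS.:+ l)) NS.:+ (NS.con 2 NS.:* i NS.:+ (NS.con 1 NS.:+ q))) refl a i l q) ⟩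
    inv (two ^ (p ℕ.+ (2 ℕ.* i ℕ.+ suc q)))
      ≡⟨ cong inv (trans (^-distribˡ-+-* two p (2 ℕ.* i ℕ.+ suc q)) (cong (two ^ p *_) (^-distribˡ-+-* two (2 ℕ.* i) (suc q)))) ⟩
    inv (two ^ p * (two ^ (2 ℕ.* i) * two ^ suc q))
      ≡⟨ trans (inv-distrib-* (two ^ p) _) (cong (inv (two ^ p) *_) (inv-distrib-* (two ^ (2 ℕ.* i)) (two ^ suc q))) ⟩
    inv (two ^ p) * (inv (two ^ (2 ℕ.* i)) * inv (two ^ suc q)) ∎
  four : (- ι 4) ^ i ≡ si * two ^ (2 ℕ.* i)
  four = trans (cong (_^ i) (solve 1 (λ y → :- y := :- con 1ℚ :* y) refl (ι 4))) (trans (^-distribʳ-* (- 1ℚ) (ι 4) i) (cong (si *_) (sym (^-2* two i))))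

summand₂-binomials : ∀ a i l → let m = i ℕ.+ l ; j = a ℕ.+ 2 ℕ.* m ; p = l ℕ.+ (a ℕ.+ l) in
  (- 1ℚ) ^ i * (ι (j C m) * inv (ι (j ℕ.∸ m ℕ.+ 1)) * (poch (- ι m) i * poch (- ι j + ι m + - 1ℚ) i * inv (poch (- ι j) i * ι (i !))))
    ≡ ι ((j ℕ.∸ i) C i) * ι (suc p C l) * inv (ι (suc p))
summand₂-binomials a i l = begin
  si * (Cjm * inv (ι (j ℕ.∸ m ℕ.+ 1)) * (pm * pb * inv (pj * ι (i !))))
    ≡⟨ QP.*-identityʳ _ ⟨
  si * (Cjm * inv (ι (j ℕ.∸ m ℕ.+ 1)) * (pm * pb * inv (pj * ι (i !)))) * 1ℚ
    ≡⟨ cong (si * (Cjm * inv (ι (j ℕ.∸ m ℕ.+ 1)) * (pm * pb * inv (pj * ι (i !)))) *_) ([-1]^n*[-1]^n≡1 i) ⟨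
  si * (Cjm * inv (ι (j ℕ.∸ m ℕ.+ 1)) * (pm * pb * inv (pj * ι (i !)))) * (si * si)
    ≡⟨ solve 6 (λ s c r a b k → s :* (c :* r :* (a :* b :* k)) :* (s :* s) := c :* (a :* s) :* (b :* s) :* (k :* s) :* r) refl si Cjm (inv (ι (j ℕ.∸ m ℕ.+ 1))) pm pb (inv (pj * ι (i !))) ⟩
  Cjm * (pm * si) * (pb * si) * (inv (pj * ι (i !)) * si) * inv (ι (j ℕ.∸ m ℕ.+ 1))
    ≡⟨ cong₂ (λ u v → Cjm * (pm * si) * (pb * si) * u * inv (ι v)) sign-into-denominator (trans (cong (ℕ._+ 1) ([a+2m]∸m≡a+m a m)) (ℕP.+-comm (a ℕ.+ m) 1)) ⟩
  Cjm * (pm * si) * (pb * si) * inv (pj * si * ι (i !)) * inv (ι (suc (a ℕ.+ m)))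
    ≡⟨ cong (λ u → Cjm * u * (pb * si) * inv (pj * si * ι (i !)) * inv (ι (suc (a ℕ.+ m)))) (poch-neg m i (ℕP.m≤m+n i l)) ⟩
  Cjm * ι (fallingℕ m i) * (pb * si) * inv (pj * si * ι (i !)) * inv (ι (suc (a ℕ.+ m)))
    ≡⟨ cong₂ (λ u v → Cjm * ι (fallingℕ m i) * u * inv (v * ι (i !)) * inv (ι (suc (a ℕ.+ m)))) pb≡ (poch-neg j i i≤j) ⟩
  Cjm * ι (fallingℕ m i) * ι (fallingℕ (suc (a ℕ.+ m)) i) * inv (ι (fallingℕ j i) * ι (i !)) * inv (ι (suc (a ℕ.+ m)))
    ≡⟨ collect ⟩
  ι (N) * inv (ι D)
    ≡⟨ ι-ratio N D (((i ℕ.+ p) C i) ℕ.* (suc p C l)) (suc p) D≢0 (λ ()) N*[1+p]≡ ⟩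
  ι (((i ℕ.+ p) C i) ℕ.* (suc p C l)) * inv (ι (suc p))
    ≡⟨ cong (_* inv (ι (suc p))) (trans (ι-* ((i ℕ.+ p) C i) (suc p C l)) (cong (λ z → ι (z C i) * ι (suc p C l)) (sym ([a+2[i+l]]∸i≡i+[l+[a+l]] a i l)))) ⟩
  ι ((j ℕ.∸ i) C i) * ι (suc p C l) * inv (ι (suc p)) ∎
  where
  m = i ℕ.+ l
  j = a ℕ.+ 2 ℕ.* m
  p = l ℕ.+ (a ℕ.+ l)
  si = (- 1ℚ) ^ i
  Cjm = ι (j C m)
  pm = poch (- ι m) i
  pb = poch (- ι j + ι m + - 1ℚ) i
  pj = poch (- ι j) i
  i≤j : i ≤ j
  i≤j = ℕP.≤-trans (ℕP.m≤m+n i l) (ℕP.≤-trans (ℕP.m≤m+n m (m ℕ.+ 0)) (ℕP.m≤n+m (2 ℕ.* m) a))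
  N = (j C m) ℕ.* fallingℕ m i ℕ.* fallingℕ (suc (a ℕ.+ m)) i
  D = suc (a ℕ.+ m) ℕ.* (fallingℕ j i ℕ.* i !)
  D≢0 : D ≢ 0
  D≢0 e = [ (λ ()) , (λ e′ → [ fallingℕ≢0 j i i≤j , n!≢0 i ]′ (ℕP.m*n≡0⇒m≡0∨n≡0 (fallingℕ j i) e′)) ]′ (ℕP.m*n≡0⇒m≡0∨n≡0 (suc (a ℕ.+ m)) e)
  sign-into-denominator : inv (pj * ι (i !)) * si ≡ inv (pj * si * ι (i !))
  sign-into-denominator = begin
    inv (pj * ι (i !)) * si      ≡⟨ cong (inv (pj * ι (i !)) *_) (inv-unique si si ([-1]^n*[-1]^n≡1 i)) ⟨
    inv (pj * ι (i !)) * inv si  ≡⟨ inv-distrib-* (pj * ι (i !)) si ⟨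
    inv (pj * ι (i !) * si)      ≡⟨ cong inv (solve 3 (λ a b c → a :* b :* c := a :* c :* b) refl pj (ι (i !)) si) ⟩
    inv (pj * si * ι (i !))      ∎
  pb≡ : pb * si ≡ ι (fallingℕ (suc (a ℕ.+ m)) i)
  pb≡ = trans (cong (λ z → poch z i * si) (begin
      - ι (a ℕ.+ 2 ℕ.* m) + ι m + - 1ℚ     ≡⟨ cong (λ z → - z + ι m + - 1ℚ) (trans (ι-+ a (2 ℕ.* m)) (cong (ι a +_) (ι-2* m))) ⟩
      - (ι a + two * ι m) + ι m + - 1ℚ     ≡⟨ solve 2 (λ u v → :- (u :+ con two :* v) :+ v :+ :- con 1ℚ := :- (con 1ℚ :+ (u :+ v))) refl (ι a) (ι m) ⟩
      - (1ℚ + (ι a + ι m))                 ≡⟨ cong -_ (trans (ι-suc (a ℕ.+ m)) (cong (1ℚ +_) (ι-+ a m))) ⟨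
      - ι (suc (a ℕ.+ m))                  ∎))
    (poch-neg (suc (a ℕ.+ m)) i (ℕP.m≤n⇒m≤1+n (ℕP.≤-trans (ℕP.m≤m+n i l) (ℕP.m≤n+m m a))))
  collect : ι (j C m) * ι (fallingℕ m i) * ι (fallingℕ (suc (a ℕ.+ m)) i) * inv (ι (fallingℕ j i) * ι (i !)) * inv (ι (suc (a ℕ.+ m))) ≡ ι N * inv (ι D)
  collect = begin
    ι (j C m) * ι (fallingℕ m i) * ι (fallingℕ (suc (a ℕ.+ m)) i) * inv (ι (fallingℕ j i) * ι (i !)) * inv (ι (suc (a ℕ.+ m)))
      ≡⟨ cong₂ (λ u v → u * inv v * inv (ι (suc (a ℕ.+ m)))) (sym (trans (ι-* ((j C m) ℕ.* fallingℕ m i) _) (cong (_* ι (fallingℕ (suc (a ℕ.+ m)) i)) (ι-* (j C m) (fallingℕ m i))))) (sym (ι-* (fallingℕ j i) (i !))) ⟩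
    ι N * inv (ι (fallingℕ j i ℕ.* i !)) * inv (ι (suc (a ℕ.+ m)))
      ≡⟨ trans (QP.*-assoc (ι N) (inv (ι (fallingℕ j i ℕ.* i !))) (inv (ι (suc (a ℕ.+ m))))) (cong (ι N *_) (trans (QP.*-comm (inv (ι (fallingℕ j i ℕ.* i !))) (inv (ι (suc (a ℕ.+ m))))) (sym (inv-distrib-* (ι (suc (a ℕ.+ m))) (ι (fallingℕ j i ℕ.* i !)))))) ⟩
    ι N * inv (ι (suc (a ℕ.+ m)) * ι (fallingℕ j i ℕ.* i !))
      ≡⟨ cong (λ z → ι N * inv z) (sym (ι-* (suc (a ℕ.+ m)) (fallingℕ j i ℕ.* i !))) ⟩
    ι N * inv (ι D) ∎
  N*[1+p]≡ : N ℕ.* suc p ≡ ((i ℕ.+ p) C i) ℕ.* (suc p C l) ℕ.* D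
  N*[1+p]≡ = begin
    (j C m) ℕ.* fallingℕ m i ℕ.* fallingℕ (suc (a ℕ.+ m)) i ℕ.* suc p
      ≡⟨ cong (λ z → (z C m) ℕ.* fallingℕ m i ℕ.* fallingℕ (suc (a ℕ.+ m)) i ℕ.* suc p) (a+2m≡m+[a+m] a m) ⟩
    ((m ℕ.+ (a ℕ.+ m)) C m) ℕ.* fallingℕ m i ℕ.* fallingℕ (suc (a ℕ.+ m)) i ℕ.* suc p
      ≡⟨ coefficient-identityᵁ a i l ⟩
    ((i ℕ.+ p) C i) ℕ.* (suc p C l) ℕ.* suc (a ℕ.+ m) ℕ.* fallingℕ (m ℕ.+ (a ℕ.+ m)) i ℕ.* i !
      ≡⟨ cong (λ z → ((i ℕ.+ p) C i) ℕ.* (suc p C l) ℕ.* suc (a ℕ.+ m) ℕ.* fallingℕ z i ℕ.* i !) (sym (a+2m≡m+[a+m] a m)) ⟩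
    ((i ℕ.+ p) C i) ℕ.* (suc p C l) ℕ.* suc (a ℕ.+ m) ℕ.* fallingℕ j i ℕ.* i !
      ≡⟨ NS.solve 5 (λ c s x f k → c NS.:* s NS.:* x NS.:* f NS.:* k NS.:= c NS.:* s NS.:* (x NS.:* (f NS.:* k))) refl ((i ℕ.+ p) C i) (suc p C l) (suc (a ℕ.+ m)) (fallingℕ j i) (i !) ⟩
    ((i ℕ.+ p) C i) ℕ.* (suc p C l) ℕ.* D ∎

rhs₂-term : ∀ a i l q → let j = a ℕ.+ 2 ℕ.* (i ℕ.+ l) ; p = j ℕ.∸ 2 ℕ.* i in
  prefactor₂ j (suc q) * (summand₂ j (suc q) (i ℕ.+ l) * hyp₂ j (i ℕ.+ l) i)
    ≡ ι ((j ℕ.∸ i) C i) * (inv (two ^ p * oddFactorial (suc (suc q))) * inv (ι (suc p))) * uHalfTerm p (suc q) l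
rhs₂-term a i l q = begin
  S * IH * I₂ * (Cjm * (Q * IR) * P₁ * P₂ * (pm * pb * inv (pj * ι (i !)) * G))
    ≡⟨ solve 12 (λ S IH I2 C Q IR P1 P2 pm pb ip G → (S :* IH :* I2) :* ((C :* (Q :* IR) :* P1 :* P2) :* ((pm :* pb) :* ip :* G)) := (S :* (Q :* P1 :* P2)) :* IH :* (I2 :* G) :* (C :* IR :* ((pm :* pb) :* ip))) refl
         S IH I₂ Cjm Q IR P₁ P₂ pm pb (inv (pj * ι (i !))) G ⟩
  S * (Q * P₁ * P₂) * IH * (I₂ * G) * R
    ≡⟨ cong₂ (λ u v → u * v * (I₂ * G) * R) (summand₂-chebyshev a m q) (inv-poch-½ (suc (suc q))) ⟩
  x * uNum x (suc q) * (two ^ suc (suc q) * inv D) * (I₂ * G) * R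
    ≡⟨ cong (λ z → x * uNum x (suc q) * (two ^ suc (suc q) * inv D) * z * R) (summand₂-powers a i l (suc q)) ⟩
  x * uNum x (suc q) * (two ^ suc (suc q) * inv D) * (si * inv (two ^ p′) * inv (two ^ suc (suc q))) * R
    ≡⟨ solve 7 (λ xu tq iD sI i2p i2q R → xu :* (tq :* iD) :* (sI :* i2p :* i2q) :* R := (xu :* iD :* i2p) :* (tq :* i2q) :* (sI :* R)) refl
         (x * uNum x (suc q)) (two ^ suc (suc q)) (inv D) si (inv (two ^ p′)) (inv (two ^ suc (suc q))) R ⟩
  x * uNum x (suc q) * inv D * inv (two ^ p′) * (two ^ suc (suc q) * inv (two ^ suc (suc q))) * (si * R)
    ≡⟨ cong₂ (λ u v → x * uNum x (suc q) * inv D * inv (two ^ p′) * u * v) (two^n*inv-two^n≡1 (suc (suc q))) (summand₂-binomials a i l) ⟩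
  x * uNum x (suc q) * inv D * inv (two ^ p′) * 1ℚ * (ι ((j ℕ.∸ i) C i) * ι (suc p′ C l) * inv (ι (suc p′)))
    ≡⟨ solve 7 (λ x U iD i2p C2 Cs iZ → (x :* U :* iD :* i2p) :* con 1ℚ :* (C2 :* Cs :* iZ) := C2 :* ((i2p :* iD) :* iZ) :* (Cs :* x :* U)) refl
         x (uNum x (suc q)) (inv D) (inv (two ^ p′)) (ι ((j ℕ.∸ i) C i)) (ι (suc p′ C l)) (inv (ι (suc p′))) ⟩
  ι ((j ℕ.∸ i) C i) * (inv (two ^ p′) * inv D * inv (ι (suc p′))) * (ι (suc p′ C l) * x * uNum x (suc q))
    ≡⟨ cong (λ z → ι ((j ℕ.∸ i) C i) * (z * inv (ι (suc p′))) * (ι (suc p′ C l) * x * uNum x (suc q))) (sym (inv-distrib-* (two ^ p′) D)) ⟩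
  target p′ (suc a)
    ≡⟨ cong₂ target (sym ([a+2[i+l]]∸2i≡l+[a+l] a i l)) (sym 1+p∸2l≡1+a) ⟩
  target (j ℕ.∸ 2 ℕ.* i) (suc (j ℕ.∸ 2 ℕ.* i) ℕ.∸ 2 ℕ.* l) ∎
  where
  m = i ℕ.+ l
  j = a ℕ.+ 2 ℕ.* m
  p′ = l ℕ.+ (a ℕ.+ l)
  x = ι (suc a)
  D = oddFactorial (suc (suc q))
  S = (- 1ℚ) ^ suc (suc q)
  IH = sqrtPiOverGammaThreeHalves (suc q)
  I₂ = inv (ι 2 ^ (j ℕ.+ suc q ℕ.+ 1))
  Cjm = ι (j C m)
  Q = ι (j ℕ.∸ 2 ℕ.* m) * ι (j ℕ.∸ 2 ℕ.* m ℕ.+ 1) ^ 2 * ι (j ℕ.∸ 2 ℕ.* m ℕ.+ 2)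
  IR = inv (ι (j ℕ.∸ m ℕ.+ 1))
  P₁ = poch (- ι j + ι (2 ℕ.* m ℕ.+ 1)) q
  P₂ = poch (ι (j ℕ.∸ 2 ℕ.* m ℕ.+ 3)) q
  pm = poch (- ι m) i
  pb = poch (- ι j + ι m + - 1ℚ) i
  pj = poch (- ι j) i
  G = (- ι 4) ^ i
  si = (- 1ℚ) ^ i
  R = Cjm * IR * (pm * pb * inv (pj * ι (i !)))
  target : ℕ → ℕ → ℚ
  target p d = ι ((j ℕ.∸ i) C i) * (inv (two ^ p * D) * inv (ι (suc p))) * (ι (suc p C l) * ι d * uNum (ι d) (suc q))
  1+p∸2l≡1+a : suc (j ℕ.∸ 2 ℕ.* i) ℕ.∸ 2 ℕ.* l ≡ suc a
  1+p∸2l≡1+a = begin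
    suc (j ℕ.∸ 2 ℕ.* i) ℕ.∸ 2 ℕ.* l ≡⟨ cong (λ z → suc z ℕ.∸ 2 ℕ.* l) ([a+2[i+l]]∸2i≡l+[a+l] a i l) ⟩
    suc p′ ℕ.∸ 2 ℕ.* l              ≡⟨ cong (ℕ._∸ 2 ℕ.* l) (NS.solve 2 (λ a l → NS.con 1 NS.:+ (l NS.:+ (a NS.:+ l)) NS.:= (NS.con 1 NS.:+ a) NS.:+ NS.con 2 NS.:* l) refl a l) ⟩
    suc a ℕ.+ 2 ℕ.* l ℕ.∸ 2 ℕ.* l    ≡⟨ ℕP.m+n∸n≡m (suc a) (2 ℕ.* l) ⟩
    suc a                           ∎

2[i+l]≤j : ∀ j i l → i ≤ ⌊ j /2⌋ → l ≤ ⌊ j /2⌋ ℕ.∸ i → 2 ℕ.* (i ℕ.+ l) ≤ j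
2[i+l]≤j j i l i≤⌊j/2⌋ l≤⌊j/2⌋∸i = i≤⌊n/2⌋⇒2i≤n j (subst (i ℕ.+ l ≤_) (ℕP.m+[n∸m]≡n i≤⌊j/2⌋) (ℕP.+-monoʳ-≤ i l≤⌊j/2⌋∸i))

rhs₁≡fibSum : ∀ j q → rhs1 j (suc q) ≡ fibSum j (suc q)
rhs₁≡fibSum j q = begin
  prefactor₁ (suc q) * sumTo M (λ m → summand₁ j (suc q) m * sumTo m (hyp₁ j m))
    ≡⟨ sumTo-*ˡ² M (prefactor₁ (suc q)) (summand₁ j (suc q)) (hyp₁ j) ⟩
  sumTo M (λ m → sumTo m (λ k → prefactor₁ (suc q) * (summand₁ j (suc q) m * hyp₁ j m k)))
    ≡⟨ sumTo-triangle M (λ m k → prefactor₁ (suc q) * (summand₁ j (suc q) m * hyp₁ j m k)) ⟩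
  sumTo M (λ i → sumTo (M ℕ.∸ i) (λ l → prefactor₁ (suc q) * (summand₁ j (suc q) (i ℕ.+ l) * hyp₁ j (i ℕ.+ l) l)))
    ≡⟨ sumTo-cong M (λ i i≤M → sumTo-cong (M ℕ.∸ i) (λ l l≤M∸i → term i l (2[i+l]≤j j i l i≤M l≤M∸i))) ⟩
  sumTo M (λ i → sumTo (M ℕ.∸ i) (λ l → c i * tHalfTerm (j ℕ.∸ 2 ℕ.* i) (suc q) l))
    ≡⟨ sumTo-cong M row ⟩
  fibSum j (suc q) ∎
  where
  M = ⌊ j /2⌋
  c : ℕ → ℚ
  c i = ι ((j ℕ.∸ i) C i) * (two * inv (two ^ (j ℕ.∸ 2 ℕ.* i) * oddFactorial (suc q)))
  term : ∀ i l → 2 ℕ.* (i ℕ.+ l) ≤ j →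
    prefactor₁ (suc q) * (summand₁ j (suc q) (i ℕ.+ l) * hyp₁ j (i ℕ.+ l) l) ≡ c i * tHalfTerm (j ℕ.∸ 2 ℕ.* i) (suc q) l
  term i l 2[i+l]≤j = subst (λ J → prefactor₁ (suc q) * (summand₁ J (suc q) (i ℕ.+ l) * hyp₁ J (i ℕ.+ l) l)
                                  ≡ ι ((J ℕ.∸ i) C i) * (two * inv (two ^ (J ℕ.∸ 2 ℕ.* i) * oddFactorial (suc q))) * tHalfTerm (J ℕ.∸ 2 ℕ.* i) (suc q) l)
                            (ℕP.m∸n+n≡m 2[i+l]≤j) (rhs₁-term (j ℕ.∸ 2 ℕ.* (i ℕ.+ l)) i l q)
  row : ∀ i → i ≤ M → sumTo (M ℕ.∸ i) (λ l → c i * tHalfTerm (j ℕ.∸ 2 ℕ.* i) (suc q) l) ≡ fibTerm (suc q) j i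
  row i i≤M = begin
    sumTo (M ℕ.∸ i) (λ l → c i * tHalfTerm p (suc q) l)
      ≡⟨ sumTo-*ˡ (M ℕ.∸ i) (c i) (tHalfTerm p (suc q)) ⟩
    c i * sumTo (M ℕ.∸ i) (tHalfTerm p (suc q))
      ≡⟨ cong (λ z → c i * sumTo z (tHalfTerm p (suc q))) (⌊n∸2i/2⌋≡⌊n/2⌋∸i j i (i≤⌊n/2⌋⇒2i≤n j i≤M)) ⟨
    c i * sumTo ⌊ p /2⌋ (tHalfTerm p (suc q))
      ≡⟨ solve 4 (λ C t iv S → C :* (t :* iv) :* S := C :* (iv :* (t :* S))) refl (ι ((j ℕ.∸ i) C i)) two (inv K) (sumTo ⌊ p /2⌋ (tHalfTerm p (suc q))) ⟩
    ι ((j ℕ.∸ i) C i) * (inv K * (two * sumTo ⌊ p /2⌋ (tHalfTerm p (suc q))))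
      ≡⟨ cong (λ z → ι ((j ℕ.∸ i) C i) * (inv K * z)) (trans (tHalfSum p (suc q)) (TBinomial.binomialSum-closed p (suc q))) ⟩
    ι ((j ℕ.∸ i) C i) * (inv K * (K * falling (ι p) (suc q)))
      ≡⟨ cong (ι ((j ℕ.∸ i) C i) *_) (inv-cancelˡ K (falling (ι p) (suc q)) (*-≢0 (two ^ p) (oddFactorial (suc q)) (^-≢0 two p two≢0) (oddFactorial≢0 (suc q)))) ⟩
    fibTerm (suc q) j i ∎
    where
    p = j ℕ.∸ 2 ℕ.* i
    K = two ^ p * oddFactorial (suc q)

rhs₂≡fibSum : ∀ j q → rhs2 j (suc q) ≡ fibSum j (suc q)
rhs₂≡fibSum j q = begin
  prefactor₂ j (suc q) * sumTo M (λ m → summand₂ j (suc q) m * sumTo m (hyp₂ j m))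
    ≡⟨ sumTo-*ˡ² M (prefactor₂ j (suc q)) (summand₂ j (suc q)) (hyp₂ j) ⟩
  sumTo M (λ m → sumTo m (λ k → prefactor₂ j (suc q) * (summand₂ j (suc q) m * hyp₂ j m k)))
    ≡⟨ sumTo-triangle′ M (λ m k → prefactor₂ j (suc q) * (summand₂ j (suc q) m * hyp₂ j m k)) ⟩
  sumTo M (λ i → sumTo (M ℕ.∸ i) (λ l → prefactor₂ j (suc q) * (summand₂ j (suc q) (i ℕ.+ l) * hyp₂ j (i ℕ.+ l) i)))
    ≡⟨ sumTo-cong M (λ i i≤M → sumTo-cong (M ℕ.∸ i) (λ l l≤M∸i → term i l (2[i+l]≤j j i l i≤M l≤M∸i))) ⟩
  sumTo M (λ i → sumTo (M ℕ.∸ i) (λ l → c i * uHalfTerm (j ℕ.∸ 2 ℕ.* i) (suc q) l))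
    ≡⟨ sumTo-cong M row ⟩
  fibSum j (suc q) ∎
  where
  M = ⌊ j /2⌋
  c : ℕ → ℚ
  c i = ι ((j ℕ.∸ i) C i) * (inv (two ^ (j ℕ.∸ 2 ℕ.* i) * oddFactorial (suc (suc q))) * inv (ι (suc (j ℕ.∸ 2 ℕ.* i))))
  term : ∀ i l → 2 ℕ.* (i ℕ.+ l) ≤ j →
    prefactor₂ j (suc q) * (summand₂ j (suc q) (i ℕ.+ l) * hyp₂ j (i ℕ.+ l) i) ≡ c i * uHalfTerm (j ℕ.∸ 2 ℕ.* i) (suc q) l
  term i l 2[i+l]≤j = subst (λ J → prefactor₂ J (suc q) * (summand₂ J (suc q) (i ℕ.+ l) * hyp₂ J (i ℕ.+ l) i)
                                  ≡ ι ((J ℕ.∸ i) C i) * (inv (two ^ (J ℕ.∸ 2 ℕ.* i) * oddFactorial (suc (suc q))) * inv (ι (suc (J ℕ.∸ 2 ℕ.* i)))) * uHalfTerm (J ℕ.∸ 2 ℕ.* i) (suc q) l)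
                            (ℕP.m∸n+n≡m 2[i+l]≤j) (rhs₂-term (j ℕ.∸ 2 ℕ.* (i ℕ.+ l)) i l q)
  row : ∀ i → i ≤ M → sumTo (M ℕ.∸ i) (λ l → c i * uHalfTerm (j ℕ.∸ 2 ℕ.* i) (suc q) l) ≡ fibTerm (suc q) j i
  row i i≤M = begin
    sumTo (M ℕ.∸ i) (λ l → c i * uHalfTerm p (suc q) l)
      ≡⟨ sumTo-*ˡ (M ℕ.∸ i) (c i) (uHalfTerm p (suc q)) ⟩
    c i * sumTo (M ℕ.∸ i) (uHalfTerm p (suc q))
      ≡⟨ cong (λ z → c i * sumTo z (uHalfTerm p (suc q))) (⌊n∸2i/2⌋≡⌊n/2⌋∸i j i (i≤⌊n/2⌋⇒2i≤n j i≤M)) ⟨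
    c i * sumTo ⌊ p /2⌋ (uHalfTerm p (suc q))
      ≡⟨ cong (c i *_) (trans (uHalfSum p (suc q)) (cong (ι (suc p) *_) (UBinomial.binomialSum-closed p (suc q)))) ⟩
    ι ((j ℕ.∸ i) C i) * (inv K * inv (ι (suc p))) * (ι (suc p) * (K * falling (ι p) (suc q)))
      ≡⟨ solve 5 (λ C iK iZ Z F → C :* (iK :* iZ) :* (Z :* F) := C :* ((iK :* F) :* (Z :* iZ))) refl (ι ((j ℕ.∸ i) C i)) (inv K) (inv (ι (suc p))) (ι (suc p)) (K * falling (ι p) (suc q)) ⟩
    ι ((j ℕ.∸ i) C i) * (inv K * (K * falling (ι p) (suc q)) * (ι (suc p) * inv (ι (suc p))))
      ≡⟨ cong₂ (λ u v → ι ((j ℕ.∸ i) C i) * (u * v)) (inv-cancelˡ K (falling (ι p) (suc q)) K≢0) (inv-inverseʳ (ι (suc p)) (ι-suc≢0 p)) ⟩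
    ι ((j ℕ.∸ i) C i) * (falling (ι p) (suc q) * 1ℚ)
      ≡⟨ cong (ι ((j ℕ.∸ i) C i) *_) (QP.*-identityʳ (falling (ι p) (suc q))) ⟩
    fibTerm (suc q) j i ∎
    where
    p = j ℕ.∸ 2 ℕ.* i
    K = two ^ p * oddFactorial (suc (suc q))
    K≢0 : K ≢ 0ℚ
    K≢0 = *-≢0 (two ^ p) (oddFactorial (suc (suc q))) (^-≢0 two p two≢0) (oddFactorial≢0 (suc (suc q)))

corollary6 : (j q : ℕ) → 1 ≤ q →
    (ι (fibD q (suc j)) ≡ rhs1 j q) × (ι (fibD q (suc j)) ≡ rhs2 j q)
corollary6 j (suc q) _ = trans (fibD≡fibSum j (suc q)) (sym (rhs₁≡fibSum j q))
                       , trans (fibD≡fibSum j (suc q)) (sym (rhs₂≡fibSum j q))
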